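{- Let $n\ge1$, $0\le r\le n-1$, and let $\Gamma$ be any composite of $r$ maps each equal to $\Delta$ or $\Delta'$. Then $${}^{r}\!A_n(t)=\theta\Gamma E\mathfrak S_n=\theta\Gamma(D+D')\mathfrak S_n=\theta\Gamma M\mathfrak S_n=\theta\Gamma\Delta E\,\mathcal C_{n+1}=\theta\Gamma\Delta D\,\mathfrak S_{n+1}',$$ and moreover ${}^{r}\!A_n(t)=\theta\Gamma D\mathfrak S_n$ holds if and only if $\Gamma$ contains at least one factor $\Delta$.
   Context: $[n]=\{1,\dots,n\}$, $\mathfrak S_n$ symmetric group on $[n]$, $x_+=\max\{0,x\}$. For $\sigma\in\mathfrak S_n$ (conventions $\sigma(0)=\sigma^{ -1}(0)=\sigma(n+1)=0$), vectors in $\mathbb N^n$: $E\sigma(k)=(\sigma(k)-(k-1))_+$; $D\sigma(k)=(\sigma(\sigma^{ -1}(k)-1)-(k-1))_+$; $M\sigma(k)=(\sigma(\sigma^{ -1}(k-1)+1)-(k-1))_+$. An entry $\tau(i)$ is saillant if $\tau(i')<\tau(i)$ for all $i'<i$; $D'\tau(j)=1$ if the value $j$ is saillant and either $\tau^{ -1}(j)=n$ or ($\tau^{ -1}(j)\le n-1$ and $\tau(\tau^{ -1}(j)+1)$ is saillant), and $D'\tau(j)=0$ otherwise; $(D+D')\tau=D\tau+D'\tau$ coordinatewise. For $p\ge1$, $\Delta(x_1,\dots,x_p)=((x_1-1)_+,\dots,(x_{p-1}-1)_+)$ and $\Delta'(x_1,\dots,x_p)=(x_2,\dots,x_p)$.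 For $x\in\mathbb N^p$, $|x|$ is the number of positive coordinates; for a set $P$ of permutations and a map $K$ into vectors, $\theta KP=\sum_{\sigma\in P}t^{|K\sigma|}$. $\mathcal C_{n+1}$ is the set of cyclic permutations of $[n+1]$ and $\mathfrak S'_{n+1}=\{\sigma\in\mathfrak S_{n+1}:\sigma(1)=n+1\}$. The generalized Eulerian polynomial is ${}^{r}\!A_n(t)=\sum_{\sigma\in\mathfrak S_n}t^{|\{k\in[n]:\sigma(k)\ge k+r\}|}$ (equivalently $\theta\Delta^rE\mathfrak S_n$). -}

module Defs where

open import Data.Nat using (ℕ; zero; suc; _+_; _∸_; _≡ᵇ_; _<ᵇ_; _≤ᵇ_)
open import Data.Bool using (Bool; true; false; if_then_else_; _∧_; _∨_; not)
open import Data.List using (List; []; _∷_; map; length; upTo; concatMap; foldr)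

allB : {A : Set} → (A → Bool) → List A → Bool
allB p [] = true
allB p (x ∷ xs) = p x ∧ allB p xs

anyB : {A : Set} → (A → Bool) → List A → Bool
anyB p [] = false
anyB p (x ∷ xs) = p x ∨ anyB p xs

filterB : {A : Set} → (A → Bool) → List A → List A
filterB p [] = []
filterB p (x ∷ xs) = if p x then x ∷ filterB p xs else filterB p xs

countB : {A : Set} → (A → Bool) → List A → ℕ
countB p [] = 0
countB p (x ∷ xs) = (if p x then 1 else 0) + countB p xs

-- Permutations of [n] are represented in one-line notation as lists
-- σ = [σ(1), …, σ(n)] of natural numbers (values 1..n).

-- σ(i) with 1-based index; σ(0) = σ(n+1) = 0 (and 0 beyond the range).
at : List ℕ → ℕ → ℕ
at xs zero = 0
at [] (suc i) = 0
at (x ∷ xs) (suc zero) = x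
at (x ∷ xs) (suc (suc i)) = at xs (suc i)

-- σ⁻¹(k), 1-based; 0 if k does not occur (in particular σ⁻¹(0) = 0).
pos : List ℕ → ℕ → ℕ
pos [] k = 0
pos (x ∷ xs) k = if x ≡ᵇ k then 1 else (if pos xs k ≡ᵇ 0 then 0 else suc (pos xs k))

insertAll : ℕ → List ℕ → List (List ℕ)
insertAll a [] = (a ∷ []) ∷ []
insertAll a (x ∷ xs) = (a ∷ x ∷ xs) ∷ map (x ∷_) (insertAll a xs)

Perms : ℕ → List (List ℕ)
Perms zero = [] ∷ []
Perms (suc n) = concatMap (insertAll (suc n)) (Perms n)

-- 𝔖'_{n+1} = {σ ∈ 𝔖_{n+1} : σ(1) = n+1}
PermsTop : ℕ → List (List ℕ)
PermsTop n = filterB (λ σ → at σ 1 ≡ᵇ suc n) (Perms (suc n))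

iter : List ℕ → ℕ → ℕ → ℕ
iter σ zero x = x
iter σ (suc k) x = at σ (iter σ k x)

-- σ ∈ 𝔖_m is cyclic (a single m-cycle) iff σ^k(1) ≠ 1 for 1 ≤ k ≤ m-1.
isCyclic : List ℕ → Bool
isCyclic σ = allB (λ k → not (iter σ (suc k) 1 ≡ᵇ 1)) (upTo (length σ ∸ 1))

-- 𝒞_{n+1}: cyclic permutations of [n+1]
Cyc : ℕ → List (List ℕ)
Cyc n = filterB isCyclic (Perms (suc n))

-- E σ(k) = (σ(k) - (k-1))₊ , k = 1..n   (here k = suc i)
E : List ℕ → List ℕ
E σ = map (λ i → at σ (suc i) ∸ i) (upTo (length σ))

-- D σ(k) = (σ(σ⁻¹(k) - 1) - (k-1))₊
D : List ℕ → List ℕ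
D σ = map (λ i → at σ (pos σ (suc i) ∸ 1) ∸ i) (upTo (length σ))

-- M σ(k) = (σ(σ⁻¹(k-1) + 1) - (k-1))₊
M : List ℕ → List ℕ
M σ = map (λ i → at σ (suc (pos σ i)) ∸ i) (upTo (length σ))

saillantAt : List ℕ → ℕ → Bool
saillantAt σ p = allB (λ q → at σ (suc q) <ᵇ at σ p) (upTo (p ∸ 1))

D' : List ℕ → List ℕ
D' τ = map f (upTo (length τ))
  where
  f : ℕ → ℕ
  f i = if saillantAt τ (pos τ (suc i)) ∧
           ((pos τ (suc i) ≡ᵇ length τ) ∨
            ((pos τ (suc i) ≤ᵇ (length τ ∸ 1)) ∧ saillantAt τ (suc (pos τ (suc i)))))
        then 1 else 0

_⊕_ : List ℕ → List ℕ → List ℕ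
[] ⊕ ys = ys
(x ∷ xs) ⊕ [] = x ∷ xs
(x ∷ xs) ⊕ (y ∷ ys) = (x + y) ∷ (xs ⊕ ys)

DD' : List ℕ → List ℕ
DD' τ = D τ ⊕ D' τ

dropLast : List ℕ → List ℕ
dropLast [] = []
dropLast (x ∷ []) = []
dropLast (x ∷ y ∷ xs) = x ∷ dropLast (y ∷ xs)

Δ : List ℕ → List ℕ
Δ xs = map (λ x → x ∸ 1) (dropLast xs)

Δ' : List ℕ → List ℕ
Δ' [] = []
Δ' (x ∷ xs) = xs

data Op : Set where
  δ δ' : Op

applyOp : Op → List ℕ → List ℕ
applyOp δ = Δ
applyOp δ' = Δ'

-- Γ = [g₁, …, g_r] denotes the composite g₁ ∘ ⋯ ∘ g_r
applyΓ : List Op → List ℕ → List ℕ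
applyΓ Γ xs = foldr applyOp xs Γ

isΔ : Op → Bool
isΔ δ = true
isΔ δ' = false

∣_∣⁺ : List ℕ → ℕ
∣ xs ∣⁺ = countB (λ x → 1 ≤ᵇ x) xs

-- θ K P, represented by its coefficient sequence: coefficient of t^k
θ : (List ℕ → List ℕ) → List (List ℕ) → ℕ → ℕ
θ K P k = countB (λ σ → ∣ K σ ∣⁺ ≡ᵇ k) P

-- ^r A_n(t): coefficient of t^k is #{σ ∈ 𝔖_n : #{i : σ(i) ≥ i + r} = k}
excR : ℕ → List ℕ → ℕ
excR r σ = countB (λ i → (suc i + r) ≤ᵇ at σ (suc i)) (upTo (length σ))

A : ℕ → ℕ → ℕ → ℕ
A r n k = countB (λ σ → excR r σ ≡ᵇ k) (Perms n)

-- Write a and b for the numbers of factors Δ and Δ′ in Γ.  Since Δ′ drops the first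
-- coordinate while Δ drops the last one and lowers the others by one, the positive
-- coordinates of Γ x are the x_i with i > b and x_i > a; this turns each |Γ K σ| into a
-- count of big rises or big drops of σ.  Each family is then generated from the
-- permutations of [n] by adding the letter n + 1 in n + 1 ways (at a position, into a
-- cycle, or by a rotation), chosen so that every child of a parent with statistic s has
-- statistic s or s + 1, exactly (n + 1 − r) − s of them s + 1.  Counting children gives
-- one recurrence Arec for all the coefficient sequences, and ^rA_n is itself the case
-- a = r, b = 0 of the family for E.  For D + D′ with no Δ in Γ, repeatedly moving the
-- maximum turns the statistic into a big-drop count; once Γ contains Δ, D′ never changes
-- it.  Without Δ, |Γ D σ| ≤ n − 1 − r, so the coefficient of t^(n−r), positive in ^rA_n,
-- vanishes.

module Submission where

open import Defs
open import Data.Bool using (Bool; true; false; if_then_else_; _∧_; _∨_; not; T)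
open import Data.Bool.Properties using (∧-identityʳ; ∨-identityʳ)
open import Data.Empty using (⊥; ⊥-elim)
open import Data.List using (List; []; _∷_; map; length; upTo; concatMap; foldr; _++_; _∷ʳ_; [_])
open import Data.List.Membership.DecPropositional using (_∈?_)
open import Data.List.Membership.Propositional using (_∈_; _∉_)
open import Data.List.Membership.Propositional.Properties using (∈-∃++; ∈-++⁻; ∈-++⁺ˡ; ∈-++⁺ʳ; ∈-map⁺; ∈-map⁻; ∈-upTo⁻; ∈-upTo⁺)
open import Data.List.Properties using (map-upTo; upTo-∷ʳ; map-++; map-∘; map-cong; ++-assoc; ++-identityʳ; length-map; length-upTo; length-++; foldr-++; ∷ʳ-injective)
open import Data.List.Relation.Binary.Permutation.Propositional using (_↭_; prep; swap; ↭-sym; ↭-reflexive) renaming (refl to ↭-refl; trans to ↭-trans)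
open import Data.List.Relation.Binary.Permutation.Propositional.Properties using (shift; ↭-length; drop-mid; All-resp-↭; ∈-resp-↭; ++⁺ʳ; ++⁺ˡ; ++-comm)
open import Data.List.Relation.Unary.All using (All; []; _∷_)
import Data.List.Relation.Unary.All as All
import Data.List.Relation.Unary.All.Properties as AllP
open import Data.List.Relation.Unary.AllPairs using ([]; _∷_)
open import Data.List.Relation.Unary.Any using (here; there)
open import Data.List.Relation.Unary.Unique.Propositional using (Unique)
import Data.List.Relation.Unary.Unique.Propositional.Properties as UP
open import Data.Nat using (ℕ; zero; suc; _+_; _*_; _∸_; _≤_; _<_; z≤n; s≤s; _≡ᵇ_; _<ᵇ_; _≤ᵇ_; _⊔_)
open import Data.Nat.ListAction using (sum)
open import Data.Nat.ListAction.Properties using (sum-++)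
open import Data.Nat.Properties
open import Algebra.Properties.CommutativeSemigroup +-commutativeSemigroup using (interchange)
open import Data.Nat.Tactic.RingSolver using (solve-∀)
open import Data.Product using (Σ; ∃; _×_; _,_; proj₁; proj₂)
import Data.Product as Product
open import Data.Sum using (_⊎_; inj₁; inj₂)
open import Data.Unit using (tt)
open import Function using (_∘_; flip)
open import Function.Bundles using (_⇔_; mk⇔)
open import Relation.Binary.PropositionalEquality hiding ([_])
open import Relation.Nullary using (yes; no)

T⇒≡true : ∀ {b} → T b → b ≡ true
T⇒≡true {true} t = refl

≡true⇒T : ∀ {b} → b ≡ true → T b
≡true⇒T refl = tt

≤⇒≤ᵇ≡true : ∀ {m n} → m ≤ n → (m ≤ᵇ n) ≡ true
≤⇒≤ᵇ≡true p = T⇒≡true (≤⇒≤ᵇ p)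

≤ᵇ≡true⇒≤ : ∀ {m n} → (m ≤ᵇ n) ≡ true → m ≤ n
≤ᵇ≡true⇒≤ {m} {n} e = ≤ᵇ⇒≤ m n (≡true⇒T e)

>⇒≤ᵇ≡false : ∀ {m n} → n < m → (m ≤ᵇ n) ≡ false
>⇒≤ᵇ≡false {m} {n} p with m ≤ᵇ n in eq
... | true = ⊥-elim (<⇒≱ p (≤ᵇ≡true⇒≤ eq))
... | false = refl

<⇒<ᵇ≡true : ∀ {m n} → m < n → (m <ᵇ n) ≡ true
<⇒<ᵇ≡true p = T⇒≡true (<⇒<ᵇ p)

<ᵇ≡true⇒< : ∀ {m n} → (m <ᵇ n) ≡ true → m < n
<ᵇ≡true⇒< {m} {n} e = <ᵇ⇒< m n (≡true⇒T e)

≥⇒<ᵇ≡false : ∀ {m n} → n ≤ m → (m <ᵇ n) ≡ false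
≥⇒<ᵇ≡false {m} {n} p with m <ᵇ n in eq
... | true = ⊥-elim (<⇒≱ (<ᵇ≡true⇒< eq) p)
... | false = refl

≡⇒≡ᵇ≡true : ∀ {m n} → m ≡ n → (m ≡ᵇ n) ≡ true
≡⇒≡ᵇ≡true {zero} refl = refl
≡⇒≡ᵇ≡true {suc m} refl = ≡⇒≡ᵇ≡true {m} refl

≡ᵇ≡true⇒≡ : ∀ {m n} → (m ≡ᵇ n) ≡ true → m ≡ n
≡ᵇ≡true⇒≡ {zero} {zero} e = refl
≡ᵇ≡true⇒≡ {suc m} {suc n} e = cong suc (≡ᵇ≡true⇒≡ e)

≢⇒≡ᵇ≡false : ∀ {m n} → m ≢ n → (m ≡ᵇ n) ≡ false
≢⇒≡ᵇ≡false {m} {n} ne with m ≡ᵇ n in eq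
... | true = ⊥-elim (ne (≡ᵇ≡true⇒≡ eq))
... | false = refl

≡ᵇ≡false⇒≢ : ∀ {m n} → (m ≡ᵇ n) ≡ false → m ≢ n
≡ᵇ≡false⇒≢ {m} e refl with () ← trans (sym e) (≡⇒≡ᵇ≡true {m} refl)

∧≡true⇒ : ∀ {a b} → (a ∧ b) ≡ true → (a ≡ true) × (b ≡ true)
∧≡true⇒ {true} {true} e = refl , refl

ι : Bool → ℕ
ι b = if b then 1 else 0

ι≤1 : ∀ b → ι b ≤ 1
ι≤1 true = s≤s z≤n
ι≤1 false = z≤n

ι-mono : ∀ {x y} → (x ≡ true → y ≡ true) → ι x ≤ ι y
ι-mono {false} h = z≤n
ι-mono {true} h rewrite h refl = ≤-refl

∧-intro : ∀ {x y} → x ≡ true → y ≡ true → (x ∧ y) ≡ true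
∧-intro refl refl = refl

∧-falseʳ : ∀ x {y} → y ≡ false → (x ∧ y) ≡ false
∧-falseʳ true refl = refl
∧-falseʳ false refl = refl

not≡true⇒ : ∀ {b} → not b ≡ true → b ≡ false
not≡true⇒ {false} e = refl

not≡false⇒ : ∀ {b} → not b ≡ false → b ≡ true
not≡false⇒ {true} e = refl

≤ᵇ-suc : ∀ m n → (suc m ≤ᵇ suc n) ≡ (m ≤ᵇ n)
≤ᵇ-suc zero n = refl
≤ᵇ-suc (suc m) n = refl

≤ᵇ-∸ : ∀ a P i → (suc a ≤ᵇ (P ∸ i)) ≡ (suc i + a ≤ᵇ P)
≤ᵇ-∸ a P zero = refl
≤ᵇ-∸ a zero (suc i) = refl
≤ᵇ-∸ a (suc P) (suc i) = trans (≤ᵇ-∸ a P i) (sym (≤ᵇ-suc (suc i + a) P))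

1≤ᵇ∸ : ∀ a x → (1 ≤ᵇ (x ∸ a)) ≡ (suc a ≤ᵇ x)
1≤ᵇ∸ zero x = refl
1≤ᵇ∸ (suc a) zero = refl
1≤ᵇ∸ (suc a) (suc x) = 1≤ᵇ∸ a x

1≤ᵇ+ι : ∀ x c → (1 ≤ᵇ (x + ι c)) ≡ ((1 ≤ᵇ x) ∨ c)
1≤ᵇ+ι zero true = refl
1≤ᵇ+ι zero false = refl
1≤ᵇ+ι (suc x) c = refl

≢⇒≤ᵇ≡suc-≤ᵇ : ∀ {x u} → x ≢ u → (x ≤ᵇ u) ≡ (suc x ≤ᵇ u)
≢⇒≤ᵇ≡suc-≤ᵇ {x} {u} ne with x ≤? u
... | yes le = trans (≤⇒≤ᵇ≡true le) (sym (≤⇒≤ᵇ≡true (≤∧≢⇒< le ne)))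
... | no nle = trans (>⇒≤ᵇ≡false (≰⇒> nle)) (sym (>⇒≤ᵇ≡false (≤-trans (≰⇒> nle) (n≤1+n x))))

⊔<ᵇ : ∀ a b c → ((a ⊔ b) <ᵇ c) ≡ ((a <ᵇ c) ∧ (b <ᵇ c))
⊔<ᵇ a b c with ≤-total a b
... | inj₁ a≤b rewrite m≤n⇒m⊔n≡n a≤b = both
  where
  both : (b <ᵇ c) ≡ ((a <ᵇ c) ∧ (b <ᵇ c))
  both with b <ᵇ c in e
  ... | true = sym (cong (λ t → t ∧ true) (<⇒<ᵇ≡true {a} {c} (≤-<-trans a≤b (<ᵇ≡true⇒< e))))
  ... | false = sym (∧-falseʳ (a <ᵇ c) refl)
... | inj₂ b≤a rewrite m≥n⇒m⊔n≡m b≤a = both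
  where
  both : (a <ᵇ c) ≡ ((a <ᵇ c) ∧ (b <ᵇ c))
  both with a <ᵇ c in e
  ... | true = sym (cong (λ t → true ∧ t) (<⇒<ᵇ≡true {b} {c} (≤-<-trans b≤a (<ᵇ≡true⇒< e))))
  ... | false = refl

<ᵇ-∧-⊔<ᵇ : ∀ M x y → ((M <ᵇ x) ∧ ((M ⊔ x) <ᵇ y)) ≡ ((M <ᵇ x) ∧ (x <ᵇ y))
<ᵇ-∧-⊔<ᵇ M x y rewrite ⊔<ᵇ M x y with M <ᵇ x in e1
... | false = refl
... | true with x <ᵇ y in e2
... | false = ∧-falseʳ (M <ᵇ y) refl
... | true = cong (λ t → t ∧ true) (<⇒<ᵇ≡true {M} {y} (<-trans (<ᵇ≡true⇒< e1) (<ᵇ≡true⇒< e2)))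

≡ᵇ-suc-+ : ∀ m k → (suc m ≡ᵇ m + suc (suc k)) ≡ false
≡ᵇ-suc-+ m k = ≢⇒≡ᵇ≡false (λ e → m≢1+m+n m (trans (suc-injective (trans e (+-suc m (suc k)))) (+-suc m k)))

suc≤+2+∸1 : ∀ m k → suc m ≤ m + suc (suc k) ∸ 1
suc≤+2+∸1 m k rewrite +-suc m (suc k) = ≤-trans (≤-reflexive (+-comm 1 m)) (+-monoʳ-≤ m (s≤s z≤n))

m∸[m∸n]≤n : ∀ m n → m ∸ (m ∸ n) ≤ n
m∸[m∸n]≤n m n with n ≤? m
... | yes n≤m = ≤-reflexive (m∸[m∸n]≡n n≤m)
... | no n≰m rewrite m≤n⇒m∸n≡0 (<⇒≤ (≰⇒> n≰m)) = <⇒≤ (≰⇒> n≰m)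

suc<⇒<∸1 : ∀ {k n} → suc k < n → k < n ∸ 1
suc<⇒<∸1 {k} {suc n} (s≤s le) = le

<∸1⇒suc< : ∀ {k n} → k < n ∸ 1 → suc k < n
<∸1⇒suc< {k} {suc n} le = s≤s le

countB-++ : ∀ {A : Set} (p : A → Bool) xs ys → countB p (xs ++ ys) ≡ countB p xs + countB p ys
countB-++ p [] ys = refl
countB-++ p (x ∷ xs) ys rewrite countB-++ p xs ys = sym (+-assoc (ι (p x)) _ _)

countB-map : ∀ {A B : Set} (p : B → Bool) (f : A → B) xs → countB p (map f xs) ≡ countB (p ∘ f) xs
countB-map p f [] = refl
countB-map p f (x ∷ xs) = cong (ι (p (f x)) +_) (countB-map p f xs)

sumL : ∀ {A : Set} → (A → ℕ) → List A → ℕ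
sumL g [] = 0
sumL g (x ∷ xs) = g x + sumL g xs

countB-concatMap : ∀ {A B : Set} (p : B → Bool) (f : A → List B) xs →
  countB p (concatMap f xs) ≡ sumL (λ x → countB p (f x)) xs
countB-concatMap p f [] = refl
countB-concatMap p f (x ∷ xs) = trans (countB-++ p (f x) _) (cong (countB p (f x) +_) (countB-concatMap p f xs))

sumL-ext : ∀ {A : Set} {f g : A → ℕ} xs → (∀ x → x ∈ xs → f x ≡ g x) → sumL f xs ≡ sumL g xs
sumL-ext [] h = refl
sumL-ext (x ∷ xs) h = cong₂ _+_ (h x (here refl)) (sumL-ext xs (λ y m → h y (there m)))

countB-ext : ∀ {A : Set} {p q : A → Bool} xs → (∀ x → x ∈ xs → p x ≡ q x) → countB p xs ≡ countB q xs
countB-ext [] h = refl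
countB-ext (x ∷ xs) h = cong₂ _+_ (cong ι (h x (here refl))) (countB-ext xs (λ y m → h y (there m)))

countB-↭ : ∀ {A : Set} (p : A → Bool) {xs ys} → xs ↭ ys → countB p xs ≡ countB p ys
countB-↭ p ↭-refl = refl
countB-↭ p (prep x r) = cong (ι (p x) +_) (countB-↭ p r)
countB-↭ p {x ∷ y ∷ xs} {.y ∷ .x ∷ ys} (swap .x .y r) = trans (sym (+-assoc (ι (p x)) (ι (p y)) (countB p xs)))
  (trans (cong (_+ countB p xs) (+-comm (ι (p x)) (ι (p y)))) (trans (+-assoc (ι (p y)) _ _)
    (cong (λ z → ι (p y) + (ι (p x) + z)) (countB-↭ p r))))
countB-↭ p (↭-trans r s) = trans (countB-↭ p r) (countB-↭ p s)

countB-filterB : ∀ {A : Set} (p q : A → Bool) xs → countB p (filterB q xs) ≡ countB (λ x → q x ∧ p x) xs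
countB-filterB p q [] = refl
countB-filterB p q (x ∷ xs) with q x
... | true = cong (ι (p x) +_) (countB-filterB p q xs)
... | false = countB-filterB p q xs

countB≤length : ∀ {A : Set} (p : A → Bool) xs → countB p xs ≤ length xs
countB≤length p [] = z≤n
countB≤length p (x ∷ xs) with p x
... | true = s≤s (countB≤length p xs)
... | false = m≤n⇒m≤1+n (countB≤length p xs)

∈⇒1≤countB : ∀ {A : Set} (p : A → Bool) {x} xs → x ∈ xs → p x ≡ true → 1 ≤ countB p xs
∈⇒1≤countB p (y ∷ xs) (here refl) px rewrite px = s≤s z≤n
∈⇒1≤countB p (y ∷ xs) (there m) px = ≤-trans (∈⇒1≤countB p xs m px) (m≤n+m _ (ι (p y)))

countB-none : ∀ {A : Set} (p : A → Bool) xs → (∀ x → x ∈ xs → p x ≡ false) → countB p xs ≡ 0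
countB-none p [] h = refl
countB-none p (x ∷ xs) h rewrite h x (here refl) = countB-none p xs (λ y m → h y (there m))

sumL-filterB : ∀ {A : Set} (f : A → ℕ) (q : A → Bool) L → sumL f (filterB q L) ≡ sumL (λ y → if q y then f y else 0) L
sumL-filterB f q [] = refl
sumL-filterB f q (x ∷ L) with q x
... | true = cong (f x +_) (sumL-filterB f q L)
... | false = sumL-filterB f q L

∈-filterB : ∀ {A : Set} (q : A → Bool) L {x} → x ∈ filterB q L → x ∈ L × q x ≡ true
∈-filterB q (y ∷ L) m with q y in e
∈-filterB q (y ∷ L) (here refl) | true = here refl , e
∈-filterB q (y ∷ L) (there m) | true with ∈-filterB q L m
... | m' , e' = there m' , e'
∈-filterB q (y ∷ L) m | false with ∈-filterB q L m
... | m' , e' = there m' , e'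

allB-map : ∀ {A B : Set} (p : B → Bool) (f : A → B) xs → allB p (map f xs) ≡ allB (p ∘ f) xs
allB-map p f [] = refl
allB-map p f (x ∷ xs) = cong (p (f x) ∧_) (allB-map p f xs)

allB-ext : ∀ {A : Set} {p q : A → Bool} xs → (∀ x → p x ≡ q x) → allB p xs ≡ allB q xs
allB-ext [] h = refl
allB-ext (x ∷ xs) h = cong₂ _∧_ (h x) (allB-ext xs h)

allB-∀ : ∀ {A : Set} (p : A → Bool) xs → allB p xs ≡ true → ∀ {x} → x ∈ xs → p x ≡ true
allB-∀ p (y ∷ xs) e (here refl) = proj₁ (∧≡true⇒ {p y} e)
allB-∀ p (y ∷ xs) e (there m) = allB-∀ p xs (proj₂ (∧≡true⇒ {p y} e)) m

allB-∀⁻ : ∀ {A : Set} (p : A → Bool) xs → (∀ {x} → x ∈ xs → p x ≡ true) → allB p xs ≡ true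
allB-∀⁻ p [] h = refl
allB-∀⁻ p (y ∷ xs) h rewrite h (here refl) = allB-∀⁻ p xs (λ m → h (there m))

allB-∃ : ∀ {A : Set} (p : A → Bool) xs → allB p xs ≡ false → ∃ λ x → x ∈ xs × p x ≡ false
allB-∃ p (y ∷ xs) e with p y in e1
... | false = y , here refl , e1
... | true with allB-∃ p xs e
... | x , m , px = x , there m , px

allB-∃⁻ : ∀ {A : Set} (p : A → Bool) xs {x} → x ∈ xs → p x ≡ false → allB p xs ≡ false
allB-∃⁻ p (y ∷ xs) (here refl) px rewrite px = refl
allB-∃⁻ p (y ∷ xs) (there m) px rewrite allB-∃⁻ p xs m px = ∧-falseʳ (p y) refl

allB-last : ∀ (p : ℕ → Bool) m → allB p (upTo (suc m)) ≡ true → p m ≡ true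
allB-last p m e = go (upTo m) e'
  where
  e' : allB p (upTo m ++ [ m ]) ≡ true
  e' = trans (cong (allB p) (upTo-∷ʳ m)) e
  go : ∀ xs → allB p (xs ++ [ m ]) ≡ true → p m ≡ true
  go [] e'' with p m
  go [] refl | true = refl
  go (x ∷ xs) e'' = go xs (proj₂ (∧≡true⇒ {p x} e''))

firstWitness : ∀ (p : ℕ → Bool) K → (∃ λ i → i < K × p i ≡ true) →
  ∃ λ i → i < K × p i ≡ true × (∀ i' → i' < i → p i' ≡ false)
firstWitness p (suc K) (i , i< , pi) with p 0 in e0
... | true = 0 , s≤s z≤n , e0 , (λ i' ())
... | false with i
... | zero with () ← trans (sym e0) pi
... | suc i' with firstWitness (λ t → p (suc t)) K (i' , ≤-pred i< , pi)
... | j , j< , pj , earlier-false = suc j , s≤s j< , pj , earlier-false′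
  where
  earlier-false′ : ∀ i'' → i'' < suc j → p i'' ≡ false
  earlier-false′ zero _ = e0
  earlier-false′ (suc i'') (s≤s lt) = earlier-false i'' lt

length-∷ʳ : ∀ {A : Set} (xs : List A) x → length (xs ∷ʳ x) ≡ suc (length xs)
length-∷ʳ xs x = trans (length-++ xs) (+-comm (length xs) 1)

map-cong-∈ : ∀ {A B : Set} {f g : A → B} (xs : List A) → (∀ x → x ∈ xs → f x ≡ g x) → map f xs ≡ map g xs
map-cong-∈ [] h = refl
map-cong-∈ (x ∷ xs) h = cong₂ _∷_ (h x (here refl)) (map-cong-∈ xs (λ y m → h y (there m)))

length-concatMap : ∀ {A B : Set} (f : A → List B) m L → (∀ x → x ∈ L → length (f x) ≡ m) → length (concatMap f L) ≡ length L * m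
length-concatMap f m [] h = refl
length-concatMap f m (x ∷ L) h = trans (length-++ (f x)) (cong₂ _+_ (h x (here refl)) (length-concatMap f m L (λ y my → h y (there my))))

∈-concatMap⁺ : ∀ {A B : Set} (f : A → List B) {x z} L → x ∈ L → z ∈ f x → z ∈ concatMap f L
∈-concatMap⁺ f (y ∷ L) (here refl) mz = ∈-++⁺ˡ mz
∈-concatMap⁺ f (y ∷ L) (there m) mz = ∈-++⁺ʳ (f y) (∈-concatMap⁺ f L m mz)

∈-concatMap⁻ : ∀ {A B : Set} (f : A → List B) {z} L → z ∈ concatMap f L → ∃ λ x → x ∈ L × z ∈ f x
∈-concatMap⁻ f (y ∷ L) m with ∈-++⁻ (f y) m
... | inj₁ m1 = y , here refl , m1
... | inj₂ m2 with ∈-concatMap⁻ f L m2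
... | x , mx , mz = x , there mx , mz

∉-++ʳ : ∀ {a : ℕ} p q → a ∉ p ++ q → a ∉ q
∉-++ʳ p q na m = na (∈-++⁺ʳ p m)

remove-∈ : ∀ {A : Set} {x : A} P → x ∈ P → Σ (List A) λ P' → (P ↭ x ∷ P') × (∀ {y} → y ∈ P → y ≢ x → y ∈ P')
remove-∈ {x = x} P m with ∈-∃++ m
... | P1 , P2 , refl = (P1 ++ P2) , shift x P1 P2 , f
  where
  f : ∀ {y} → y ∈ P1 ++ x ∷ P2 → y ≢ x → y ∈ P1 ++ P2
  f {y} m' ne with ∈-++⁻ P1 m'
  ... | inj₁ m1 = ∈-++⁺ˡ m1
  ... | inj₂ (here refl) = ⊥-elim (ne refl)
  ... | inj₂ (there m2) = ∈-++⁺ʳ P1 m2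

All≢-∈ : ∀ {A : Set} {x : A} {L y} → All (λ z → x ≢ z) L → y ∈ L → y ≢ x
All≢-∈ (px ∷ a) (here refl) eq = px (sym eq)
All≢-∈ (px ∷ a) (there m) = All≢-∈ a m

unique-⊆⇒length≤ : ∀ {A : Set} (L P : List A) → Unique L → (∀ {x} → x ∈ L → x ∈ P) → length L ≤ length P
unique-⊆⇒length≤ [] P u sub = z≤n
unique-⊆⇒length≤ (x ∷ L) P (ax ∷ u) sub with remove-∈ P (sub (here refl))
... | P' , r , f = ≤-trans (s≤s (unique-⊆⇒length≤ L P' u (λ m → f (sub (there m)) (All≢-∈ ax m))))
                            (≤-reflexive (sym (↭-length r)))

unique-⊆-length≥⇒countB≡ : ∀ {A : Set} (L P : List A) → Unique L → (∀ {x} → x ∈ L → x ∈ P) → length P ≤ length L →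
  ∀ q → countB q L ≡ countB q P
unique-⊆-length≥⇒countB≡ [] [] u sub le q = refl
unique-⊆-length≥⇒countB≡ [] (x ∷ P) u sub () q
unique-⊆-length≥⇒countB≡ (x ∷ L) P (ax ∷ u) sub le q with remove-∈ P (sub (here refl))
... | P' , r , f = trans (cong (ι (q x) +_) (unique-⊆-length≥⇒countB≡ L P' u sub' le' q)) (sym (countB-↭ q r))
  where
  sub' : ∀ {y} → y ∈ L → y ∈ P'
  sub' m = f (sub (there m)) (All≢-∈ ax m)
  le' : length P' ≤ length L
  le' = ≤-pred (≤-trans (≤-reflexive (↭-length (↭-sym r))) le)

unique-concatMap : ∀ {A B : Set} (f : A → List B) (g : B → A) L → Unique L →
  (∀ x → x ∈ L → Unique (f x)) → (∀ x z → x ∈ L → z ∈ f x → g z ≡ x) → Unique (concatMap f L)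
unique-concatMap f g [] u uf gi = []
unique-concatMap f g (x ∷ L) (ax ∷ u) uf gi = app (f x) (uf x (here refl)) (λ z m → gi x z (here refl) m)
  where
  rest : Unique (concatMap f L)
  rest = unique-concatMap f g L u (λ y m → uf y (there m)) (λ y z m → gi y z (there m))
  notin : ∀ z → g z ≡ x → z ∈ concatMap f L → ⊥
  notin z eq m = go L ax (λ y m' z' mz → gi y z' (there m') mz) m
    where
    go : ∀ L' → All (λ w → x ≢ w) L' → (∀ y → y ∈ L' → ∀ z' → z' ∈ f y → g z' ≡ y) → z ∈ concatMap f L' → ⊥
    go [] a h ()
    go (y ∷ L') (px ∷ a) h m' with ∈-++⁻ (f y) m'
    ... | inj₁ my = px (trans (sym eq) (h y (here refl) z my))
    ... | inj₂ mr = go L' a (λ y' m'' → h y' (there m'')) mr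
  app : ∀ xs → Unique xs → (∀ z → z ∈ xs → g z ≡ x) → Unique (xs ++ concatMap f L)
  app [] _ _ = rest
  app (z ∷ xs) (az ∷ uz) h = allne ∷ app xs uz (λ z' m → h z' (there m))
    where
    allne : All (λ w → z ≢ w) (xs ++ concatMap f L)
    allne = All.tabulate λ {w} m → λ eq → sub w m eq
      where
      sub : ∀ w → w ∈ xs ++ concatMap f L → z ≡ w → ⊥
      sub w m refl with ∈-++⁻ xs m
      ... | inj₁ mx = All≢-∈ az mx refl
      ... | inj₂ mr = notin z (h z (here refl)) mr

unique-map-inv : ∀ {A B : Set} (φ : A → B) (h : B → A) L → Unique L → (∀ s → s ∈ L → h (φ s) ≡ s) → Unique (map φ L)
unique-map-inv φ h [] u hi = []
unique-map-inv φ h (s ∷ L) (as ∷ u) hi = allne L as (λ s' m → hi s' (there m)) ∷ unique-map-inv φ h L u (λ s' m → hi s' (there m))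
  where
  allne : ∀ L' → All (λ w → s ≢ w) L' → (∀ s' → s' ∈ L' → h (φ s') ≡ s') → All (λ w → φ s ≢ w) (map φ L')
  allne [] a hh = []
  allne (s' ∷ L') (px ∷ a) hh = (λ eq → px (trans (sym (hi s (here refl))) (trans (cong h eq) (hh s' (here refl)))))
                               ∷ allne L' a (λ s'' m → hh s'' (there m))

Unique-map-∷ : ∀ (z : ℕ) {L : List (List ℕ)} → Unique L → Unique (map (z ∷_) L)
Unique-map-∷ z {[]} [] = []
Unique-map-∷ z {x ∷ L} (ax ∷ u) = allm L ax ∷ Unique-map-∷ z u
  where
  allm : ∀ L' → All (λ w → x ≢ w) L' → All (λ w → z ∷ x ≢ w) (map (z ∷_) L')
  allm [] [] = []
  allm (w ∷ L') (p ∷ a) = (λ e → p (tl e)) ∷ allm L' a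
    where
    tl : ∀ {xs ys : List ℕ} → z ∷ xs ≡ z ∷ ys → xs ≡ ys
    tl refl = refl

Unique-++ˡ : ∀ (xs : List ℕ) {ys} → Unique (xs ++ ys) → Unique xs
Unique-++ˡ [] u = []
Unique-++ˡ (x ∷ xs) (ax ∷ u) = All.tabulate (λ m → All.lookup ax (∈-++⁺ˡ m)) ∷ Unique-++ˡ xs u

Unique-++ʳ : ∀ (xs : List ℕ) {ys} → Unique (xs ++ ys) → Unique ys
Unique-++ʳ [] u = u
Unique-++ʳ (x ∷ xs) (ax ∷ u) = Unique-++ʳ xs u

Unique-middle : ∀ (p : List ℕ) m t → Unique (p ++ m ∷ t) → m ∉ p × m ∉ t
Unique-middle p m t u = (λ mp → np p u mp) , (λ mt → All≢-∈ (head' (Unique-++ʳ p u)) mt refl)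
  where
  head' : ∀ {t'} → Unique (m ∷ t') → All (λ z → m ≢ z) t'
  head' (a ∷ _) = a
  np : ∀ p' → Unique (p' ++ m ∷ t) → m ∈ p' → ⊥
  np (x ∷ p') (ax ∷ u') (here refl) = All.lookup ax (∈-++⁺ʳ p' (here refl)) refl
  np (x ∷ p') (ax ∷ u') (there mp) = np p' u' mp

Unique⇒countB-≡ᵇ≤1 : ∀ (j : ℕ) L → Unique L → countB (λ x → x ≡ᵇ j) L ≤ 1
Unique⇒countB-≡ᵇ≤1 j [] u = z≤n
Unique⇒countB-≡ᵇ≤1 j (x ∷ L) (ax ∷ u) with x ≡ᵇ j in e
... | false = Unique⇒countB-≡ᵇ≤1 j L u
... | true rewrite countB-none (λ x' → x' ≡ᵇ j) L (λ x' m → ≢⇒≡ᵇ≡false (λ e' → All≢-∈ ax m (trans e' (sym (≡ᵇ≡true⇒≡ e))))) = s≤s z≤n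

upTo-suc : ∀ n → upTo (suc n) ≡ 0 ∷ map suc (upTo n)
upTo-suc n = cong (0 ∷_) (sym (map-upTo suc n))

countB-upTo-sucʳ : ∀ (p : ℕ → Bool) n → countB p (upTo (suc n)) ≡ countB p (upTo n) + ι (p n)
countB-upTo-sucʳ p n = trans (cong (countB p) (sym (upTo-∷ʳ n))) (trans (countB-++ p (upTo n) (n ∷ [])) (cong (countB p (upTo n) +_) (+-identityʳ _)))

countB-upTo-sucˡ : ∀ (p : ℕ → Bool) m → countB p (upTo (suc m)) ≡ ι (p 0) + countB (λ i → p (suc i)) (upTo m)
countB-upTo-sucˡ p m = trans (cong (countB p) (upTo-suc m)) (cong (ι (p 0) +_) (countB-map p suc (upTo m)))

countB-upTo-+ : ∀ (p : ℕ → Bool) x y → countB p (upTo (x + y)) ≡ countB p (upTo x) + countB (λ i → p (x + i)) (upTo y)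
countB-upTo-+ p x zero rewrite +-identityʳ x = sym (+-identityʳ _)
countB-upTo-+ p x (suc y) rewrite +-suc x y | countB-upTo-sucʳ p (x + y) | countB-upTo-+ p x y | countB-upTo-sucʳ (λ i → p (x + i)) y =
  +-assoc (countB p (upTo x)) _ _

countB-upTo-none : ∀ (p : ℕ → Bool) n → (∀ i → i < n → p i ≡ false) → countB p (upTo n) ≡ 0
countB-upTo-none p n h = countB-none p (upTo n) (λ i m → h i (∈-upTo⁻ m))

countB-upTo-ext : ∀ (p q : ℕ → Bool) n → (∀ i → i < n → p i ≡ q i) → countB p (upTo n) ≡ countB q (upTo n)
countB-upTo-ext p q n h = countB-ext (upTo n) (λ i m → h i (∈-upTo⁻ m))

countB-upTo-window : ∀ (q : ℕ → Bool) a b n → (∀ i → n ∸ a ≤ i → i < n → q i ≡ false) →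
  countB (λ i → q (b + i)) (upTo (n ∸ (a + b))) ≡ countB (λ i → (b ≤ᵇ i) ∧ q i) (upTo n)
countB-upTo-window q a b n hq with b ≤? n
... | no b>n rewrite m≤n⇒m∸n≡0 (≤-trans (<⇒≤ (≰⇒> b>n)) (m≤n+m b a)) =
  sym (countB-upTo-none _ n (λ i i<n → cong (_∧ q i) (>⇒≤ᵇ≡false (<-≤-trans i<n (<⇒≤ (≰⇒> b>n))))))
... | yes b≤n = sym (begin
  countB (λ i → (b ≤ᵇ i) ∧ q i) (upTo n)
    ≡⟨ cong (λ z → countB (λ i → (b ≤ᵇ i) ∧ q i) (upTo z)) (sym (m+[n∸m]≡n b≤n)) ⟩
  countB (λ i → (b ≤ᵇ i) ∧ q i) (upTo (b + (n ∸ b)))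
    ≡⟨ countB-upTo-+ _ b (n ∸ b) ⟩
  countB (λ i → (b ≤ᵇ i) ∧ q i) (upTo b) + countB (λ i → (b ≤ᵇ b + i) ∧ q (b + i)) (upTo (n ∸ b))
    ≡⟨ cong₂ _+_ (countB-upTo-none _ b (λ i i<b → cong (_∧ q i) (>⇒≤ᵇ≡false i<b)))
                 (countB-upTo-ext _ _ (n ∸ b) (λ i _ → cong (_∧ q (b + i)) (≤⇒≤ᵇ≡true (m≤m+n b i)))) ⟩
  countB (λ i → q (b + i)) (upTo (n ∸ b))
    ≡⟨ cong (λ z → countB (λ i → q (b + i)) (upTo z)) (sym (m+[n∸m]≡n m≤nb)) ⟩
  countB (λ i → q (b + i)) (upTo (m + ((n ∸ b) ∸ m)))
    ≡⟨ countB-upTo-+ _ m _ ⟩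
  countB (λ i → q (b + i)) (upTo m) + countB (λ j → q (b + (m + j))) (upTo ((n ∸ b) ∸ m))
    ≡⟨ cong (countB (λ i → q (b + i)) (upTo m) +_) (countB-upTo-none (λ j → q (b + (m + j))) ((n ∸ b) ∸ m) (λ j j< → hq _ (≤-trans key (≤-trans (m≤m+n (b + m) j) (≤-reflexive (+-assoc b m j)))) (lt j j<))) ⟩
  countB (λ i → q (b + i)) (upTo m) + 0
    ≡⟨ +-identityʳ _ ⟩
  countB (λ i → q (b + i)) (upTo m) ∎)
  where
  open ≡-Reasoning
  m : ℕ
  m = n ∸ (a + b)
  m≤nb : m ≤ n ∸ b
  m≤nb = ≤-trans (≤-reflexive (cong (n ∸_) (+-comm a b))) (≤-trans (≤-reflexive (sym (∸-+-assoc n b a))) (m∸n≤m (n ∸ b) a))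
  lt : ∀ j → j < (n ∸ b) ∸ m → b + (m + j) < n
  lt j j< = <-≤-trans (+-monoʳ-< b (+-monoʳ-< m j<)) (≤-reflexive (trans (cong (b +_) (m+[n∸m]≡n m≤nb)) (m+[n∸m]≡n b≤n)))
  key : n ∸ a ≤ b + m
  key = ≤-trans (m≤n+m∸n (n ∸ a) b) (≤-reflexive (cong (b +_) (∸-+-assoc n a b)))

countB-≤ᵇ-upTo : ∀ b K → countB (λ i → b ≤ᵇ i) (upTo K) ≡ K ∸ b
countB-≤ᵇ-upTo b zero = sym (0∸n≡0 b)
countB-≤ᵇ-upTo b (suc K) rewrite countB-upTo-sucʳ (λ i → b ≤ᵇ i) K | countB-≤ᵇ-upTo b K with b ≤? K
... | yes b≤K rewrite ≤⇒≤ᵇ≡true b≤K = trans (+-comm (K ∸ b) 1) (sym (+-∸-assoc 1 b≤K))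
... | no b≰K rewrite >⇒≤ᵇ≡false (≰⇒> b≰K) | m≤n⇒m∸n≡0 (<⇒≤ (≰⇒> b≰K)) = sym (m≤n⇒m∸n≡0 (≰⇒> b≰K))

countB-interval : ∀ b a N m → suc N ∸ a ≤ m → countB (λ i → (b ≤ᵇ i) ∧ (i + a ≤ᵇ N)) (upTo m) ≡ (suc N ∸ a) ∸ b
countB-interval b a N m Km = begin
  countB (λ i → (b ≤ᵇ i) ∧ (i + a ≤ᵇ N)) (upTo m) ≡⟨ cong (λ z → countB (λ i → (b ≤ᵇ i) ∧ (i + a ≤ᵇ N)) (upTo z)) (sym (m+[n∸m]≡n Km)) ⟩
  countB (λ i → (b ≤ᵇ i) ∧ (i + a ≤ᵇ N)) (upTo (K + (m ∸ K))) ≡⟨ countB-upTo-+ _ K (m ∸ K) ⟩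
  countB (λ i → (b ≤ᵇ i) ∧ (i + a ≤ᵇ N)) (upTo K) + countB (λ j → (b ≤ᵇ K + j) ∧ (K + j + a ≤ᵇ N)) (upTo (m ∸ K))
    ≡⟨ cong₂ _+_ (countB-upTo-ext _ _ K (λ i i<K → trans (cong ((b ≤ᵇ i) ∧_) (≤⇒≤ᵇ≡true (lo i i<K))) (∧-identityʳ (b ≤ᵇ i))))
                 (countB-upTo-none _ (m ∸ K) (λ j _ → ∧-falseʳ (b ≤ᵇ K + j) (>⇒≤ᵇ≡false (hi j)))) ⟩
  countB (λ i → b ≤ᵇ i) (upTo K) + 0 ≡⟨ +-identityʳ _ ⟩
  countB (λ i → b ≤ᵇ i) (upTo K) ≡⟨ countB-≤ᵇ-upTo b K ⟩
  K ∸ b ∎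
  where
  open ≡-Reasoning
  K : ℕ
  K = suc N ∸ a
  lo : ∀ i → i < K → i + a ≤ N
  lo i i<K with a ≤? suc N
  ... | yes a≤ = ≤-pred (m≤o∸n⇒m+n≤o (suc i) a≤ i<K)
  ... | no a≰ with () ← ≤-trans i<K (≤-reflexive (m≤n⇒m∸n≡0 (<⇒≤ (≰⇒> a≰))))
  hi : ∀ j → N < K + j + a
  hi j = ≤-trans (m≤n+m∸n (suc N) a) (≤-trans (≤-reflexive (+-comm a K)) (+-monoˡ-≤ a (m≤m+n K j)))

lastOr : ℕ → List ℕ → ℕ
lastOr u [] = u
lastOr u (x ∷ xs) = lastOr x xs

lastOr-∈ : ∀ u xs → lastOr u xs ≡ u ⊎ lastOr u xs ∈ xs
lastOr-∈ u [] = inj₁ refl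
lastOr-∈ u (x ∷ xs) with lastOr-∈ x xs
... | inj₁ e = inj₂ (here e)
... | inj₂ m = inj₂ (there m)

lastOr-< : ∀ {u m} xs → u < m → All (_< m) xs → lastOr u xs < m
lastOr-< [] u<m _ = u<m
lastOr-< (x ∷ xs) _ (x<m ∷ xs<m) = lastOr-< xs x<m xs<m

lastOr-∷ʳ : ∀ u pre (x : ℕ) → lastOr u (pre ∷ʳ x) ≡ x
lastOr-∷ʳ u [] x = refl
lastOr-∷ʳ u (y ∷ pre) x = lastOr-∷ʳ y pre x

maximum : List ℕ → ℕ
maximum = foldr _⊔_ 0

maximum-∷ʳ : ∀ pre x → maximum (pre ∷ʳ x) ≡ maximum pre ⊔ x
maximum-∷ʳ [] x = trans (⊔-identityʳ x) (sym (⊔-identityˡ x))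
maximum-∷ʳ (y ∷ pre) x = trans (cong (y ⊔_) (maximum-∷ʳ pre x)) (sym (⊔-assoc y (maximum pre) x))

maximum-≥ : ∀ {y} xs → y ∈ xs → y ≤ maximum xs
maximum-≥ (x ∷ xs) (here refl) = m≤m⊔n x (maximum xs)
maximum-≥ (x ∷ xs) (there m) = ≤-trans (maximum-≥ xs m) (m≤n⊔m x (maximum xs))

maximum-∈ : ∀ x xs → maximum (x ∷ xs) ∈ x ∷ xs
maximum-∈ x [] = here (⊔-identityʳ x)
maximum-∈ x (y ∷ xs) with ≤-total (maximum (y ∷ xs)) x
... | inj₁ le = here (m≥n⇒m⊔n≡m le)
... | inj₂ ge rewrite m≤n⇒m⊔n≡n ge = there (maximum-∈ y xs)

maximum-< : ∀ xs m → 1 ≤ m → All (_< m) xs → maximum xs < m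
maximum-< [] m m≥1 a = m≥1
maximum-< (x ∷ xs) m m≥1 (px ∷ a) = ⊔-lub px (maximum-< xs m m≥1 a)

maximum-≡ : ∀ xs m → m ∈ xs → (∀ {y} → y ∈ xs → y ≤ m) → maximum xs ≡ m
maximum-≡ (x ∷ xs) m mm h = ≤-antisym (lub (x ∷ xs) (λ z → h z)) (maximum-≥ (x ∷ xs) mm)
  where
  lub : ∀ ys → (∀ {y} → y ∈ ys → y ≤ m) → maximum ys ≤ m
  lub [] h' = z≤n
  lub (y ∷ ys) h' = ⊔-lub (h' (here refl)) (lub ys (λ z → h' (there z)))

-- The recurrence

Arec : ℕ → ℕ → ℕ → ℕ
Arec r zero k = if k ≡ᵇ 0 then 1 else 0
Arec r (suc n) zero = (suc n ∸ (suc n ∸ r)) * Arec r n zero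
Arec r (suc n) (suc k) = (suc n ∸ ((suc n ∸ r) ∸ suc k)) * Arec r n (suc k) + ((suc n ∸ r) ∸ k) * Arec r n k

childCount : ℕ → ℕ → ℕ → ℕ → ℕ
childCount m c s k = (m ∸ (c ∸ s)) * ι (s ≡ᵇ k) + (c ∸ s) * ι (suc s ≡ᵇ k)

sumL-*ι≡*countB : ∀ {A : Set} (f : ℕ → ℕ) (S : A → ℕ) k P →
  sumL (λ y → f (S y) * ι (S y ≡ᵇ k)) P ≡ f k * countB (λ y → S y ≡ᵇ k) P
sumL-*ι≡*countB f S k [] = sym (*-zeroʳ (f k))
sumL-*ι≡*countB f S k (y ∷ P) with S y ≡ᵇ k in eq
... | true = trans (cong₂ _+_ (trans (*-identityʳ _) (cong f (≡ᵇ≡true⇒≡ eq))) (sumL-*ι≡*countB f S k P)) (sym (*-suc (f k) _))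
... | false = trans (cong₂ _+_ (*-zeroʳ (f (S y))) (sumL-*ι≡*countB f S k P)) refl

shiftedTerm : ℕ → (ℕ → ℕ) → ℕ → ℕ
shiftedTerm c N zero = 0
shiftedTerm c N (suc k') = (c ∸ k') * N k'

sumL-childCount : ∀ {A : Set} (S : A → ℕ) m c k P →
  sumL (λ y → childCount m c (S y) k) P ≡
    (m ∸ (c ∸ k)) * countB (λ y → S y ≡ᵇ k) P + shiftedTerm c (λ j → countB (λ y → S y ≡ᵇ j) P) k
sumL-childCount S m c k P = trans (sumL-split P) (cong₂ _+_ (sumL-*ι≡*countB (λ s → m ∸ (c ∸ s)) S k P) (second k))
  where
  sumL-split : ∀ Q → sumL (λ y → childCount m c (S y) k) Q ≡
      sumL (λ y → (m ∸ (c ∸ S y)) * ι (S y ≡ᵇ k)) Q + sumL (λ y → (c ∸ S y) * ι (suc (S y) ≡ᵇ k)) Q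
  sumL-split [] = refl
  sumL-split (y ∷ Q) rewrite sumL-split Q = interchange ((m ∸ (c ∸ S y)) * ι (S y ≡ᵇ k)) ((c ∸ S y) * ι (suc (S y) ≡ᵇ k)) _ _
  second : ∀ k → sumL (λ y → (c ∸ S y) * ι (suc (S y) ≡ᵇ k)) P ≡ shiftedTerm c (λ j → countB (λ y → S y ≡ᵇ j) P) k
  second zero = zeroes P
    where
    zeroes : ∀ Q → sumL (λ y → (c ∸ S y) * ι (suc (S y) ≡ᵇ zero)) Q ≡ 0
    zeroes [] = refl
    zeroes (y ∷ Q) = trans (cong₂ _+_ (*-zeroʳ (c ∸ S y)) (zeroes Q)) refl
  second (suc k') = sumL-*ι≡*countB (λ s → c ∸ s) S k' P

sum≤length : ∀ (δs : List ℕ) → All (_≤ 1) δs → sum δs ≤ length δs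
sum≤length [] [] = z≤n
sum≤length (d ∷ δs) (z≤n ∷ a) = m≤n⇒m≤1+n (sum≤length δs a)
sum≤length (d ∷ δs) (s≤s z≤n ∷ a) = s≤s (sum≤length δs a)

countB-map-+δ : ∀ s (δs : List ℕ) k → All (_≤ 1) δs →
  countB (λ t → t ≡ᵇ k) (map (s +_) δs) ≡ (length δs ∸ sum δs) * ι (s ≡ᵇ k) + sum δs * ι (suc s ≡ᵇ k)
countB-map-+δ s [] k [] = refl
countB-map-+δ s (d ∷ δs) k (z≤n ∷ a) rewrite countB-map-+δ s δs k a | +-identityʳ s
  | +-∸-assoc 1 (sum≤length δs a) =
  sym (+-assoc (ι (s ≡ᵇ k)) _ _)
countB-map-+δ s (d ∷ δs) k (s≤s z≤n ∷ a) rewrite countB-map-+δ s δs k a | +-comm s 1 =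
  swap-front (ι (suc s ≡ᵇ k)) ((length δs ∸ sum δs) * ι (s ≡ᵇ k)) (sum δs * ι (suc s ≡ᵇ k))
  where
  swap-front : ∀ x y z → x + (y + z) ≡ y + (x + z)
  swap-front = solve-∀

record ChildStats (m c s : ℕ) (cs : List ℕ) : Set where
  field
    δs : List ℕ
    stats≡ : cs ≡ map (s +_) δs
    δs≤1 : All (_≤ 1) δs
    length-δs : length δs ≡ m
    s+sum-δs≡c : s + sum δs ≡ c

ChildStats⇒countB : ∀ {m c s cs} → ChildStats m c s cs → ∀ k → countB (λ t → t ≡ᵇ k) cs ≡ childCount m c s k
ChildStats⇒countB {m} {c} {s} {cs} d k rewrite ChildStats.stats≡ d =
  trans (countB-map-+δ s (ChildStats.δs d) k (ChildStats.δs≤1 d))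
    (cong₂ (λ x y → (x ∸ y) * ι (s ≡ᵇ k) + y * ι (suc s ≡ᵇ k)) (ChildStats.length-δs d) e)
  where
  e : sum (ChildStats.δs d) ≡ c ∸ s
  e = trans (sym (m+n∸m≡n s _)) (cong (_∸ s) (ChildStats.s+sum-δs≡c d))

module ArecFamily {A : Set} (r : ℕ) (X : ℕ → List A) (S : ℕ → A → ℕ)
  (base : ∀ k → countB (λ z → S 0 z ≡ᵇ k) (X 0) ≡ Arec r 0 k)
  (step : ∀ n k → countB (λ z → S (suc n) z ≡ᵇ k) (X (suc n)) ≡
            sumL (λ y → childCount (suc n) (suc n ∸ r) (S n y) k) (X n)) where

  countB≡Arec : ∀ n k → countB (λ z → S n z ≡ᵇ k) (X n) ≡ Arec r n k
  countB≡Arec zero k = base k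
  countB≡Arec (suc n) zero = trans (step n zero) (trans (sumL-childCount (S n) (suc n) (suc n ∸ r) zero (X n))
    (trans (+-identityʳ _) (cong ((suc n ∸ (suc n ∸ r)) *_) (countB≡Arec n zero))))
  countB≡Arec (suc n) (suc k) = trans (step n (suc k)) (trans (sumL-childCount (S n) (suc n) (suc n ∸ r) (suc k) (X n))
    (cong₂ _+_ (cong ((suc n ∸ ((suc n ∸ r) ∸ suc k)) *_) (countB≡Arec n (suc k))) (cong (((suc n ∸ r) ∸ k) *_) (countB≡Arec n k))))

concatMap-step : ∀ {A : Set} (S S' : A → ℕ) (kids : A → List A) P m c →
  (∀ y → y ∈ P → ChildStats m c (S y) (map S' (kids y))) →
  ∀ k → countB (λ z → S' z ≡ᵇ k) (concatMap kids P) ≡ sumL (λ y → childCount m c (S y) k) P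
concatMap-step S S' kids P m c h k = trans (countB-concatMap _ kids P)
  (sumL-ext P (λ y my → trans (sym (countB-map (λ t → t ≡ᵇ k) S' (kids y))) (ChildStats⇒countB (h y my) k)))

Arec-top-positive : ∀ r n → 1 ≤ Arec r n (n ∸ r)
Arec-top-positive r zero rewrite 0∸n≡0 r = s≤s z≤n
Arec-top-positive r (suc m) with r ≤? m
... | yes r≤m rewrite +-∸-assoc 1 r≤m =
  ≤-trans (≤-trans (Arec-top-positive r m) (≤-reflexive (trans (sym (*-identityˡ _)) (cong (_* Arec r m (m ∸ r)) (sym (gap≡1 r≤m))))))
    (m≤n+m _ ((suc m ∸ ((suc m ∸ r) ∸ suc (m ∸ r))) * Arec r m (suc (m ∸ r))))
  where
  gap≡1 : r ≤ m → (suc m ∸ r) ∸ (m ∸ r) ≡ 1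
  gap≡1 r≤m' rewrite +-∸-assoc 1 r≤m' = trans (+-∸-assoc 1 {m ∸ r} ≤-refl) (cong suc (n∸n≡0 (m ∸ r)))
... | no r≰m rewrite m≤n⇒m∸n≡0 (≰⇒> r≰m) =
  ≤-trans (≤-trans (Arec-top-positive r m) (≤-reflexive (cong (Arec r m) (m≤n⇒m∸n≡0 (<⇒≤ (≰⇒> r≰m))))))
    (≤-trans (m≤m+n (Arec r m 0) (m * Arec r m 0)) (≤-reflexive (cong (λ t → (suc m ∸ t) * Arec r m 0) (sym (m≤n⇒m∸n≡0 (≰⇒> r≰m))))))

-- The operators Δ and Δ′

#Δ : List Op → ℕ
#Δ Γ = countB isΔ Γ

#Δ' : List Op → ℕ
#Δ' Γ = countB (not ∘ isΔ) Γ

#Δ+#Δ'≡length : ∀ Γ → #Δ Γ + #Δ' Γ ≡ length Γ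
#Δ+#Δ'≡length [] = refl
#Δ+#Δ'≡length (δ ∷ Γ) = cong suc (#Δ+#Δ'≡length Γ)
#Δ+#Δ'≡length (δ' ∷ Γ) = trans (+-suc (#Δ Γ) (#Δ' Γ)) (cong suc (#Δ+#Δ'≡length Γ))

anyB-isΔ⇒1≤#Δ : ∀ Γ → anyB isΔ Γ ≡ true → 1 ≤ #Δ Γ
anyB-isΔ⇒1≤#Δ (δ ∷ Γ) e = s≤s z≤n
anyB-isΔ⇒1≤#Δ (δ' ∷ Γ) e = anyB-isΔ⇒1≤#Δ Γ e

¬anyB-isΔ⇒#Δ≡0 : ∀ Γ → anyB isΔ Γ ≡ false → #Δ Γ ≡ 0
¬anyB-isΔ⇒#Δ≡0 [] e = refl
¬anyB-isΔ⇒#Δ≡0 (δ' ∷ Γ) e = ¬anyB-isΔ⇒#Δ≡0 Γ e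

dropLast-∷ʳ : ∀ (xs : List ℕ) x → dropLast (xs ∷ʳ x) ≡ xs
dropLast-∷ʳ [] x = refl
dropLast-∷ʳ (y ∷ []) x = refl
dropLast-∷ʳ (y ∷ z ∷ xs) x = cong (y ∷_) (dropLast-∷ʳ (z ∷ xs) x)

Δ-map-upTo : ∀ (g : ℕ → ℕ) m → Δ (map g (upTo m)) ≡ map (λ i → g i ∸ 1) (upTo (m ∸ 1))
Δ-map-upTo g zero = refl
Δ-map-upTo g (suc m) =
  trans (cong (λ z → map (λ x → x ∸ 1) (dropLast (map g z))) (sym (upTo-∷ʳ m)))
  (trans (cong (λ z → map (λ x → x ∸ 1) (dropLast z)) (map-++ g (upTo m) (m ∷ [])))
  (trans (cong (map (λ x → x ∸ 1)) (dropLast-∷ʳ (map g (upTo m)) (g m))) (sym (map-∘ (upTo m)))))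

Δ'-map-upTo : ∀ (g : ℕ → ℕ) m → Δ' (map g (upTo m)) ≡ map (g ∘ suc) (upTo (m ∸ 1))
Δ'-map-upTo g zero = refl
Δ'-map-upTo g (suc m) = trans (cong (map g) (sym (map-upTo suc m))) (sym (map-∘ (upTo m)))

applyΓ-map-upTo : ∀ Γ (h : ℕ → ℕ) n → applyΓ Γ (map h (upTo n)) ≡ map (λ i → h (#Δ' Γ + i) ∸ #Δ Γ) (upTo (n ∸ (#Δ Γ + #Δ' Γ)))
applyΓ-map-upTo [] h n = refl
applyΓ-map-upTo (δ ∷ Γ) h n rewrite applyΓ-map-upTo Γ h n | Δ-map-upTo (λ i → h (#Δ' Γ + i) ∸ #Δ Γ) (n ∸ (#Δ Γ + #Δ' Γ)) =
  trans (map-cong (λ i → trans (∸-+-assoc (h (#Δ' Γ + i)) (#Δ Γ) 1) (cong (h (#Δ' Γ + i) ∸_) (+-comm (#Δ Γ) 1))) _)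
        (cong (λ z → map (λ i → h (#Δ' Γ + i) ∸ suc (#Δ Γ)) (upTo z)) (trans (∸-+-assoc n (#Δ Γ + #Δ' Γ) 1) (cong (n ∸_) (+-comm _ 1))))
applyΓ-map-upTo (δ' ∷ Γ) h n rewrite applyΓ-map-upTo Γ h n | Δ'-map-upTo (λ i → h (#Δ' Γ + i) ∸ #Δ Γ) (n ∸ (#Δ Γ + #Δ' Γ)) =
  trans (map-cong (λ i → cong (λ z → h z ∸ #Δ Γ) (+-suc (#Δ' Γ) i)) _)
        (cong (λ z → map (λ i → h (suc (#Δ' Γ) + i) ∸ #Δ Γ) (upTo z))
          (trans (∸-+-assoc n (#Δ Γ + #Δ' Γ) 1) (cong (n ∸_) (trans (+-assoc (#Δ Γ) (#Δ' Γ) 1) (cong (#Δ Γ +_) (+-comm (#Δ' Γ) 1))))))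

∣map-∸∣⁺ : ∀ a (xs : List ℕ) → ∣ map (λ x → x ∸ a) xs ∣⁺ ≡ countB (λ x → suc a ≤ᵇ x) xs
∣map-∸∣⁺ a xs = trans (countB-map _ _ xs) (countB-ext xs (λ x _ → 1≤ᵇ∸ a x))

∣applyΓ-map-upTo∣⁺ : ∀ Γ (h : ℕ → ℕ) n → ∣ applyΓ Γ (map h (upTo n)) ∣⁺ ≡
  countB (λ i → suc (#Δ Γ) ≤ᵇ h (#Δ' Γ + i)) (upTo (n ∸ (#Δ Γ + #Δ' Γ)))
∣applyΓ-map-upTo∣⁺ Γ h n rewrite applyΓ-map-upTo Γ h n =
  trans (cong ∣_∣⁺ (map-∘ {g = λ x → x ∸ #Δ Γ} {f = λ i → h (#Δ' Γ + i)} (upTo (n ∸ (#Δ Γ + #Δ' Γ)))))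
  (trans (∣map-∸∣⁺ (#Δ Γ) (map (λ i → h (#Δ' Γ + i)) (upTo (n ∸ (#Δ Γ + #Δ' Γ))))) (countB-map _ _ (upTo (n ∸ (#Δ Γ + #Δ' Γ)))))

∣applyΓ-excess∣⁺ : ∀ Γ n (f : ℕ → ℕ) → (∀ i → f i ≤ n) →
  ∣ applyΓ Γ (map (λ i → f i ∸ i) (upTo n)) ∣⁺ ≡
  countB (λ i → (#Δ' Γ ≤ᵇ i) ∧ (suc i + #Δ Γ ≤ᵇ f i)) (upTo n)
∣applyΓ-excess∣⁺ Γ n f fb =
  trans (∣applyΓ-map-upTo∣⁺ Γ (λ i → f i ∸ i) n)
  (trans (countB-upTo-window (λ i → suc (#Δ Γ) ≤ᵇ (f i ∸ i)) (#Δ Γ) (#Δ' Γ) n tail-vanishes)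
  (countB-ext (upTo n) (λ i _ → cong ((#Δ' Γ ≤ᵇ i) ∧_) (≤ᵇ-∸ (#Δ Γ) (f i) i))))
  where
  tail-vanishes : ∀ i → n ∸ #Δ Γ ≤ i → i < n → (suc (#Δ Γ) ≤ᵇ (f i ∸ i)) ≡ false
  tail-vanishes i le _ = >⇒≤ᵇ≡false (s≤s (≤-trans (∸-monoˡ-≤ i (fb i)) (≤-trans (∸-monoʳ-≤ n le) (m∸[m∸n]≤n n (#Δ Γ)))))

applyΓ-[] : ∀ Γ → applyΓ Γ [] ≡ []
applyΓ-[] [] = refl
applyΓ-[] (δ ∷ Γ) rewrite applyΓ-[] Γ = refl
applyΓ-[] (δ' ∷ Γ) rewrite applyΓ-[] Γ = refl

applyΓ-Δ : ∀ Γ x → applyΓ Γ (Δ x) ≡ applyΓ (Γ ++ [ δ ]) x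
applyΓ-Δ Γ x = sym (foldr-++ applyOp x Γ [ δ ])

#Δ+#Δ'-∷ʳδ : ∀ Γ → #Δ (Γ ++ [ δ ]) + #Δ' (Γ ++ [ δ ]) ≡ suc (length Γ)
#Δ+#Δ'-∷ʳδ Γ = trans (#Δ+#Δ'≡length (Γ ++ [ δ ])) (length-∷ʳ Γ δ)

1≤#Δ-∷ʳδ : ∀ Γ → 1 ≤ #Δ (Γ ++ [ δ ])
1≤#Δ-∷ʳδ Γ = ≤-trans (s≤s z≤n) (≤-reflexive (trans (sym (+-comm (#Δ Γ) 1)) (sym (countB-++ isΔ Γ [ δ ]))))

⊕-map : ∀ (f g : ℕ → ℕ) xs → map f xs ⊕ map g xs ≡ map (λ i → f i + g i) xs
⊕-map f g [] = refl
⊕-map f g (x ∷ xs) = cong (f x + g x ∷_) (⊕-map f g xs)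

-- Permutations as lists

range : ℕ → List ℕ
range n = map suc (upTo n)

range-suc : ∀ n → range (suc n) ≡ range n ∷ʳ suc n
range-suc n = trans (cong (map suc) (sym (upTo-∷ʳ n))) (map-++ suc (upTo n) [ n ])

length-range : ∀ n → length (range n) ≡ n
length-range n = trans (length-map suc (upTo n)) (length-upTo n)

IsPerm : ℕ → List ℕ → Set
IsPerm n σ = σ ↭ range n

insertAll-↭ : ∀ a (y z : List ℕ) → z ∈ insertAll a y → z ↭ a ∷ y
insertAll-↭ a [] .(a ∷ []) (here refl) = ↭-refl
insertAll-↭ a (x ∷ y) .(a ∷ x ∷ y) (here refl) = ↭-refl
insertAll-↭ a (x ∷ y) z (there m) with ∈-map⁻ (x ∷_) m
... | z' , m' , refl = ↭-trans (prep x (insertAll-↭ a y z' m')) (swap x a ↭-refl)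

∷↭∷ʳ : ∀ (a : ℕ) y → a ∷ y ↭ y ∷ʳ a
∷↭∷ʳ a y = ↭-trans (↭-reflexive (cong (a ∷_) (sym (++-identityʳ y)))) (↭-sym (shift a y []))

Perms-IsPerm : ∀ n σ → σ ∈ Perms n → IsPerm n σ
Perms-IsPerm zero .[] (here refl) = ↭-refl
Perms-IsPerm (suc n) σ m with ∈-concatMap⁻ (insertAll (suc n)) (Perms n) m
... | y , my , mσ rewrite range-suc n =
  ↭-trans (insertAll-↭ (suc n) y σ mσ) (↭-trans (∷↭∷ʳ (suc n) y) (++⁺ʳ [ suc n ] (Perms-IsPerm n y my)))

∈-insertAll : ∀ (a : ℕ) p q → p ++ a ∷ q ∈ insertAll a (p ++ q)
∈-insertAll a [] [] = here refl
∈-insertAll a [] (x ∷ q) = here refl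
∈-insertAll a (x ∷ p) q = there (∈-map⁺ (x ∷_) (∈-insertAll a p q))

Perms-complete : ∀ n σ → IsPerm n σ → σ ∈ Perms n
Perms-complete zero σ ip with ↭-length ip
Perms-complete zero [] ip | _ = here refl
Perms-complete (suc n) σ ip rewrite range-suc n with ∈-∃++ (∈-resp-↭ (↭-sym ip) (∈-++⁺ʳ (range n) (here refl)))
... | p , q , refl = ∈-concatMap⁺ (insertAll (suc n)) (Perms n) (Perms-complete n (p ++ q) ip') (∈-insertAll (suc n) p q)
  where
  ip' : p ++ q ↭ range n
  ip' = ↭-trans (drop-mid p (range n) ip) (↭-reflexive (++-identityʳ (range n)))

length-insertAll : ∀ (a : ℕ) y → length (insertAll a y) ≡ suc (length y)
length-insertAll a [] = refl
length-insertAll a (x ∷ y) = cong suc (trans (length-map (x ∷_) (insertAll a y)) (length-insertAll a y))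

Unique-resp-↭ : ∀ {xs ys : List ℕ} → xs ↭ ys → Unique xs → Unique ys
Unique-resp-↭ ↭-refl u = u
Unique-resp-↭ (prep x p) (ax ∷ u) = All-resp-↭ p ax ∷ Unique-resp-↭ p u
Unique-resp-↭ (swap x y p) ((x≢y ∷ ax) ∷ ay ∷ u) = ((λ e → x≢y (sym e)) ∷ All-resp-↭ p ay) ∷ All-resp-↭ p ax ∷ Unique-resp-↭ p u
Unique-resp-↭ (↭-trans p q) u = Unique-resp-↭ q (Unique-resp-↭ p u)

Unique-range : ∀ n → Unique (range n)
Unique-range n = UP.map⁺ suc-injective (UP.upTo⁺ n)

IsPerm⇒Unique : ∀ {n σ} → IsPerm n σ → Unique σ
IsPerm⇒Unique ip = Unique-resp-↭ (↭-sym ip) (Unique-range _)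

∈-range⁻ : ∀ {n v} → v ∈ range n → 1 ≤ v × v ≤ n
∈-range⁻ {n} m with ∈-map⁻ suc m
... | i , mi , refl = s≤s z≤n , ∈-upTo⁻ mi

∈-range⁺ : ∀ {n v} → 1 ≤ v → v ≤ n → v ∈ range n
∈-range⁺ {n} {suc v} (s≤s z≤n) le = ∈-map⁺ suc (∈-upTo⁺ le)

IsPerm-bound : ∀ {n σ v} → IsPerm n σ → v ∈ σ → 1 ≤ v × v ≤ n
IsPerm-bound ip m = ∈-range⁻ (∈-resp-↭ ip m)


IsPerm-length : ∀ {n σ} → IsPerm n σ → length σ ≡ n
IsPerm-length {n} ip = trans (↭-length ip) (length-range n)

0∉IsPerm : ∀ {n σ} → IsPerm n σ → 0 ∉ σ
0∉IsPerm ip m with IsPerm-bound ip m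
... | () , _

countB-upTo-IsPerm : ∀ {n σ} → IsPerm n σ → (φ : ℕ → Bool) → countB (λ i → φ (suc i)) (upTo n) ≡ countB φ σ
countB-upTo-IsPerm {n} ip φ = trans (sym (countB-map φ suc (upTo n))) (countB-↭ φ (↭-sym ip))

countB-Perms0 : ∀ r (S : List ℕ → ℕ) → S [] ≡ 0 → ∀ k → countB (λ z → S z ≡ᵇ k) (Perms 0) ≡ Arec r 0 k
countB-Perms0 r S e zero rewrite e = refl
countB-Perms0 r S e (suc k) rewrite e = refl

at-∈-or-0 : ∀ xs j → at xs j ≡ 0 ⊎ (at xs j ∈ xs)
at-∈-or-0 xs zero = inj₁ refl
at-∈-or-0 [] (suc j) = inj₁ refl
at-∈-or-0 (x ∷ xs) (suc zero) = inj₂ (here refl)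
at-∈-or-0 (x ∷ xs) (suc (suc j)) with at-∈-or-0 xs (suc j)
... | inj₁ e = inj₁ e
... | inj₂ m = inj₂ (there m)

at-bound : ∀ {n σ} → IsPerm n σ → ∀ j → at σ j ≤ n
at-bound ip j with at-∈-or-0 _ j
... | inj₁ e = ≤-trans (≤-reflexive e) z≤n
... | inj₂ m = proj₂ (IsPerm-bound ip m)

at-∸1 : ∀ xs i → at xs (i ∸ 1) ≡ at (0 ∷ xs) i
at-∸1 xs zero = refl
at-∸1 xs (suc zero) = refl
at-∸1 xs (suc (suc i)) = refl

at-∈ : ∀ σ x → 1 ≤ x → x ≤ length σ → at σ x ∈ σ
at-∈ (y ∷ σ) (suc zero) _ _ = here refl
at-∈ (y ∷ σ) (suc (suc x)) _ (s≤s le) = there (at-∈ σ (suc x) (s≤s z≤n) le)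

at-++ˡ : ∀ p r x → 1 ≤ x → x ≤ length p → at (p ++ r) x ≡ at p x
at-++ˡ (y ∷ p) r (suc zero) _ _ = refl
at-++ˡ (y ∷ p) r (suc (suc x)) _ (s≤s le) = at-++ˡ p r (suc x) (s≤s z≤n) le

at-++ʳ : ∀ p r x → at (p ++ r) (length p + suc x) ≡ at r (suc x)
at-++ʳ [] r x = refl
at-++ʳ (y ∷ p) r x rewrite +-suc (length p) x = shifted p r x
  where
  shifted : ∀ p r x → at (y ∷ p ++ r) (suc (suc (length p + x))) ≡ at r (suc x)
  shifted p r x rewrite sym (+-suc (length p) x) = at-++ʳ p r x

at-++-suc-length : ∀ pre (x : ℕ) xs → at (pre ++ x ∷ xs) (suc (length pre)) ≡ x
at-++-suc-length [] x xs = refl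
at-++-suc-length (y ∷ []) x xs = refl
at-++-suc-length (y ∷ z ∷ pre) x xs = at-++-suc-length (z ∷ pre) x xs

at-++-length : ∀ pre rest → at (pre ++ rest) (length pre) ≡ lastOr 0 pre
at-++-length [] rest = refl
at-++-length (y ∷ pre) rest = go y pre
  where
  go : ∀ y pre → at (y ∷ pre ++ rest) (suc (length pre)) ≡ lastOr y pre
  go y [] = refl
  go y (z ∷ pre) = go z pre

pos-head : ∀ x xs → pos (x ∷ xs) x ≡ 1
pos-head x xs rewrite ≡⇒≡ᵇ≡true {x} refl = refl

pos-∈ : ∀ {v} xs → v ∈ xs → ∃ λ j → pos xs v ≡ suc j
pos-∈ {v} (x ∷ xs) m with x ≡ᵇ v in eq
... | true = 0 , refl
pos-∈ {v} (x ∷ xs) (here refl) | false with () ← trans (sym eq) (≡⇒≡ᵇ≡true {x} refl)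
pos-∈ {v} (x ∷ xs) (there m) | false with pos-∈ xs m
... | j , e rewrite e = suc j , refl

pos-∉ : ∀ {v} xs → v ∉ xs → pos xs v ≡ 0
pos-∉ [] nm = refl
pos-∉ {v} (x ∷ xs) nm with x ≡ᵇ v in eq
... | true = ⊥-elim (nm (here (sym (≡ᵇ≡true⇒≡ eq))))
... | false rewrite pos-∉ xs (λ m → nm (there m)) = refl

pos-tail : ∀ {v} x xs → x ≢ v → v ∈ xs → pos (x ∷ xs) v ≡ suc (pos xs v)
pos-tail {v} x xs ne m rewrite ≢⇒≡ᵇ≡false ne with pos-∈ xs m
... | j , e rewrite e = refl

at-pos : ∀ {v} xs → v ∈ xs → at xs (pos xs v) ≡ v
at-pos {v} (x ∷ xs) m with x ≡ᵇ v in eq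
... | true = ≡ᵇ≡true⇒≡ {x} {v} eq
at-pos {v} (x ∷ xs) (here refl) | false with () ← trans (sym eq) (≡⇒≡ᵇ≡true {x} refl)
at-pos {v} (x ∷ xs) (there m) | false with pos-∈ xs m
... | j , e rewrite e = trans (cong (at xs) (sym e)) (at-pos xs m)

pos-at : ∀ σ x → Unique σ → 1 ≤ x → x ≤ length σ → pos σ (at σ x) ≡ x
pos-at (y ∷ σ) (suc zero) u _ _ = pos-head y σ
pos-at (y ∷ σ) (suc (suc x)) (ay ∷ u) _ (s≤s le) =
  trans (pos-tail y σ (λ e → All≢-∈ ay m (sym e)) m) (cong suc (pos-at σ (suc x) u (s≤s z≤n) le))
  where
  m : at σ (suc x) ∈ σ
  m = at-∈ σ (suc x) (s≤s z≤n) le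

pairCount : (ℕ → ℕ → Bool) → ℕ → List ℕ → ℕ
pairCount g u [] = 0
pairCount g u (x ∷ xs) = ι (g u x) + pairCount g x xs

pairCount-++ : ∀ (g : ℕ → ℕ → Bool) u xs ys → pairCount g u (xs ++ ys) ≡ pairCount g u xs + pairCount g (lastOr u xs) ys
pairCount-++ g u [] ys = refl
pairCount-++ g u (x ∷ xs) ys rewrite pairCount-++ g x xs ys = sym (+-assoc (ι (g u x)) _ _)

pairCount-ext : ∀ (g h : ℕ → ℕ → Bool) → (∀ u v → g u v ≡ h u v) → ∀ u xs → pairCount g u xs ≡ pairCount h u xs
pairCount-ext g h e u [] = refl
pairCount-ext g h e u (x ∷ xs) = cong₂ _+_ (cong ι (e u x)) (pairCount-ext g h e x xs)

countB-pred≡pairCount : ∀ (φ : ℕ → ℕ → Bool) p xs → Unique xs →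
  countB (λ v → φ v (at (p ∷ xs) (pos xs v))) xs ≡ pairCount (λ u v → φ v u) p xs
countB-pred≡pairCount φ p [] u = refl
countB-pred≡pairCount φ p (x ∷ xs) (ax ∷ u) rewrite pos-head x xs =
  cong (ι (φ x p) +_) (trans (countB-ext xs ext) (countB-pred≡pairCount φ x xs u))
  where
  ext : ∀ v → v ∈ xs → φ v (at (p ∷ x ∷ xs) (pos (x ∷ xs) v)) ≡ φ v (at (x ∷ xs) (pos xs v))
  ext v m rewrite pos-tail x xs (λ e → All≢-∈ ax m (sym e)) m with pos-∈ xs m
  ... | j , e rewrite e = refl

succPairCount : (ℕ → ℕ → Bool) → List ℕ → ℕ
succPairCount φ [] = 0
succPairCount φ (x ∷ xs) = ι (φ x (at xs 1)) + succPairCount φ xs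

countB-succ≡succPairCount : ∀ (φ : ℕ → ℕ → Bool) xs → Unique xs →
  countB (λ v → φ v (at xs (suc (pos xs v)))) xs ≡ succPairCount φ xs
countB-succ≡succPairCount φ [] u = refl
countB-succ≡succPairCount φ (x ∷ xs) (ax ∷ u) rewrite pos-head x xs =
  cong (ι (φ x (at xs 1)) +_) (trans (countB-ext xs ext) (countB-succ≡succPairCount φ xs u))
  where
  ext : ∀ v → v ∈ xs → φ v (at (x ∷ xs) (suc (pos (x ∷ xs) v))) ≡ φ v (at xs (suc (pos xs v)))
  ext v m rewrite pos-tail x xs (λ e → All≢-∈ ax m (sym e)) m = refl

succPairCount≡pairCount : ∀ (g : ℕ → ℕ → Bool) → (∀ x → g x 0 ≡ false) → ∀ u xs → ι (g u (at xs 1)) + succPairCount g xs ≡ pairCount g u xs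
succPairCount≡pairCount g h u [] rewrite h u = refl
succPairCount≡pairCount g h u (x ∷ xs) = cong (ι (g u x) +_) (succPairCount≡pairCount g h x xs)

indexCount : (ℕ → ℕ → Bool) → ℕ → List ℕ → ℕ
indexCount h o [] = 0
indexCount h o (x ∷ xs) = ι (h o x) + indexCount h (suc o) xs

countB-upTo≡indexCount : ∀ (h : ℕ → ℕ → Bool) o σ → countB (λ i → h (o + i) (at σ (suc i))) (upTo (length σ)) ≡ indexCount h o σ
countB-upTo≡indexCount h o [] = refl
countB-upTo≡indexCount h o (x ∷ xs) = trans (countB-upTo-sucˡ (λ i → h (o + i) (at (x ∷ xs) (suc i))) (length xs))
  (cong₂ _+_ (cong (λ t → ι (h t x)) (+-identityʳ o))
    (trans (countB-ext (upTo (length xs)) (λ i _ → cong (λ t → h t (at xs (suc i))) (+-suc o i))) (countB-upTo≡indexCount h (suc o) xs)))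

indexCount-∷ʳ : ∀ (h : ℕ → ℕ → Bool) o xs v → indexCount h o (xs ∷ʳ v) ≡ indexCount h o xs + ι (h (o + length xs) v)
indexCount-∷ʳ h o [] v rewrite +-identityʳ o = +-identityʳ _
indexCount-∷ʳ h o (x ∷ xs) v rewrite indexCount-∷ʳ h (suc o) xs v | +-suc o (length xs) = sym (+-assoc (ι (h o x)) _ _)

countB≡indexCount : ∀ (Φ : ℕ → ℕ → Bool) o xs → Unique xs → countB (λ v → Φ v (o + pos xs v)) xs ≡ indexCount (flip Φ) (suc o) xs
countB≡indexCount Φ o [] u = refl
countB≡indexCount Φ o (x ∷ xs) (ax ∷ u) rewrite pos-head x xs | +-comm o 1 =
  cong (ι (Φ x (suc o)) +_) (trans (countB-ext xs ext) (countB≡indexCount Φ (suc o) xs u))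
  where
  ext : ∀ v → v ∈ xs → Φ v (o + pos (x ∷ xs) v) ≡ Φ v (suc o + pos xs v)
  ext v m rewrite pos-tail x xs (λ e → All≢-∈ ax m (sym e)) m = cong (Φ v) (+-suc o (pos xs v))

bigRise : ℕ → ℕ → ℕ → ℕ → Bool
bigRise a b o x = (b ≤ᵇ o) ∧ (suc o + a ≤ᵇ x)

bigDrop : ℕ → ℕ → ℕ → ℕ → Bool
bigDrop a b u v = (suc b ≤ᵇ v) ∧ (v + a ≤ᵇ u)

-- Inserting the maximum: D and M

insertDeltas : (ℕ → ℕ → Bool) → ℕ → ℕ → List ℕ → List ℕ
insertDeltas g A u [] = [ ι (g u A) ]
insertDeltas g A u (x ∷ xs) = ((ι (g u A) + ι (g A x)) ∸ ι (g u x)) ∷ insertDeltas g A x xs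

module Insertion (g : ℕ → ℕ → Bool) (A : ℕ)
  (insert-keeps : ∀ u x → u < A → x < A → ι (g u x) ≤ ι (g u A) + ι (g A x))
  (insert-gains≤1 : ∀ u x → u < A → x < A → ι (g u A) + ι (g A x) ≤ suc (ι (g u x))) where

  pairCount-insertAll : ∀ u xs → All (_< A) (u ∷ xs) → map (pairCount g u) (insertAll A xs) ≡ map (pairCount g u xs +_) (insertDeltas g A u xs)
  pairCount-insertAll u [] a = cong [_] (+-identityʳ (ι (g u A)))
  pairCount-insertAll u (x ∷ xs) (ua ∷ xa ∷ a) = cong₂ _∷_ first rest
    where
    R : ℕ
    R = pairCount g x xs
    first : ι (g u A) + (ι (g A x) + R) ≡ (ι (g u x) + R) + ((ι (g u A) + ι (g A x)) ∸ ι (g u x))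
    first = begin
      ι (g u A) + (ι (g A x) + R) ≡⟨ sym (+-assoc (ι (g u A)) _ R) ⟩
      (ι (g u A) + ι (g A x)) + R ≡⟨ cong (_+ R) (sym (m+[n∸m]≡n (insert-keeps u x ua xa))) ⟩
      (ι (g u x) + ((ι (g u A) + ι (g A x)) ∸ ι (g u x))) + R ≡⟨ +-assoc (ι (g u x)) _ R ⟩
      ι (g u x) + (((ι (g u A) + ι (g A x)) ∸ ι (g u x)) + R) ≡⟨ cong (ι (g u x) +_) (+-comm _ R) ⟩
      ι (g u x) + (R + ((ι (g u A) + ι (g A x)) ∸ ι (g u x))) ≡⟨ sym (+-assoc (ι (g u x)) R _) ⟩
      (ι (g u x) + R) + ((ι (g u A) + ι (g A x)) ∸ ι (g u x)) ∎
      where open ≡-Reasoning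
    rest : map (pairCount g u) (map (x ∷_) (insertAll A xs)) ≡ map ((ι (g u x) + R) +_) (insertDeltas g A x xs)
    rest = begin
      map (pairCount g u) (map (x ∷_) (insertAll A xs)) ≡⟨ sym (map-∘ (insertAll A xs)) ⟩
      map (λ z → ι (g u x) + pairCount g x z) (insertAll A xs) ≡⟨ map-∘ (insertAll A xs) ⟩
      map (ι (g u x) +_) (map (pairCount g x) (insertAll A xs)) ≡⟨ cong (map (ι (g u x) +_)) (pairCount-insertAll x xs (xa ∷ a)) ⟩
      map (ι (g u x) +_) (map (R +_) (insertDeltas g A x xs)) ≡⟨ sym (map-∘ (insertDeltas g A x xs)) ⟩
      map (λ d → ι (g u x) + (R + d)) (insertDeltas g A x xs) ≡⟨ map-cong (λ d → sym (+-assoc (ι (g u x)) R d)) (insertDeltas g A x xs) ⟩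
      map ((ι (g u x) + R) +_) (insertDeltas g A x xs) ∎
      where open ≡-Reasoning

  insertDeltas-≤1 : ∀ u xs → All (_< A) (u ∷ xs) → All (_≤ 1) (insertDeltas g A u xs)
  insertDeltas-≤1 u [] a = ι≤1 _ ∷ []
  insertDeltas-≤1 u (x ∷ xs) (ua ∷ xa ∷ a) = ≤-trans (∸-monoˡ-≤ (ι (g u x)) (insert-gains≤1 u x ua xa)) (≤-reflexive (m+n∸n≡m 1 (ι (g u x)))) ∷ insertDeltas-≤1 x xs (xa ∷ a)

  length-insertDeltas : ∀ u xs → length (insertDeltas g A u xs) ≡ suc (length xs)
  length-insertDeltas u [] = refl
  length-insertDeltas u (x ∷ xs) = cong suc (length-insertDeltas x xs)

  sum-insertDeltas : ∀ u xs → All (_< A) (u ∷ xs) →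
    pairCount g u xs + sum (insertDeltas g A u xs) ≡ countB (λ v → g v A) (u ∷ xs) + countB (λ v → g A v) xs
  sum-insertDeltas u [] a = trans (+-identityʳ (ι (g u A))) (sym (trans (+-identityʳ _) (+-identityʳ _)))
  sum-insertDeltas u (x ∷ xs) (ua ∷ xa ∷ a) = begin
    (ι (g u x) + R) + (D0 + sum (insertDeltas g A x xs)) ≡⟨ interchange (ι (g u x)) R D0 (sum (insertDeltas g A x xs)) ⟩
    (ι (g u x) + D0) + (R + sum (insertDeltas g A x xs)) ≡⟨ cong₂ _+_ (m+[n∸m]≡n (insert-keeps u x ua xa)) (sum-insertDeltas x xs (xa ∷ a)) ⟩
    (ι (g u A) + ι (g A x)) + (countB (λ v → g v A) (x ∷ xs) + countB (λ v → g A v) xs) ≡⟨ interchange (ι (g u A)) (ι (g A x)) (countB (λ v → g v A) (x ∷ xs)) (countB (λ v → g A v) xs) ⟩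
    ι (g u A) + countB (λ v → g v A) (x ∷ xs) + (ι (g A x) + countB (λ v → g A v) xs) ∎
    where
    open ≡-Reasoning
    R : ℕ
    R = pairCount g x xs
    D0 : ℕ
    D0 = (ι (g u A) + ι (g A x)) ∸ ι (g u x)

module InsertionFamily (r : ℕ) (S : List ℕ → ℕ) (g : ℕ → ℕ → Bool)
  (S-unfold : ∀ n σ → IsPerm n σ → S σ ≡ pairCount g 0 σ)
  (insert-keeps : ∀ A u x → u < A → x < A → ι (g u x) ≤ ι (g u A) + ι (g A x))
  (insert-gains≤1 : ∀ A u x → u < A → x < A → ι (g u A) + ι (g A x) ≤ suc (ι (g u x)))
  (total-gain : ∀ n → countB (λ v → g v (suc n)) (0 ∷ range n) + countB (λ v → g (suc n) v) (range n) ≡ suc n ∸ r)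
  (S-[] : S [] ≡ 0) where

  childStats : ∀ n y → y ∈ Perms n → ChildStats (suc n) (suc n ∸ r) (S y) (map S (insertAll (suc n) y))
  childStats n y my = record
    { δs = insertDeltas g (suc n) 0 y
    ; stats≡ = trans (map-cong-∈ (insertAll (suc n) y) (λ z mz → S-unfold (suc n) z (Perms-IsPerm (suc n) z (∈-concatMap⁺ (insertAll (suc n)) (Perms n) my mz))))
             (trans (I.pairCount-insertAll 0 y bnd)
               (cong (λ t → map (t +_) (insertDeltas g (suc n) 0 y)) (sym (S-unfold n y ip))))
    ; δs≤1 = I.insertDeltas-≤1 0 y bnd
    ; length-δs = trans (I.length-insertDeltas 0 y) (cong suc (IsPerm-length ip))
    ; s+sum-δs≡c = trans (cong (_+ sum (insertDeltas g (suc n) 0 y)) (S-unfold n y ip))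
             (trans (I.sum-insertDeltas 0 y bnd)
               (trans (cong₂ _+_ (countB-↭ (λ v → g v (suc n)) (prep 0 ip)) (countB-↭ (λ v → g (suc n) v) ip)) (total-gain n)))
    }
    where
    module I = Insertion g (suc n) (insert-keeps (suc n)) (insert-gains≤1 (suc n))
    ip : IsPerm n y
    ip = Perms-IsPerm n y my
    bnd : All (_< suc n) (0 ∷ y)
    bnd = s≤s z≤n ∷ All.tabulate (λ m → s≤s (proj₂ (IsPerm-bound ip m)))

  countB-Perms≡Arec : ∀ n k → countB (λ z → S z ≡ᵇ k) (Perms n) ≡ Arec r n k
  countB-Perms≡Arec = ArecFamily.countB≡Arec r Perms (λ _ → S) (countB-Perms0 r S S-[])
    (λ n k → concatMap-step S S (insertAll (suc n)) (Perms n) (suc n) (suc n ∸ r) (childStats n) k)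

module DStatistic (Γ : List Op) where
  a : ℕ
  a = #Δ Γ
  b : ℕ
  b = #Δ' Γ
  S : List ℕ → ℕ
  S σ = ∣ applyΓ Γ (D σ) ∣⁺
  g : ℕ → ℕ → Bool
  g = bigDrop a b

  S-unfold : ∀ n σ → IsPerm n σ → S σ ≡ pairCount g 0 σ
  S-unfold n σ ip rewrite IsPerm-length ip =
    trans (∣applyΓ-excess∣⁺ Γ n (λ i → at σ (pos σ (suc i) ∸ 1)) (λ i → at-bound ip (pos σ (suc i) ∸ 1)))
    (trans (countB-ext (upTo n) (λ i _ → cong (_∧ (suc i + a ≤ᵇ at σ (pos σ (suc i) ∸ 1))) (sym (≤ᵇ-suc b i))))
    (trans (countB-upTo-IsPerm ip (λ v → (suc b ≤ᵇ v) ∧ (v + a ≤ᵇ at σ (pos σ v ∸ 1))))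
    (trans (countB-ext σ (λ v _ → cong (λ w → (suc b ≤ᵇ v) ∧ (v + a ≤ᵇ w)) (at-∸1 σ (pos σ v))))
      (countB-pred≡pairCount (λ v u → (suc b ≤ᵇ v) ∧ (v + a ≤ᵇ u)) 0 σ (IsPerm⇒Unique ip)))))

module DFamily (Γ : List Op) (a≥1 : 1 ≤ #Δ Γ) where
  open DStatistic Γ

  insert-keeps : ∀ A u x → u < A → x < A → ι (g u x) ≤ ι (g u A) + ι (g A x)
  insert-keeps A u x u<A x<A = ≤-trans (ι-mono h) (m≤n+m (ι (g A x)) (ι (g u A)))
    where
    h : g u x ≡ true → g A x ≡ true
    h e with ∧≡true⇒ {suc b ≤ᵇ x} e
    ... | e1 , e2 = ∧-intro e1 (≤⇒≤ᵇ≡true (≤-trans (≤ᵇ≡true⇒≤ {x + a} e2) (<⇒≤ u<A)))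

  g-to-max-false : ∀ A u → u < A → g u A ≡ false
  g-to-max-false A u u<A = ∧-falseʳ (suc b ≤ᵇ A) (>⇒≤ᵇ≡false (<-≤-trans u<A (m≤m+n A a)))

  insert-gains≤1 : ∀ A u x → u < A → x < A → ι (g u A) + ι (g A x) ≤ suc (ι (g u x))
  insert-gains≤1 A u x u<A x<A rewrite g-to-max-false A u u<A = ≤-trans (ι≤1 (g A x)) (s≤s z≤n)

  total-gain : ∀ n → countB (λ v → g v (suc n)) (0 ∷ range n) + countB (λ v → g (suc n) v) (range n) ≡ suc n ∸ length Γ
  total-gain n = trans (cong₂ _+_ pairs-into-max pairs-out-of-max) (trans (countB-interval b a n n (≤-trans (∸-monoʳ-≤ (suc n) a≥1) ≤-refl))
            (trans (∸-+-assoc (suc n) a b) (cong (suc n ∸_) (#Δ+#Δ'≡length Γ))))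
    where
    pairs-into-max : countB (λ v → g v (suc n)) (0 ∷ range n) ≡ 0
    pairs-into-max = countB-none _ (0 ∷ range n) (λ v m → g-to-max-false (suc n) v (bnd m))
      where
      bnd : ∀ {v} → v ∈ 0 ∷ range n → v < suc n
      bnd (here refl) = s≤s z≤n
      bnd (there m) = s≤s (proj₂ (∈-range⁻ m))
    pairs-out-of-max : countB (λ v → g (suc n) v) (range n) ≡ countB (λ i → (b ≤ᵇ i) ∧ (i + a ≤ᵇ n)) (upTo n)
    pairs-out-of-max = trans (countB-map _ suc (upTo n)) (countB-ext (upTo n) (λ i _ → cong₂ _∧_ (≤ᵇ-suc b i) (≤ᵇ-suc (i + a) n)))

  S-[] : S [] ≡ 0
  S-[] rewrite applyΓ-[] Γ = refl

  countB-Perms≡Arec : ∀ n k → countB (λ z → S z ≡ᵇ k) (Perms n) ≡ Arec (length Γ) n k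
  countB-Perms≡Arec = InsertionFamily.countB-Perms≡Arec (length Γ) S g S-unfold insert-keeps insert-gains≤1 total-gain S-[]

module MStatistic (Γ : List Op) where
  a : ℕ
  a = #Δ Γ
  b : ℕ
  b = #Δ' Γ
  S : List ℕ → ℕ
  S σ = ∣ applyΓ Γ (M σ) ∣⁺
  g : ℕ → ℕ → Bool
  g = bigRise a b

  g0 : ∀ x → g x 0 ≡ false
  g0 x = ∧-falseʳ (b ≤ᵇ x) refl

  S-unfold : ∀ n σ → IsPerm n σ → S σ ≡ pairCount g 0 σ
  S-unfold n σ ip rewrite IsPerm-length ip =
    trans (∣applyΓ-excess∣⁺ Γ n (λ i → at σ (suc (pos σ i))) (λ i → at-bound ip (suc (pos σ i))))
    (trans (sym (trans (countB-upTo-sucʳ ψ n) (trans (cong (countB ψ (upTo n) +_) ψn) (+-identityʳ _))))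
    (trans (cong (countB ψ) (upTo-suc n))
    (trans (cong (ι (ψ 0) +_) (trans (countB-map ψ suc (upTo n)) (countB-upTo-IsPerm ip ψ)))
    (trans (cong (λ p → ι (g 0 (at σ (suc p))) + countB ψ σ) (pos-∉ σ (0∉IsPerm ip)))
    (trans (cong (ι (g 0 (at σ 1)) +_) (countB-succ≡succPairCount g σ (IsPerm⇒Unique ip)))
      (succPairCount≡pairCount g g0 0 σ))))))
    where
    ψ : ℕ → Bool
    ψ i = g i (at σ (suc (pos σ i)))
    ψn : ι (ψ n) ≡ 0
    ψn rewrite ∧-falseʳ (b ≤ᵇ n) {suc n + a ≤ᵇ at σ (suc (pos σ n))} (>⇒≤ᵇ≡false (s≤s (≤-trans (at-bound ip (suc (pos σ n))) (m≤m+n n a)))) = refl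

module MFamily (Γ : List Op) where
  open MStatistic Γ

  insert-keeps : ∀ A u x → u < A → x < A → ι (g u x) ≤ ι (g u A) + ι (g A x)
  insert-keeps A u x u<A x<A = ≤-trans (ι-mono h) (m≤m+n (ι (g u A)) (ι (g A x)))
    where
    h : g u x ≡ true → g u A ≡ true
    h e with ∧≡true⇒ {b ≤ᵇ u} e
    ... | e1 , e2 = ∧-intro e1 (≤⇒≤ᵇ≡true (≤-trans (≤ᵇ≡true⇒≤ {suc u + a} e2) (<⇒≤ x<A)))

  g-from-max-false : ∀ A x → x < A → g A x ≡ false
  g-from-max-false A x x<A = ∧-falseʳ (b ≤ᵇ A) (>⇒≤ᵇ≡false (≤-trans (s≤s (<⇒≤ x<A)) (m≤m+n (suc A) a)))

  insert-gains≤1 : ∀ A u x → u < A → x < A → ι (g u A) + ι (g A x) ≤ suc (ι (g u x))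
  insert-gains≤1 A u x u<A x<A rewrite g-from-max-false A x x<A | +-identityʳ (ι (g u A)) = ≤-trans (ι≤1 (g u A)) (s≤s z≤n)

  total-gain : ∀ n → countB (λ v → g v (suc n)) (0 ∷ range n) + countB (λ v → g (suc n) v) (range n) ≡ suc n ∸ length Γ
  total-gain n = trans (cong₂ _+_ pairs-into-max pairs-out-of-max) (trans (+-identityʳ _) (trans (countB-interval b a n (suc n) (m∸n≤m (suc n) a))
            (trans (∸-+-assoc (suc n) a b) (cong (suc n ∸_) (#Δ+#Δ'≡length Γ)))))
    where
    pairs-into-max : countB (λ v → g v (suc n)) (0 ∷ range n) ≡ countB (λ i → (b ≤ᵇ i) ∧ (i + a ≤ᵇ n)) (upTo (suc n))
    pairs-into-max = trans (cong (countB (λ v → g v (suc n))) (sym (upTo-suc n)))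
           (countB-ext (upTo (suc n)) (λ i _ → cong ((b ≤ᵇ i) ∧_) (≤ᵇ-suc (i + a) n)))
    pairs-out-of-max : countB (λ v → g (suc n) v) (range n) ≡ 0
    pairs-out-of-max = countB-none _ (range n) (λ v m → g-from-max-false (suc n) v (s≤s (proj₂ (∈-range⁻ m))))

  S-[] : S [] ≡ 0
  S-[] rewrite applyΓ-[] Γ = refl

  countB-Perms≡Arec : ∀ n k → countB (λ z → S z ≡ᵇ k) (Perms n) ≡ Arec (length Γ) n k
  countB-Perms≡Arec = InsertionFamily.countB-Perms≡Arec (length Γ) S g S-unfold insert-keeps insert-gains≤1 total-gain S-[]

-- Cycle insertion: E

-- The children c of y with c j = a and c a = y j for a position j of y: a is spliced into
-- the cycle of y through j.
cycleInserts : ℕ → List ℕ → List (List ℕ)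
cycleInserts a [] = []
cycleInserts a (z ∷ q) = (a ∷ q ∷ʳ z) ∷ map (z ∷_) (cycleInserts a q)

cycleInsertAll : ℕ → List ℕ → List (List ℕ)
cycleInsertAll a y = cycleInserts a y ∷ʳ (y ∷ʳ a)

PermsC : ℕ → List (List ℕ)
PermsC zero = [] ∷ []
PermsC (suc n) = concatMap (cycleInsertAll (suc n)) (PermsC n)

rotateRight : List ℕ → List ℕ
rotateRight [] = []
rotateRight (x ∷ xs) with rotateRight xs
... | [] = x ∷ []
... | h ∷ t = h ∷ x ∷ t

rotateRight-∷ʳ : ∀ q z → rotateRight (q ∷ʳ z) ≡ z ∷ q
rotateRight-∷ʳ [] z = refl
rotateRight-∷ʳ (x ∷ q) z rewrite rotateRight-∷ʳ q z = refl

uncycleInsert : ℕ → List ℕ → List ℕ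
uncycleInsert a [] = []
uncycleInsert a (x ∷ w) = if x ≡ᵇ a then rotateRight w else x ∷ uncycleInsert a w

uncycleInsert-cycleInserts : ∀ a y w → a ∉ y → w ∈ cycleInserts a y → uncycleInsert a w ≡ y
uncycleInsert-cycleInserts a (z ∷ q) .(a ∷ q ∷ʳ z) na (here refl) rewrite ≡⇒≡ᵇ≡true {a} refl = rotateRight-∷ʳ q z
uncycleInsert-cycleInserts a (z ∷ q) w na (there m) with ∈-map⁻ (z ∷_) m
... | w' , m' , refl rewrite ≢⇒≡ᵇ≡false {z} {a} (λ e → na (here (sym e))) = cong (z ∷_) (uncycleInsert-cycleInserts a q w' (λ m'' → na (there m'')) m')

uncycleInsert-∷ʳ : ∀ a y → a ∉ y → uncycleInsert a (y ∷ʳ a) ≡ y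
uncycleInsert-∷ʳ a [] na rewrite ≡⇒≡ᵇ≡true {a} refl = refl
uncycleInsert-∷ʳ a (z ∷ q) na rewrite ≢⇒≡ᵇ≡false {z} {a} (λ e → na (here (sym e))) = cong (z ∷_) (uncycleInsert-∷ʳ a q (λ m → na (there m)))

uncycleInsert-cycleInsertAll : ∀ a y w → a ∉ y → w ∈ cycleInsertAll a y → uncycleInsert a w ≡ y
uncycleInsert-cycleInsertAll a y w na m with ∈-++⁻ (cycleInserts a y) m
... | inj₁ m1 = uncycleInsert-cycleInserts a y w na m1
... | inj₂ (here refl) = uncycleInsert-∷ʳ a y na

cycleInsertAll-↭ : ∀ a y w → w ∈ cycleInsertAll a y → w ↭ a ∷ y
cycleInsertAll-↭ a y w m with ∈-++⁻ (cycleInserts a y) m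
... | inj₁ m1 = nf y w m1
  where
  nf : ∀ y w → w ∈ cycleInserts a y → w ↭ a ∷ y
  nf (z ∷ q) .(a ∷ q ∷ʳ z) (here refl) = prep a (↭-sym (∷↭∷ʳ z q))
  nf (z ∷ q) w (there m') with ∈-map⁻ (z ∷_) m'
  ... | w' , m'' , refl = ↭-trans (prep z (nf q w' m'')) (swap z a ↭-refl)
... | inj₂ (here refl) = ↭-sym (∷↭∷ʳ a y)

PermsC-IsPerm : ∀ n σ → σ ∈ PermsC n → IsPerm n σ
PermsC-IsPerm zero .[] (here refl) = ↭-refl
PermsC-IsPerm (suc n) σ m with ∈-concatMap⁻ (cycleInsertAll (suc n)) (PermsC n) m
... | y , my , mσ rewrite range-suc n =
  ↭-trans (cycleInsertAll-↭ (suc n) y σ mσ) (↭-trans (∷↭∷ʳ (suc n) y) (++⁺ʳ [ suc n ] (PermsC-IsPerm n y my)))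

cycleInserts-∷ʳ : ∀ a y w → w ∈ cycleInserts a y → ∃ λ w' → ∃ λ z → w ≡ w' ∷ʳ z × z ∈ y
cycleInserts-∷ʳ a (z ∷ q) .(a ∷ q ∷ʳ z) (here refl) = a ∷ q , z , refl , here refl
cycleInserts-∷ʳ a (z ∷ q) w (there m) with ∈-map⁻ (z ∷_) m
... | w' , m' , refl with cycleInserts-∷ʳ a q w' m'
... | w'' , z' , refl , mz = z ∷ w'' , z' , refl , there mz

Unique-cycleInserts : ∀ a y → a ∉ y → Unique (cycleInserts a y)
Unique-cycleInserts a [] na = []
Unique-cycleInserts a (z ∷ q) na = All.tabulate ne ∷ Unique-map-∷ z (Unique-cycleInserts a q (λ m → na (there m)))
  where
  ne : ∀ {w} → w ∈ map (z ∷_) (cycleInserts a q) → a ∷ q ∷ʳ z ≢ w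
  ne m e with ∈-map⁻ (z ∷_) m
  ne m refl | w' , m' , refl = na (here refl)

Unique-cycleInsertAll : ∀ a y → a ∉ y → Unique (cycleInsertAll a y)
Unique-cycleInsertAll a y na = UP.++⁺ (Unique-cycleInserts a y na) ([] ∷ []) disj
  where
  disj : ∀ {w} → w ∈ cycleInserts a y × w ∈ [ y ∷ʳ a ] → ⊥
  disj (m1 , here refl) with cycleInserts-∷ʳ a y _ m1
  ... | w' , z , e , mz with ∷ʳ-injective y w' e
  ... | _ , refl = na mz

Unique-PermsC : ∀ n → Unique (PermsC n)
Unique-PermsC zero = [] ∷ []
Unique-PermsC (suc n) = unique-concatMap (cycleInsertAll (suc n)) (uncycleInsert (suc n)) (PermsC n) (Unique-PermsC n)
  (λ y my → Unique-cycleInsertAll (suc n) y (nin y my)) (λ y w my mw → uncycleInsert-cycleInsertAll (suc n) y w (nin y my) mw)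
  where
  nin : ∀ y → y ∈ PermsC n → suc n ∉ y
  nin y my m = 1+n≰n (proj₂ (IsPerm-bound (PermsC-IsPerm n y my) m))

length-cycleInserts : ∀ (a : ℕ) y → length (cycleInserts a y) ≡ length y
length-cycleInserts a [] = refl
length-cycleInserts a (z ∷ q) = cong suc (trans (length-map (z ∷_) (cycleInserts a q)) (length-cycleInserts a q))

length-cycleInsertAll : ∀ (a : ℕ) y → length (cycleInsertAll a y) ≡ suc (length y)
length-cycleInsertAll a y = trans (length-++ (cycleInserts a y)) (trans (+-comm (length (cycleInserts a y)) 1) (cong suc (length-cycleInserts a y)))

length-Perms≡PermsC : ∀ n → length (Perms n) ≡ length (PermsC n)
length-Perms≡PermsC zero = refl
length-Perms≡PermsC (suc n) =
  trans (length-concatMap (insertAll (suc n)) (suc n) (Perms n) (λ y my → trans (length-insertAll (suc n) y) (cong suc (IsPerm-length (Perms-IsPerm n y my)))))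
  (trans (cong (_* suc n) (length-Perms≡PermsC n))
  (sym (length-concatMap (cycleInsertAll (suc n)) (suc n) (PermsC n) (λ y my → trans (length-cycleInsertAll (suc n) y) (cong suc (IsPerm-length (PermsC-IsPerm n y my)))))))

countB-PermsC≡Perms : ∀ n (q : List ℕ → Bool) → countB q (PermsC n) ≡ countB q (Perms n)
countB-PermsC≡Perms n q = unique-⊆-length≥⇒countB≡ (PermsC n) (Perms n) (Unique-PermsC n) (λ {x} m → Perms-complete n x (PermsC-IsPerm n x m))
  (≤-reflexive (length-Perms≡PermsC n)) q

module CycleInsertion (h : ℕ → ℕ → Bool) (A N : ℕ)
  (mono : ∀ o z → z < A → h o z ≡ true → h o A ≡ true)
  (h-last-false : ∀ z → z < A → h N z ≡ false) where

  cycleDeltas : ℕ → List ℕ → List ℕ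
  cycleDeltas o [] = []
  cycleDeltas o (z ∷ q) = (ι (h o A) ∸ ι (h o z)) ∷ cycleDeltas (suc o) q

  indexCount-cycleInserts : ∀ o y → o + length y ≡ N → All (_< A) y → map (indexCount h o) (cycleInserts A y) ≡ map (indexCount h o y +_) (cycleDeltas o y)
  indexCount-cycleInserts o [] e a = refl
  indexCount-cycleInserts o (z ∷ q) e (za ∷ a) = cong₂ _∷_ first rest
    where
    e' : suc o + length q ≡ N
    e' = trans (sym (+-suc o (length q))) e
    R : ℕ
    R = indexCount h (suc o) q
    le : ι (h o z) ≤ ι (h o A)
    le = ι-mono (mono o z za)
    first : indexCount h o (A ∷ q ∷ʳ z) ≡ (ι (h o z) + R) + (ι (h o A) ∸ ι (h o z))
    first rewrite indexCount-∷ʳ h (suc o) q z | e' | h-last-false z za | +-identityʳ R =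
      trans (+-comm (ι (h o A)) R) (trans (cong (R +_) (sym (m+[n∸m]≡n le)))
        (trans (sym (+-assoc R (ι (h o z)) _)) (cong (_+ (ι (h o A) ∸ ι (h o z))) (+-comm R (ι (h o z))))))
    rest : map (indexCount h o) (map (z ∷_) (cycleInserts A q)) ≡ map ((ι (h o z) + R) +_) (cycleDeltas (suc o) q)
    rest = trans (sym (map-∘ (cycleInserts A q))) (trans (map-∘ {g = ι (h o z) +_} {f = indexCount h (suc o)} (cycleInserts A q))
      (trans (cong (map (ι (h o z) +_)) (indexCount-cycleInserts (suc o) q e' a))
      (trans (sym (map-∘ (cycleDeltas (suc o) q))) (map-cong (λ d → sym (+-assoc (ι (h o z)) R d)) (cycleDeltas (suc o) q)))))

  cycleDeltas-≤1 : ∀ o y → All (_≤ 1) (cycleDeltas o y)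
  cycleDeltas-≤1 o [] = []
  cycleDeltas-≤1 o (z ∷ q) = ≤-trans (m∸n≤m (ι (h o A)) (ι (h o z))) (ι≤1 (h o A)) ∷ cycleDeltas-≤1 (suc o) q

  length-cycleDeltas : ∀ o y → length (cycleDeltas o y) ≡ length y
  length-cycleDeltas o [] = refl
  length-cycleDeltas o (z ∷ q) = cong suc (length-cycleDeltas (suc o) q)

  sum-cycleDeltas : ∀ o y → All (_< A) y → indexCount h o y + sum (cycleDeltas o y) ≡ countB (λ i → h (o + i) A) (upTo (length y))
  sum-cycleDeltas o [] a = refl
  sum-cycleDeltas o (z ∷ q) (za ∷ a) =
    trans (interchange (ι (h o z)) (indexCount h (suc o) q) (ι (h o A) ∸ ι (h o z)) (sum (cycleDeltas (suc o) q)))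
    (trans (cong₂ _+_ (m+[n∸m]≡n (ι-mono (mono o z za)))
      (trans (sum-cycleDeltas (suc o) q a) (sym (countB-ext (upTo (length q)) (λ i _ → cong (λ t → h t A) (+-suc o i))))))
      (sym (trans (countB-upTo-sucˡ (λ i → h (o + i) A) (length q)) (cong (λ t → ι (h t A) + countB (λ i → h (o + suc i) A) (upTo (length q))) (+-identityʳ o)))))

module ExcedanceFamily (a b : ℕ) (S : List ℕ → ℕ) (S-unfold : ∀ n σ → IsPerm n σ → S σ ≡ indexCount (bigRise a b) 0 σ) (S-[] : S [] ≡ 0) where
  h : ℕ → ℕ → Bool
  h = bigRise a b

  module _ (n : ℕ) where
    mono : ∀ o z → z < suc n → h o z ≡ true → h o (suc n) ≡ true
    mono o z z<A e with ∧≡true⇒ {b ≤ᵇ o} e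
    ... | e1 , e2 = ∧-intro e1 (≤⇒≤ᵇ≡true (≤-trans (≤ᵇ≡true⇒≤ {suc o + a} e2) (<⇒≤ z<A)))
    h-last-false : ∀ z → z < suc n → h n z ≡ false
    h-last-false z z<A = ∧-falseʳ (b ≤ᵇ n) (>⇒≤ᵇ≡false (≤-trans z<A (m≤m+n (suc n) a)))

  total-gain : ∀ n → countB (λ i → h i (suc n)) (upTo (suc n)) ≡ suc n ∸ (a + b)
  total-gain n = trans (countB-ext (upTo (suc n)) (λ i _ → cong ((b ≤ᵇ i) ∧_) (≤ᵇ-suc (i + a) n)))
    (trans (countB-interval b a n (suc n) (m∸n≤m (suc n) a)) (∸-+-assoc (suc n) a b))

  childStats : ∀ n y → y ∈ PermsC n → ChildStats (suc n) (suc n ∸ (a + b)) (S y) (map S (cycleInsertAll (suc n) y))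
  childStats n y my = record
    { δs = CL.cycleDeltas 0 y ++ [ ι (h n (suc n)) ]
    ; stats≡ = trans (map-cong-∈ (cycleInsertAll (suc n) y) (λ z mz → S-unfold (suc n) z (PermsC-IsPerm (suc n) z (∈-concatMap⁺ (cycleInsertAll (suc n)) (PermsC n) my mz))))
             (trans (map-++ (indexCount h 0) (cycleInserts (suc n) y) [ y ∷ʳ suc n ])
             (trans (cong₂ _++_ (CL.indexCount-cycleInserts 0 y (IsPerm-length ip) bnd) (cong [_] (trans (indexCount-∷ʳ h 0 y (suc n)) (cong (λ t → indexCount h 0 y + ι (h t (suc n))) (IsPerm-length ip)))))
             (trans (sym (map-++ (indexCount h 0 y +_) (CL.cycleDeltas 0 y) _)) (cong (λ t → map (t +_) (CL.cycleDeltas 0 y ++ [ ι (h n (suc n)) ])) (sym (S-unfold n y ip))))))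
    ; δs≤1 = AllP.++⁺ (CL.cycleDeltas-≤1 0 y) (ι≤1 _ ∷ [])
    ; length-δs = trans (length-++ (CL.cycleDeltas 0 y)) (trans (+-comm (length (CL.cycleDeltas 0 y)) 1) (cong suc (trans (CL.length-cycleDeltas 0 y) (IsPerm-length ip))))
    ; s+sum-δs≡c = begin
        S y + sum (CL.cycleDeltas 0 y ++ [ last ])                    ≡⟨ cong₂ _+_ (S-unfold n y ip) (sum-++ (CL.cycleDeltas 0 y) [ last ]) ⟩
        indexCount h 0 y + (sum (CL.cycleDeltas 0 y) + (last + 0))    ≡⟨ sym (+-assoc (indexCount h 0 y) _ _) ⟩
        (indexCount h 0 y + sum (CL.cycleDeltas 0 y)) + (last + 0)    ≡⟨ cong₂ _+_ (CL.sum-cycleDeltas 0 y bnd) (+-identityʳ last) ⟩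
        countB (λ i → h i (suc n)) (upTo (length y)) + last          ≡⟨ cong (λ t → countB (λ i → h i (suc n)) (upTo t) + last) (IsPerm-length ip) ⟩
        countB (λ i → h i (suc n)) (upTo n) + last                   ≡⟨ sym (countB-upTo-sucʳ (λ i → h i (suc n)) n) ⟩
        countB (λ i → h i (suc n)) (upTo (suc n))                    ≡⟨ total-gain n ⟩
        suc n ∸ (a + b)                                              ∎
    }
    where
    open ≡-Reasoning
    module CL = CycleInsertion h (suc n) n (mono n) (h-last-false n)
    last : ℕ
    last = ι (h n (suc n))
    ip : IsPerm n y
    ip = PermsC-IsPerm n y my
    bnd : All (_< suc n) y
    bnd = All.tabulate (λ m → s≤s (proj₂ (IsPerm-bound ip m)))

  countB-PermsC≡Arec : ∀ n k → countB (λ z → S z ≡ᵇ k) (PermsC n) ≡ Arec (a + b) n k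
  countB-PermsC≡Arec = ArecFamily.countB≡Arec (a + b) PermsC (λ _ → S) (countB-Perms0 (a + b) S S-[])
    (λ n k → concatMap-step S S (cycleInsertAll (suc n)) (PermsC n) (suc n) (suc n ∸ (a + b)) (childStats n) k)

  countB-Perms≡Arec : ∀ n k → countB (λ z → S z ≡ᵇ k) (Perms n) ≡ Arec (a + b) n k
  countB-Perms≡Arec n k = trans (sym (countB-PermsC≡Perms n (λ z → S z ≡ᵇ k))) (countB-PermsC≡Arec n k)

-- Rotations: big drops

Pair : Set
Pair = List ℕ × List ℕ

splits : List ℕ → List Pair
splits [] = ([] , []) ∷ []
splits (x ∷ xs) = ([] , x ∷ xs) ∷ map (λ pq → (x ∷ proj₁ pq , proj₂ pq)) (splits xs)

splits-++ : ∀ y {p q} → (p , q) ∈ splits y → p ++ q ≡ y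
splits-++ [] (here refl) = refl
splits-++ (x ∷ xs) (here refl) = refl
splits-++ (x ∷ xs) (there m) with ∈-map⁻ (λ pq → (x ∷ proj₁ pq , proj₂ pq)) m
... | (p' , q') , m' , refl = cong (x ∷_) (splits-++ xs m')

length-splits : ∀ y → length (splits y) ≡ suc (length y)
length-splits [] = refl
length-splits (x ∷ xs) = cong suc (trans (length-map _ (splits xs)) (length-splits xs))

Unique-splits : ∀ y → Unique (splits y)
Unique-splits [] = [] ∷ []
Unique-splits (x ∷ xs) = All.tabulate ne ∷ mu (splits xs) (Unique-splits xs)
  where
  ne : ∀ {w} → w ∈ map (λ pq → (x ∷ proj₁ pq , proj₂ pq)) (splits xs) → ([] , x ∷ xs) ≢ w
  ne m e with ∈-map⁻ (λ pq → (x ∷ proj₁ pq , proj₂ pq)) m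
  ne m () | _ , _ , refl
  mu : ∀ L → Unique L → Unique (map (λ pq → (x ∷ proj₁ pq , proj₂ pq)) L)
  mu [] [] = []
  mu (w ∷ L) (aw ∷ u) = allm L aw ∷ mu L u
    where
    inj : ∀ {w w' : Pair} → (x ∷ proj₁ w , proj₂ w) ≡ (x ∷ proj₁ w' , proj₂ w') → w ≡ w'
    inj {p , q} {.p , .q} refl = refl
    allm : ∀ L' → All (λ v → w ≢ v) L' → All (λ v → (x ∷ proj₁ w , proj₂ w) ≢ v) (map (λ pq → (x ∷ proj₁ pq , proj₂ pq)) L')
    allm [] [] = []
    allm (v ∷ L') (pv ∷ a) = (λ e → pv (inj e)) ∷ allm L' a

rotateAround : ℕ → Pair → List ℕ
rotateAround a (p , q) = q ++ a ∷ p

rotations : ℕ → List ℕ → List (List ℕ)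
rotations a y = map (rotateAround a) (splits y)

PermsR : ℕ → List (List ℕ)
PermsR zero = [] ∷ []
PermsR (suc n) = concatMap (rotations (suc n)) (PermsR n)

breakAt : ℕ → List ℕ → Pair
breakAt a [] = ([] , [])
breakAt a (x ∷ w) = if x ≡ᵇ a then ([] , w) else (x ∷ proj₁ (breakAt a w) , proj₂ (breakAt a w))

breakAt-++ : ∀ a q p → a ∉ q → breakAt a (q ++ a ∷ p) ≡ (q , p)
breakAt-++ a [] p na rewrite ≡⇒≡ᵇ≡true {a} refl = refl
breakAt-++ a (x ∷ q) p na rewrite ≢⇒≡ᵇ≡false {x} {a} (λ e → na (here (sym e))) | breakAt-++ a q p (λ m → na (there m)) = refl

unrotate : ℕ → List ℕ → List ℕ
unrotate a w = proj₂ (breakAt a w) ++ proj₁ (breakAt a w)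

breakAt-rotateAround : ∀ a y → a ∉ y → ∀ pq → pq ∈ splits y → Product.swap (breakAt a (rotateAround a pq)) ≡ pq
breakAt-rotateAround a y na (p , q) m rewrite breakAt-++ a q p (∉-++ʳ p q (subst (a ∉_) (sym (splits-++ y m)) na)) = refl

unrotate-rotations : ∀ a y w → a ∉ y → w ∈ rotations a y → unrotate a w ≡ y
unrotate-rotations a y w na m with ∈-map⁻ (rotateAround a) m
... | (p , q) , m' , refl rewrite breakAt-++ a q p (∉-++ʳ p q (subst (a ∉_) (sym (splits-++ y m')) na)) = splits-++ y m'

rotateAround-↭ : ∀ a y pq → pq ∈ splits y → rotateAround a pq ↭ a ∷ y
rotateAround-↭ a y (p , q) m = ↭-trans (shift a q p) (prep a (↭-trans (++-comm q p) (↭-reflexive (splits-++ y m))))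

PermsR-IsPerm : ∀ n σ → σ ∈ PermsR n → IsPerm n σ
PermsR-IsPerm zero .[] (here refl) = ↭-refl
PermsR-IsPerm (suc n) σ m with ∈-concatMap⁻ (rotations (suc n)) (PermsR n) m
... | y , my , mσ with ∈-map⁻ (rotateAround (suc n)) mσ
... | pq , mpq , refl rewrite range-suc n =
  ↭-trans (rotateAround-↭ (suc n) y pq mpq) (↭-trans (∷↭∷ʳ (suc n) y) (++⁺ʳ [ suc n ] (PermsR-IsPerm n y my)))

Unique-PermsR : ∀ n → Unique (PermsR n)
Unique-PermsR zero = [] ∷ []
Unique-PermsR (suc n) = unique-concatMap (rotations (suc n)) (unrotate (suc n)) (PermsR n) (Unique-PermsR n)
  (λ y my → unique-map-inv (rotateAround (suc n)) (λ w → Product.swap (breakAt (suc n) w)) (splits y) (Unique-splits y) (breakAt-rotateAround (suc n) y (nin y my)))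
  (λ y w my mw → unrotate-rotations (suc n) y w (nin y my) mw)
  where
  nin : ∀ y → y ∈ PermsR n → suc n ∉ y
  nin y my m = 1+n≰n (proj₂ (IsPerm-bound (PermsR-IsPerm n y my) m))

length-Perms≡PermsR : ∀ n → length (Perms n) ≡ length (PermsR n)
length-Perms≡PermsR zero = refl
length-Perms≡PermsR (suc n) =
  trans (length-concatMap (insertAll (suc n)) (suc n) (Perms n) (λ y my → trans (length-insertAll (suc n) y) (cong suc (IsPerm-length (Perms-IsPerm n y my)))))
  (trans (cong (_* suc n) (length-Perms≡PermsR n))
  (sym (length-concatMap (rotations (suc n)) (suc n) (PermsR n) (λ y my → trans (length-map (rotateAround (suc n)) (splits y)) (trans (length-splits y) (cong suc (IsPerm-length (PermsR-IsPerm n y my))))))))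

countB-PermsR≡Perms : ∀ n (q : List ℕ → Bool) → countB q (PermsR n) ≡ countB q (Perms n)
countB-PermsR≡Perms n q = unique-⊆-length≥⇒countB≡ (PermsR n) (Perms n) (Unique-PermsR n) (λ {x} m → Perms-complete n x (PermsR-IsPerm n x m))
  (≤-reflexive (length-Perms≡PermsR n)) q

module RotationFamily (r : ℕ) (g : ℕ → ℕ → Bool) (S : List ℕ → ℕ)
  (S-unfold : ∀ n w → IsPerm n w → S w ≡ pairCount g (suc n) w)
  (mono : ∀ u u' x → u ≤ u' → g u x ≡ true → g u' x ≡ true)
  (g-to-max-false : ∀ u Aₙ → u < Aₙ → g u Aₙ ≡ false)
  (total-gain : ∀ n → countB (g (suc (suc n))) (range n) + ι (g (suc (suc n)) (suc n)) ≡ suc n ∸ r)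
  (S-[] : S [] ≡ 0) where

  module _ (n : ℕ) where
    Aₙ : ℕ
    Aₙ = suc n
    Tₙ : ℕ
    Tₙ = suc Aₙ
    rotationDelta : ℕ → List ℕ → List ℕ → ℕ
    rotationDelta u p [] = ι (g Tₙ Aₙ)
    rotationDelta u p (x ∷ q) = ι (g Tₙ x) ∸ ι (g (lastOr u p) x)

    δs : List ℕ → List ℕ
    δs y = map (λ pq → rotationDelta Aₙ (proj₁ pq) (proj₂ pq)) (splits y)

    pairCount-rotateAround : ∀ y p q → p ++ q ≡ y → All (_< Aₙ) y → pairCount g Tₙ (q ++ Aₙ ∷ p) ≡ pairCount g Aₙ (p ++ q) + rotationDelta Aₙ p q
    pairCount-rotateAround y p [] e a rewrite ++-identityʳ p = +-comm (ι (g Tₙ Aₙ)) _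
    pairCount-rotateAround y p (x ∷ q) refl a rewrite pairCount-++ g x q (Aₙ ∷ p) | pairCount-++ g Aₙ p (x ∷ q) =
      trans (cong (λ t → ι (g Tₙ x) + (pairCount g x q + (ι t + pairCount g Aₙ p))) (g-to-max-false (lastOr x q) Aₙ Lq)) (trans (cong (λ t → t + (pairCount g x q + (0 + pairCount g Aₙ p))) (sym (m+[n∸m]≡n le)))
        (regroup (ι (g (lastOr Aₙ p) x)) (ι (g Tₙ x) ∸ ι (g (lastOr Aₙ p) x)) (pairCount g x q) (pairCount g Aₙ p)))
      where
      regroup : ∀ l d Q P → (l + d) + (Q + (0 + P)) ≡ P + (l + Q) + d
      regroup = solve-∀
      bnd : ∀ {v} → v ∈ p ++ x ∷ q → v < Aₙ
      bnd m = All.lookup a m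
      Lq : lastOr x q < Aₙ
      Lq with lastOr-∈ x q
      ... | inj₁ e rewrite e = bnd (∈-++⁺ʳ p (here refl))
      ... | inj₂ m = bnd (∈-++⁺ʳ p (there m))
      Lp : lastOr Aₙ p ≤ Aₙ
      Lp with lastOr-∈ Aₙ p
      ... | inj₁ e = ≤-reflexive e
      ... | inj₂ m = <⇒≤ (bnd (∈-++⁺ˡ m))
      le : ι (g (lastOr Aₙ p) x) ≤ ι (g Tₙ x)
      le = ι-mono (mono (lastOr Aₙ p) Tₙ x (≤-trans Lp (n≤1+n Aₙ)))

    sum-rotationDeltas : ∀ u y → u ≤ Aₙ → All (_< Aₙ) y → pairCount g u y + sum (map (λ pq → rotationDelta u (proj₁ pq) (proj₂ pq)) (splits y)) ≡ countB (g Tₙ) y + ι (g Tₙ Aₙ)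
    sum-rotationDeltas u [] u≤ a = +-identityʳ _
    sum-rotationDeltas u (x ∷ xs) u≤ (xa ∷ a) rewrite sym (map-∘ {g = λ pq → rotationDelta u (proj₁ pq) (proj₂ pq)} {f = λ pq → (x ∷ proj₁ pq , proj₂ pq)} (splits xs)) =
      trans (cong (λ t → ι (g u x) + pairCount g x xs + ((ι (g Tₙ x) ∸ ι (g u x)) + sum t)) (map-cong rotationDelta-shift (splits xs)))
      (trans (interchange (ι (g u x)) (pairCount g x xs) (ι (g Tₙ x) ∸ ι (g u x)) (sum (map (λ pq → rotationDelta x (proj₁ pq) (proj₂ pq)) (splits xs))))
      (trans (cong₂ _+_ (m+[n∸m]≡n (ι-mono (mono u Tₙ x (≤-trans u≤ (n≤1+n Aₙ))))) (sum-rotationDeltas x xs (<⇒≤ xa) a))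
        (sym (+-assoc (ι (g Tₙ x)) _ _))))
      where
      rotationDelta-shift : ∀ pq → rotationDelta u (x ∷ proj₁ pq) (proj₂ pq) ≡ rotationDelta x (proj₁ pq) (proj₂ pq)
      rotationDelta-shift (p , []) = refl
      rotationDelta-shift (p , y ∷ q) = refl

  childStats : ∀ n y → y ∈ PermsR n → ChildStats (suc n) (suc n ∸ r) (S y) (map S (rotations (suc n) y))
  childStats n y my = record
    { δs = δs n y
    ; stats≡ = trans (sym (map-∘ (splits y))) (trans (map-cong-∈ (splits y) S-rotateAround) (map-∘ (splits y)))
    ; δs≤1 = rotationDeltas≤1 (splits y)
    ; length-δs = trans (length-map _ (splits y)) (trans (length-splits y) (cong suc (IsPerm-length ip)))
    ; s+sum-δs≡c = trans (cong (_+ sum (δs n y)) (S-unfold n y ip)) (trans (sum-rotationDeltas n (suc n) y ≤-refl bnd)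
             (trans (cong (_+ ι (g (suc (suc n)) (suc n))) (countB-↭ (g (suc (suc n))) ip)) (total-gain n)))
    }
    where
    ip : IsPerm n y
    ip = PermsR-IsPerm n y my
    bnd : All (_< suc n) y
    bnd = All.tabulate (λ m → s≤s (proj₂ (IsPerm-bound ip m)))
    S-rotateAround : ∀ pq → pq ∈ splits y → S (rotateAround (suc n) pq) ≡ S y + rotationDelta n (suc n) (proj₁ pq) (proj₂ pq)
    S-rotateAround (p , q) m = trans (S-unfold (suc n) (q ++ suc n ∷ p) (PermsR-IsPerm (suc n) _ (∈-concatMap⁺ (rotations (suc n)) (PermsR n) my (∈-map⁺ (rotateAround (suc n)) m))))
      (trans (pairCount-rotateAround n y p q (splits-++ y m) bnd) (trans (cong (λ t → pairCount g (suc n) t + _) (splits-++ y m)) (cong (_+ rotationDelta n (suc n) p q) (sym (S-unfold n y ip)))))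
    rotationDeltas≤1 : ∀ L → All (_≤ 1) (map (λ pq → rotationDelta n (suc n) (proj₁ pq) (proj₂ pq)) L)
    rotationDeltas≤1 [] = []
    rotationDeltas≤1 ((p , []) ∷ L) = ι≤1 _ ∷ rotationDeltas≤1 L
    rotationDeltas≤1 ((p , x ∷ q) ∷ L) = ≤-trans (m∸n≤m (ι (g (Tₙ n) x)) (ι (g (lastOr (suc n) p) x))) (ι≤1 (g (Tₙ n) x)) ∷ rotationDeltas≤1 L

  countB-PermsR≡Arec : ∀ n k → countB (λ z → S z ≡ᵇ k) (PermsR n) ≡ Arec r n k
  countB-PermsR≡Arec = ArecFamily.countB≡Arec r PermsR (λ _ → S) (countB-Perms0 r S S-[])
    (λ n k → concatMap-step S S (rotations (suc n)) (PermsR n) (suc n) (suc n ∸ r) (childStats n) k)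

  countB-Perms≡Arec : ∀ n k → countB (λ z → S z ≡ᵇ k) (Perms n) ≡ Arec r n k
  countB-Perms≡Arec n k = trans (sym (countB-PermsR≡Perms n (λ z → S z ≡ᵇ k))) (countB-PermsR≡Arec n k)

module BigDropFamily (a b r : ℕ) (a≥1 : 1 ≤ a) (ab : a + b ≡ suc r) (S : List ℕ → ℕ)
  (S-unfold : ∀ n w → IsPerm n w → S w ≡ pairCount (bigDrop a b) (suc n) w) (S-[] : S [] ≡ 0) where

  g : ℕ → ℕ → Bool
  g = bigDrop a b

  mono : ∀ u u' x → u ≤ u' → g u x ≡ true → g u' x ≡ true
  mono u u' x le e with ∧≡true⇒ {suc b ≤ᵇ x} e
  ... | e1 , e2 = ∧-intro e1 (≤⇒≤ᵇ≡true (≤-trans (≤ᵇ≡true⇒≤ {x + a} e2) le))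

  g-to-max-false : ∀ u A → u < A → g u A ≡ false
  g-to-max-false u A u<A = ∧-falseʳ (suc b ≤ᵇ A) (>⇒≤ᵇ≡false (<-≤-trans u<A (m≤m+n A a)))

  total-gain : ∀ n → countB (g (suc (suc n))) (range n) + ι (g (suc (suc n)) (suc n)) ≡ suc n ∸ r
  total-gain n = begin
    countB (g T') (range n) + ι (g T' (suc n)) ≡⟨ cong (countB (g T') (range n) +_) (sym (+-identityʳ _)) ⟩
    countB (g T') (range n) + countB (g T') [ suc n ] ≡⟨ sym (countB-++ (g T') (range n) [ suc n ]) ⟩
    countB (g T') (range n ++ [ suc n ]) ≡⟨ cong (countB (g T')) (sym (range-suc n)) ⟩
    countB (g T') (range (suc n)) ≡⟨ countB-map (g T') suc (upTo (suc n)) ⟩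
    countB (λ i → g T' (suc i)) (upTo (suc n)) ≡⟨ countB-ext (upTo (suc n)) (λ i _ → cong₂ _∧_ (≤ᵇ-suc b i) (≤ᵇ-suc (i + a) (suc n))) ⟩
    countB (λ i → (b ≤ᵇ i) ∧ (i + a ≤ᵇ suc n)) (upTo (suc n)) ≡⟨ countB-interval b a (suc n) (suc n) (∸-monoʳ-≤ (suc (suc n)) a≥1) ⟩
    (suc (suc n) ∸ a) ∸ b ≡⟨ ∸-+-assoc (suc (suc n)) a b ⟩
    suc (suc n) ∸ (a + b) ≡⟨ cong (suc (suc n) ∸_) ab ⟩
    suc n ∸ r ∎
    where
    open ≡-Reasoning
    T' : ℕ
    T' = suc (suc n)

  countB-Perms≡Arec : ∀ n k → countB (λ z → S z ≡ᵇ k) (Perms n) ≡ Arec r n k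
  countB-Perms≡Arec = RotationFamily.countB-Perms≡Arec r g S S-unfold mono g-to-max-false total-gain S-[]

-- The statistic D + D′

D'Condition : List ℕ → ℕ → Bool
D'Condition τ p = saillantAt τ p ∧ ((p ≡ᵇ length τ) ∨ ((p ≤ᵇ (length τ ∸ 1)) ∧ saillantAt τ (suc p)))

DD'Test : ℕ → List ℕ → ℕ → ℕ → Bool
DD'Test b σ x p = (suc b ≤ᵇ x) ∧ ((x ≤ᵇ at σ (p ∸ 1)) ∨ D'Condition σ p)

module DD'Statistic (Γ : List Op) (a0 : #Δ Γ ≡ 0) where
  b : ℕ
  b = #Δ' Γ
  S : List ℕ → ℕ
  S σ = ∣ applyΓ Γ (DD' σ) ∣⁺

  Φ : List ℕ → ℕ → ℕ → Bool
  Φ = DD'Test b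

  S-unfold : ∀ n σ → IsPerm n σ → S σ ≡ indexCount (flip (Φ σ)) 1 σ
  S-unfold n σ ip =
    trans (cong ∣_∣⁺ (cong (applyΓ Γ) (⊕-map (λ i → at σ (pos σ (suc i) ∸ 1) ∸ i) (λ i → ι (D'Condition σ (pos σ (suc i)))) (upTo L))))
    (trans (∣applyΓ-map-upTo∣⁺ Γ h L)
    (trans (cong (λ t → countB (λ i → suc t ≤ᵇ h (b + i)) (upTo (L ∸ (t + b)))) a0)
    (trans (countB-upTo-window (λ i → 1 ≤ᵇ h i) 0 b L (λ i le lt → ⊥-elim (<⇒≱ lt le)))
    (trans (countB-ext (upTo L) (λ i _ → cong ((b ≤ᵇ i) ∧_) (trans (1≤ᵇ+ι (at σ (pos σ (suc i) ∸ 1) ∸ i) (D'Condition σ (pos σ (suc i))))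
             (cong (_∨ D'Condition σ (pos σ (suc i))) (trans (≤ᵇ-∸ 0 (at σ (pos σ (suc i) ∸ 1)) i) (cong (_≤ᵇ at σ (pos σ (suc i) ∸ 1)) (+-identityʳ (suc i))))))))
    (trans (countB-ext (upTo L) (λ i _ → cong (_∧ _) (sym (≤ᵇ-suc b i))))
    (trans (cong (λ t → countB (λ i → Φ σ (suc i) (pos σ (suc i))) (upTo t)) (IsPerm-length ip))
    (trans (countB-upTo-IsPerm ip (λ v → Φ σ v (pos σ v)))
      (countB≡indexCount (Φ σ) 0 σ (IsPerm⇒Unique ip)))))))))
    where
    L : ℕ
    L = length σ
    h : ℕ → ℕ
    h i = (at σ (pos σ (suc i) ∸ 1) ∸ i) + ι (D'Condition σ (pos σ (suc i)))

precedesLarger : ℕ → List ℕ → Bool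
precedesLarger x [] = true
precedesLarger x (y ∷ _) = x <ᵇ y

-- scan M u xs evaluates DD'Test along xs, where M and u are the maximum and the last entry
-- of the prefix already read.
module SaillantScan (b : ℕ) where
  scan : ℕ → ℕ → List ℕ → ℕ
  scan M u [] = 0
  scan M u (x ∷ xs) = ι ((suc b ≤ᵇ x) ∧ ((x ≤ᵇ u) ∨ ((M <ᵇ x) ∧ precedesLarger x xs))) + scan (M ⊔ x) x xs

allB-prefix-at : ∀ pre rest (c : ℕ) → allB (λ q → at (pre ++ rest) (suc q) <ᵇ c) (upTo (length pre)) ≡ allB (λ y → y <ᵇ c) pre
allB-prefix-at [] rest c = refl
allB-prefix-at (y ∷ pre) rest c = cong ((y <ᵇ c) ∧_) (trans (cong (allB _) (sym (map-upTo suc (length pre))))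
  (trans (allB-map _ suc (upTo (length pre))) (trans (allB-ext (upTo (length pre)) (λ q → refl')) (allB-prefix-at pre rest c))))
  where
  refl' : ∀ {q} → (at (y ∷ pre ++ rest) (suc (suc q)) <ᵇ c) ≡ (at (pre ++ rest) (suc q) <ᵇ c)
  refl' = refl

allB-<ᵇ≡maximum-<ᵇ : ∀ pre c → 1 ≤ c → allB (λ y → y <ᵇ c) pre ≡ (maximum pre <ᵇ c)
allB-<ᵇ≡maximum-<ᵇ [] (suc c) _ = refl
allB-<ᵇ≡maximum-<ᵇ (y ∷ pre) c c≥1 = trans (cong ((y <ᵇ c) ∧_) (allB-<ᵇ≡maximum-<ᵇ pre c c≥1)) (sym (⊔<ᵇ y (maximum pre) c))

saillantAt-++ : ∀ σ pre x xs → σ ≡ pre ++ x ∷ xs → 1 ≤ x → saillantAt σ (suc (length pre)) ≡ (maximum pre <ᵇ x)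
saillantAt-++ σ pre x xs refl x≥1 =
  trans (allB-ext (upTo (length pre)) (λ q → cong (at σ (suc q) <ᵇ_) (at-++-suc-length pre x xs)))
    (trans (allB-prefix-at pre (x ∷ xs) x) (allB-<ᵇ≡maximum-<ᵇ pre x x≥1))

D'Condition-++ : ∀ σ pre x xs → σ ≡ pre ++ x ∷ xs → All (1 ≤_) (x ∷ xs) →
  D'Condition σ (suc (length pre)) ≡ ((maximum pre <ᵇ x) ∧ precedesLarger x xs)
D'Condition-++ σ pre x xs e (x≥1 ∷ a) =
  trans (cong (_∧ next-saillant) (saillantAt-++ σ pre x xs e x≥1)) (rest xs refl)
  where
  next-saillant : Bool
  next-saillant = (suc (length pre) ≡ᵇ length σ) ∨ ((suc (length pre) ≤ᵇ (length σ ∸ 1)) ∧ saillantAt σ (suc (suc (length pre))))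
  lenσ : length σ ≡ length pre + suc (length xs)
  lenσ = trans (cong length e) (length-++ pre)
  rest : ∀ ys → ys ≡ xs → ((maximum pre <ᵇ x) ∧ next-saillant) ≡ ((maximum pre <ᵇ x) ∧ precedesLarger x ys)
  rest [] refl rewrite lenσ | +-comm (length pre) 1 | ≡⇒≡ᵇ≡true {length pre} refl with maximum pre <ᵇ x
  ... | true = refl
  ... | false = refl
  rest (y ∷ ys) refl rewrite lenσ | ≡ᵇ-suc-+ (length pre) (length ys) | ≤⇒≤ᵇ≡true {suc (length pre)} {length pre + suc (suc (length ys)) ∸ 1} (suc≤+2+∸1 (length pre) (length ys)) =
    trans (cong ((maximum pre <ᵇ x) ∧_) saillant-y) (<ᵇ-∧-⊔<ᵇ (maximum pre) x y)
    where
    saillant-y : saillantAt σ (suc (suc (length pre))) ≡ ((maximum pre ⊔ x) <ᵇ y)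
    saillant-y = trans (cong (λ t → saillantAt σ (suc t)) (sym (length-∷ʳ pre x)))
      (trans (saillantAt-++ σ (pre ∷ʳ x) y ys (trans e (sym (++-assoc pre [ x ] (y ∷ ys)))) (All.lookup a (here refl)))
        (cong (_<ᵇ y) (maximum-∷ʳ pre x)))

module ScanConversion (b : ℕ) where
  open SaillantScan b

  indexCount≡scan : ∀ σ pre rest → σ ≡ pre ++ rest → All (1 ≤_) rest →
    indexCount (flip (DD'Test b σ)) (suc (length pre)) rest ≡ scan (maximum pre) (lastOr 0 pre) rest
  indexCount≡scan σ pre [] e a = refl
  indexCount≡scan σ pre (x ∷ xs) e (x≥1 ∷ a) = cong₂ _+_ (cong ι head) tl
    where
    tl : indexCount (flip (DD'Test b σ)) (suc (suc (length pre))) xs ≡ scan (maximum pre ⊔ x) x xs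
    tl = trans (cong (λ t → indexCount (flip (DD'Test b σ)) (suc t) xs) (sym (length-∷ʳ pre x)))
         (trans (indexCount≡scan σ (pre ∷ʳ x) xs (trans e (sym (++-assoc pre [ x ] xs))) a)
           (cong₂ (λ t t' → scan t t' xs) (maximum-∷ʳ pre x) (lastOr-∷ʳ 0 pre x)))
    head : DD'Test b σ x (suc (length pre)) ≡ ((suc b ≤ᵇ x) ∧ ((x ≤ᵇ lastOr 0 pre) ∨ ((maximum pre <ᵇ x) ∧ precedesLarger x xs)))
    head = cong₂ (λ t t' → (suc b ≤ᵇ x) ∧ ((x ≤ᵇ t) ∨ t'))
      (trans (cong (λ t → at t (length pre)) e) (at-++-length pre (x ∷ xs))) (D'Condition-++ σ pre x xs e (x≥1 ∷ a))

record SplitAtMax (w : List ℕ) : Set where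
  field
    p t : List ℕ
    eq : w ≡ p ++ maximum w ∷ t
    brk-eq : breakAt (maximum w) w ≡ (p , t)
    p< : All (_< maximum w) p
    t< : All (_< maximum w) t

splitAtMax : ∀ x w → Unique (x ∷ w) → SplitAtMax (x ∷ w)
splitAtMax x w u with ∈-∃++ (maximum-∈ x w)
... | p , t , e = record { p = p ; t = t ; eq = e ; brk-eq = trans (cong (breakAt (maximum (x ∷ w))) e) (breakAt-++ _ p t (proj₁ mid)) ;
                    p< = All.tabulate (λ mp → lt (∈-++⁺ˡ mp) (λ eq → proj₁ mid (subst (_∈ p) eq mp))) ;
                    t< = All.tabulate (λ mt → lt (∈-++⁺ʳ p (there mt)) (λ eq → proj₂ mid (subst (_∈ t) eq mt))) }
  where
  u' : Unique (p ++ maximum (x ∷ w) ∷ t)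
  u' = subst Unique e u
  mid : maximum (x ∷ w) ∉ p × maximum (x ∷ w) ∉ t
  mid = Unique-middle p (maximum (x ∷ w)) t u'
  lt : ∀ {y} → y ∈ p ++ maximum (x ∷ w) ∷ t → y ≢ maximum (x ∷ w) → y < maximum (x ∷ w)
  lt m ne = ≤∧≢⇒< (maximum-≥ (x ∷ w) (subst (_ ∈_) (sym e) m)) ne

-- The fuel only makes the recursion structural; it is always taken ≥ length w.
moveMax : ℕ → List ℕ → List ℕ
moveMax zero w = w
moveMax (suc f) [] = []
moveMax (suc f) (x ∷ w) = proj₂ (breakAt (maximum (x ∷ w)) (x ∷ w)) ++ maximum (x ∷ w) ∷ moveMax f (proj₁ (breakAt (maximum (x ∷ w)) (x ∷ w)))

moveMax⁻¹ : ℕ → List ℕ → List ℕ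
moveMax⁻¹ zero u = u
moveMax⁻¹ (suc f) [] = []
moveMax⁻¹ (suc f) (x ∷ u) = moveMax⁻¹ f (proj₂ (breakAt (maximum (x ∷ u)) (x ∷ u))) ++ maximum (x ∷ u) ∷ proj₁ (breakAt (maximum (x ∷ u)) (x ∷ u))

moveMax⁻¹-step : ∀ f v → v ≢ [] → moveMax⁻¹ (suc f) v ≡ moveMax⁻¹ f (proj₂ (breakAt (maximum v) v)) ++ maximum v ∷ proj₁ (breakAt (maximum v) v)
moveMax⁻¹-step f [] ne = ⊥-elim (ne refl)
moveMax⁻¹-step f (x ∷ v) ne = refl

length-prefix< : ∀ (p : List ℕ) m t → length p < length (p ++ m ∷ t)
length-prefix< p m t rewrite length-++ p {m ∷ t} = ≤-trans (≤-reflexive (+-comm 1 (length p))) (+-monoʳ-≤ (length p) (s≤s z≤n))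

module MoveMax where
  moveMax-↭ : ∀ f w → length w ≤ f → Unique w → moveMax f w ↭ w
  moveMax-↭ zero [] le u = ↭-refl
  moveMax-↭ (suc f) [] le u = ↭-refl
  moveMax-↭ (suc f) (x ∷ w) le u with splitAtMax x w u
  ... | record { p = p ; t = t ; eq = e ; brk-eq = be } rewrite be =
    ↭-trans (++⁺ˡ t (prep (maximum (x ∷ w)) (moveMax-↭ f p lp up)))
      (↭-trans (shift (maximum (x ∷ w)) t p) (↭-trans (prep _ (++-comm t p)) (↭-trans (↭-sym (shift (maximum (x ∷ w)) p t)) (↭-reflexive (sym e)))))
    where
    lp : length p ≤ f
    lp = ≤-pred (≤-trans (length-prefix< p (maximum (x ∷ w)) t) (≤-trans (≤-reflexive (cong length (sym e))) le))
    up : Unique p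
    up = Unique-++ˡ p (subst Unique e u)

  length-moveMax : ∀ f w → length w ≤ f → Unique w → length (moveMax f w) ≡ length w
  length-moveMax f w le u = ↭-length (moveMax-↭ f w le u)

  moveMax⁻¹-moveMax : ∀ f w → length w ≤ f → Unique w → moveMax⁻¹ f (moveMax f w) ≡ w
  moveMax⁻¹-moveMax zero [] le u = refl
  moveMax⁻¹-moveMax (suc f) [] le u = refl
  moveMax⁻¹-moveMax (suc f) (x ∷ w) le u with splitAtMax x w u
  ... | record { p = p ; t = t ; eq = e ; brk-eq = be ; p< = p< ; t< = t< } rewrite be =
    trans (moveMax⁻¹-step f (t ++ m ∷ moveMax f p) ne)
    (trans (cong (λ z → moveMax⁻¹ f (proj₂ (breakAt z v)) ++ z ∷ proj₁ (breakAt z v)) mx)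
    (trans (cong (λ z → moveMax⁻¹ f (proj₂ z) ++ m ∷ proj₁ z) (breakAt-++ m t (moveMax f p) m∉t))
    (trans (cong (_++ m ∷ t) (moveMax⁻¹-moveMax f p lp up)) (sym e))))
    where
    m : ℕ
    m = maximum (x ∷ w)
    v : List ℕ
    v = t ++ m ∷ moveMax f p
    ne : v ≢ []
    ne = nonempty t
      where
      nonempty : ∀ t' → t' ++ m ∷ moveMax f p ≢ []
      nonempty [] ()
      nonempty (_ ∷ _) ()
    lp : length p ≤ f
    lp = ≤-pred (≤-trans (length-prefix< p m t) (≤-trans (≤-reflexive (cong length (sym e))) le))
    up : Unique p
    up = Unique-++ˡ p (subst Unique e u)
    m∉t : m ∉ t
    m∉t mt = <-irrefl refl (All.lookup t< mt)
    mx : maximum v ≡ m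
    mx = maximum-≡ v m (∈-++⁺ʳ t (here refl)) bound
      where
      bound : ∀ {y} → y ∈ v → y ≤ m
      bound mv with ∈-++⁻ t mv
      ... | inj₁ mt = <⇒≤ (All.lookup t< mt)
      ... | inj₂ (here refl) = ≤-refl
      ... | inj₂ (there mT) = <⇒≤ (All.lookup p< (∈-resp-↭ (moveMax-↭ f p lp up) mT))

descentAbove : ℕ → ℕ → ℕ → Bool
descentAbove b u v = (suc b ≤ᵇ v) ∧ (suc v ≤ᵇ u)

module MoveMaxStatistic (b : ℕ) where
  open SaillantScan b

  precedesLarger-++ : ∀ x p' m t → x < m → precedesLarger x (p' ++ m ∷ t) ≡ precedesLarger x p'
  precedesLarger-++ x [] m t x<m = <⇒<ᵇ≡true x<m
  precedesLarger-++ x (y ∷ p') m t x<m = refl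

  scan-++ : ∀ M u p m t → All (_< m) p → scan M u (p ++ m ∷ t) ≡ scan M u p + scan (M ⊔ maximum p) (lastOr u p) (m ∷ t)
  scan-++ M u [] m t a = cong (λ z → scan z u (m ∷ t)) (sym (⊔-identityʳ M))
  scan-++ M u (x ∷ p) m t (x<m ∷ a) =
    trans (cong (λ z → ι ((suc b ≤ᵇ x) ∧ ((x ≤ᵇ u) ∨ ((M <ᵇ x) ∧ z))) + scan (M ⊔ x) x (p ++ m ∷ t)) (precedesLarger-++ x p m t x<m))
    (trans (cong (ι ((suc b ≤ᵇ x) ∧ ((x ≤ᵇ u) ∨ ((M <ᵇ x) ∧ precedesLarger x p)))  +_) (scan-++ (M ⊔ x) x p m t a))
    (trans (sym (+-assoc (ι ((suc b ≤ᵇ x) ∧ ((x ≤ᵇ u) ∨ ((M <ᵇ x) ∧ precedesLarger x p)))) _ _))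
      (cong (λ z → ι ((suc b ≤ᵇ x) ∧ ((x ≤ᵇ u) ∨ ((M <ᵇ x) ∧ precedesLarger x p))) + scan (M ⊔ x) x p + scan z (lastOr x p) (m ∷ t)) (⊔-assoc M x (maximum p)))))

  scan-belowMax : ∀ M u t → All (_< M) t → Unique (u ∷ t) → scan M u t ≡ pairCount (descentAbove b) u t
  scan-belowMax M u [] a uq = refl
  scan-belowMax M u (x ∷ t) (x<M ∷ a) ((u≢x ∷ _) ∷ uq) rewrite ≥⇒<ᵇ≡false {M} {x} (<⇒≤ x<M) | ∨-identityʳ (x ≤ᵇ u) | m≥n⇒m⊔n≡m (<⇒≤ x<M) =
    cong₂ _+_ (cong (λ z → ι ((suc b ≤ᵇ x) ∧ z)) (≢⇒≤ᵇ≡suc-≤ᵇ (λ e → u≢x (sym e)))) (scan-belowMax M x t a uq)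

  pairCount-start : ∀ N m t → All (_< m) t → m < N → pairCount (descentAbove b) N t ≡ pairCount (descentAbove b) m t
  pairCount-start N m [] a m<N = refl
  pairCount-start N m (y ∷ t) (y<m ∷ a) m<N rewrite ≤⇒≤ᵇ≡true {suc y} {N} (<-trans y<m m<N) | ≤⇒≤ᵇ≡true {suc y} {m} y<m = refl

  descentAbove-lastOr : ∀ N m t → All (_< m) t → m < N → descentAbove b (lastOr N t) m ≡ ((suc b ≤ᵇ m) ∧ precedesLarger m t)
  descentAbove-lastOr N m [] _ m<N = cong ((suc b ≤ᵇ m) ∧_) (≤⇒≤ᵇ≡true m<N)
  descentAbove-lastOr N m (y ∷ t) (y<m ∷ t<m) _ with lastOr-∈ y t
  ... | inj₁ e rewrite e | >⇒≤ᵇ≡false {suc m} {y} (≤-trans y<m (n≤1+n m)) = refl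
  ... | inj₂ yt rewrite >⇒≤ᵇ≡false {suc m} {lastOr y t} (≤-trans (All.lookup t<m yt) (n≤1+n m)) | ≥⇒<ᵇ≡false {m} {y} (<⇒≤ y<m) = refl

  scan-atMax : ∀ p m t → 1 ≤ m → All (_< m) p → All (_< m) t → Unique (m ∷ t) →
    scan (0 ⊔ maximum p) (lastOr 0 p) (m ∷ t) ≡ ι ((suc b ≤ᵇ m) ∧ precedesLarger m t) + pairCount (descentAbove b) m t
  scan-atMax p m t m≥1 p<m t<m u
    rewrite >⇒≤ᵇ≡false {m} {lastOr 0 p} (lastOr-< p m≥1 p<m) | <⇒<ᵇ≡true (maximum-< p m m≥1 p<m) | m≤n⇒m⊔n≡n (<⇒≤ (maximum-< p m m≥1 p<m)) =
    cong (ι ((suc b ≤ᵇ m) ∧ precedesLarger m t) +_) (scan-belowMax m m t t<m u)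

  open MoveMax

  scan≡pairCount-moveMax : ∀ f w N → length w ≤ f → Unique w → All (λ y → 1 ≤ y × y < N) w → scan 0 0 w ≡ pairCount (descentAbove b) N (moveMax f w)
  scan≡pairCount-moveMax zero [] N le u a = refl
  scan≡pairCount-moveMax (suc f) [] N le u a = refl
  scan≡pairCount-moveMax (suc f) (x ∷ w) N le u a with splitAtMax x w u
  ... | record { p = p ; t = t ; eq = e ; brk-eq = be ; p< = p< ; t< = t< } rewrite be = begin
    scan 0 0 (x ∷ w)                                        ≡⟨ cong (scan 0 0) e ⟩
    scan 0 0 (p ++ m ∷ t)                                   ≡⟨ scan-++ 0 0 p m t p< ⟩
    scan 0 0 p + scan (0 ⊔ maximum p) (lastOr 0 p) (m ∷ t)   ≡⟨ cong₂ _+_ (scan≡pairCount-moveMax f p m lp up ap) (scan-atMax p m t m≥1 p< t< (Unique-++ʳ p u')) ⟩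
    left + (peak + right)                                             ≡⟨ swap-ends left peak right ⟩
    right + (peak + left)                                             ≡⟨ cong₂ (λ z z' → z + (ι z' + left)) (sym (pairCount-start N m t t< m<N)) (sym (descentAbove-lastOr N m t t< m<N)) ⟩
    pairCount (descentAbove b) N t + (ι (descentAbove b (lastOr N t) m) + left) ≡⟨ sym (pairCount-++ (descentAbove b) N t (m ∷ moveMax f p)) ⟩
    pairCount (descentAbove b) N (t ++ m ∷ moveMax f p)      ∎
    where
    open ≡-Reasoning
    swap-ends : ∀ x y z → x + (y + z) ≡ z + (y + x)
    swap-ends = solve-∀
    m : ℕ
    m = maximum (x ∷ w)
    left : ℕ
    left = pairCount (descentAbove b) m (moveMax f p)
    peak : ℕ
    peak = ι ((suc b ≤ᵇ m) ∧ precedesLarger m t)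
    right : ℕ
    right = pairCount (descentAbove b) m t
    u' : Unique (p ++ m ∷ t)
    u' = subst Unique e u
    lp : length p ≤ f
    lp = ≤-pred (≤-trans (length-prefix< p m t) (≤-trans (≤-reflexive (cong length (sym e))) le))
    up : Unique p
    up = Unique-++ˡ p u'
    a' : All (λ y → 1 ≤ y × y < N) (p ++ m ∷ t)
    a' = subst (All (λ y → 1 ≤ y × y < N)) e a
    m≥1 : 1 ≤ m
    m≥1 = proj₁ (All.lookup a' (∈-++⁺ʳ p (here refl)))
    m<N : m < N
    m<N = proj₂ (All.lookup a' (∈-++⁺ʳ p (here refl)))
    ap : All (λ y → 1 ≤ y × y < m) p
    ap = All.tabulate (λ mp → proj₁ (All.lookup a' (∈-++⁺ˡ mp)) , All.lookup p< mp)

rearrange : List ℕ → List ℕ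
rearrange σ = moveMax (length σ) σ

rearrange⁻¹ : List ℕ → List ℕ
rearrange⁻¹ u = moveMax⁻¹ (length u) u

-- PermsC rather than Perms: transporting counts along rearrange needs a duplicate-free list.
module DD'Family (Γ : List Op) (a0 : #Δ Γ ≡ 0) where
  b : ℕ
  b = #Δ' Γ
  open DD'Statistic Γ a0 using (S; S-unfold)
  open ScanConversion b
  open MoveMaxStatistic b
  open MoveMax

  bigDropStat : List ℕ → ℕ
  bigDropStat u = pairCount (bigDrop 1 b) (suc (length u)) u

  S≡bigDropStat-rearrange : ∀ n σ → IsPerm n σ → S σ ≡ bigDropStat (rearrange σ)
  S≡bigDropStat-rearrange n σ ip = trans (S-unfold n σ ip)
    (trans (indexCount≡scan σ [] σ refl (All.tabulate (λ m → proj₁ (IsPerm-bound ip m))))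
    (trans (scan≡pairCount-moveMax (length σ) σ (suc (length σ)) ≤-refl (IsPerm⇒Unique ip)
              (All.tabulate (λ m → proj₁ (IsPerm-bound ip m) , ≤-trans (s≤s (proj₂ (IsPerm-bound ip m))) (≤-reflexive (cong suc (sym (IsPerm-length ip)))))))
    (trans (pairCount-ext (descentAbove b) (bigDrop 1 b) (λ u v → cong (λ z → (suc b ≤ᵇ v) ∧ (z ≤ᵇ u)) (+-comm 1 v)) (suc (length σ)) (rearrange σ))
      (cong (λ z → pairCount (bigDrop 1 b) (suc z) (rearrange σ)) (sym (length-moveMax (length σ) σ ≤-refl (IsPerm⇒Unique ip)))))))

  rearrange-IsPerm : ∀ n σ → IsPerm n σ → IsPerm n (rearrange σ)
  rearrange-IsPerm n σ ip = ↭-trans (moveMax-↭ (length σ) σ ≤-refl (IsPerm⇒Unique ip)) ip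

  rearrange⁻¹-rearrange : ∀ n σ → IsPerm n σ → rearrange⁻¹ (rearrange σ) ≡ σ
  rearrange⁻¹-rearrange n σ ip = trans (cong (λ z → moveMax⁻¹ z (rearrange σ)) (length-moveMax (length σ) σ ≤-refl (IsPerm⇒Unique ip))) (moveMax⁻¹-moveMax (length σ) σ ≤-refl (IsPerm⇒Unique ip))

  countB-rearrange : ∀ n (q : List ℕ → Bool) → countB (λ σ → q (rearrange σ)) (PermsC n) ≡ countB q (Perms n)
  countB-rearrange n q = trans (sym (countB-map q rearrange (PermsC n)))
    (unique-⊆-length≥⇒countB≡ (map rearrange (PermsC n)) (Perms n)
      (unique-map-inv rearrange rearrange⁻¹ (PermsC n) (Unique-PermsC n) (λ s m → rearrange⁻¹-rearrange n s (PermsC-IsPerm n s m)))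
      sub (≤-reflexive (trans (length-Perms≡PermsC n) (sym (length-map rearrange (PermsC n))))) q)
    where
    sub : ∀ {x} → x ∈ map rearrange (PermsC n) → x ∈ Perms n
    sub {x} m with ∈-map⁻ rearrange m
    ... | σ , mσ , refl = Perms-complete n (rearrange σ) (rearrange-IsPerm n σ (PermsC-IsPerm n σ mσ))

  module BD = BigDropFamily 1 b b ≤-refl refl bigDropStat (λ n w ip → cong (λ z → pairCount (bigDrop 1 b) (suc z) w) (IsPerm-length ip)) refl

  countB-Perms≡Arec : ∀ n k → countB (λ z → S z ≡ᵇ k) (Perms n) ≡ Arec (length Γ) n k
  countB-Perms≡Arec n k = trans (sym (countB-PermsC≡Perms n (λ z → S z ≡ᵇ k)))
    (trans (countB-ext (PermsC n) (λ σ m → cong (_≡ᵇ k) (S≡bigDropStat-rearrange n σ (PermsC-IsPerm n σ m))))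
    (trans (countB-rearrange n (λ u → bigDropStat u ≡ᵇ k))
    (trans (BD.countB-Perms≡Arec n k) (cong (λ z → Arec z n k) (trans (sym (cong (_+ b) a0)) (#Δ+#Δ'≡length Γ))))))

D'Condition⇒D-small : ∀ σ i → D'Condition σ (pos σ (suc i)) ≡ true → at σ (pos σ (suc i) ∸ 1) ≤ i
D'Condition⇒D-small σ i e with pos σ (suc i) in ep
... | zero = z≤n
... | suc zero = z≤n
... | suc (suc p') = ≤-pred (≤-trans (<ᵇ≡true⇒< {at σ (suc p')} (allB-last _ p' (proj₁ (∧≡true⇒ {saillantAt σ (suc (suc p'))} e)))) (≤-reflexive atv))
  where
  atv : at σ (suc (suc p')) ≡ suc i
  atv with _∈?_ _≟_ (suc i) σ
  ... | yes m = trans (cong (at σ) (sym ep)) (at-pos σ m)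
  ... | no nm with () ← trans (sym ep) (pos-∉ σ nm)

∣applyΓ-DD'∣⁺≡∣applyΓ-D∣⁺ : ∀ Γ → 1 ≤ #Δ Γ → ∀ σ → ∣ applyΓ Γ (DD' σ) ∣⁺ ≡ ∣ applyΓ Γ (D σ) ∣⁺
∣applyΓ-DD'∣⁺≡∣applyΓ-D∣⁺ Γ a≥1 σ =
  trans (cong ∣_∣⁺ (cong (applyΓ Γ) (⊕-map (λ i → at σ (pos σ (suc i) ∸ 1) ∸ i) (λ i → ι (D'Condition σ (pos σ (suc i)))) (upTo (length σ)))))
  (trans (∣applyΓ-map-upTo∣⁺ Γ hDD (length σ))
  (trans (countB-ext (upTo (length σ ∸ (#Δ Γ + #Δ' Γ))) (λ i _ → S-rotateAround (#Δ' Γ + i)))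
    (sym (∣applyΓ-map-upTo∣⁺ Γ hD (length σ)))))
  where
  hD : ℕ → ℕ
  hD i = at σ (pos σ (suc i) ∸ 1) ∸ i
  hDD : ℕ → ℕ
  hDD i = hD i + ι (D'Condition σ (pos σ (suc i)))
  S-rotateAround : ∀ i → (suc (#Δ Γ) ≤ᵇ hDD i) ≡ (suc (#Δ Γ) ≤ᵇ hD i)
  S-rotateAround i with D'Condition σ (pos σ (suc i)) in e
  ... | false = cong (suc (#Δ Γ) ≤ᵇ_) (+-identityʳ (hD i))
  ... | true rewrite m≤n⇒m∸n≡0 (D'Condition⇒D-small σ i e) = regroup (#Δ Γ) a≥1
    where
    regroup : ∀ a → 1 ≤ a → (suc a ≤ᵇ 1) ≡ (suc a ≤ᵇ 0)
    regroup (suc a) _ = refl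

-- Cyclic permutations

InRange : ℕ → ℕ → Set
InRange m x = 1 ≤ x × x ≤ m

module Orbit (m : ℕ) (σ : List ℕ) (ip : IsPerm m σ) where
  apply : ℕ → ℕ
  apply = at σ

  length-σ : length σ ≡ m
  length-σ = IsPerm-length ip

  apply-InRange : ∀ {x} → InRange m x → InRange m (apply x)
  apply-InRange (a , b) = IsPerm-bound ip (at-∈ σ _ a (≤-trans b (≤-reflexive (sym length-σ))))

  apply-injective : ∀ {x x'} → InRange m x → InRange m x' → apply x ≡ apply x' → x ≡ x'
  apply-injective {x} {x'} (a , b) (a' , b') e =
    trans (sym (pos-at σ x (IsPerm⇒Unique ip) a (≤-trans b (≤-reflexive (sym length-σ)))))
      (trans (cong (pos σ) e) (pos-at σ x' (IsPerm⇒Unique ip) a' (≤-trans b' (≤-reflexive (sym length-σ)))))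

  pow : ℕ → ℕ → ℕ
  pow k x = iter σ k x

  pow-InRange : ∀ k {x} → InRange m x → InRange m (pow k x)
  pow-InRange zero r = r
  pow-InRange (suc k) r = apply-InRange (pow-InRange k r)

  pow-+ : ∀ k j x → pow (k + j) x ≡ pow k (pow j x)
  pow-+ zero j x = refl
  pow-+ (suc k) j x = cong apply (pow-+ k j x)

  pow-cancel : ∀ i {x x'} → InRange m x → InRange m x' → pow i x ≡ pow i x' → x ≡ x'
  pow-cancel zero r r' e = e
  pow-cancel (suc i) r r' e = pow-cancel i r r' (apply-injective (pow-InRange i r) (pow-InRange i r') e)

  orbit : ℕ → List ℕ
  orbit K = map (λ i → pow i 1) (upTo K)

  length-orbit : ∀ K → length (orbit K) ≡ K
  length-orbit K = trans (length-map _ (upTo K)) (length-upTo K)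

  module _ (m≥1 : 1 ≤ m) where
    1-InRange : InRange m 1
    1-InRange = s≤s z≤n , m≥1

    Unique-orbit : ∀ K → (∀ d → 1 ≤ d → d < K → pow d 1 ≢ 1) → Unique (orbit K)
    Unique-orbit K H = subst Unique (sym (map-upTo (λ i → pow i 1) K)) (UP.applyUpTo⁺₁ (λ i → pow i 1) K ne)
      where
      ne : ∀ {i j} → i < j → j < K → pow i 1 ≢ pow j 1
      ne {i} {j} i<j j<K e = H (j ∸ i) (m<n⇒0<n∸m i<j) (≤-trans (s≤s (m∸n≤m j i)) j<K)
        (pow-cancel i (pow-InRange (j ∸ i) 1-InRange) 1-InRange (trans (sym (pow-+ i (j ∸ i) 1)) (trans (cong (λ t → pow t 1) (m+[n∸m]≡n (<⇒≤ i<j))) (sym e))))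

    orbit⊆range : ∀ K {x} → x ∈ orbit K → x ∈ range m
    orbit⊆range K mx with ∈-map⁻ (λ i → pow i 1) mx
    ... | i , _ , refl = ∈-range⁺ (proj₁ (pow-InRange i 1-InRange)) (proj₂ (pow-InRange i 1-InRange))

    periodic-pow : ∀ k → 1 ≤ k → pow k 1 ≡ 1 → ∀ t → ∃ λ i → i < k × pow t 1 ≡ pow i 1
    periodic-pow k k≥1 e zero = 0 , k≥1 , refl
    periodic-pow k k≥1 e (suc t) with periodic-pow k k≥1 e t
    ... | i , i<k , e' with suc i <? k
    ... | yes si<k = suc i , si<k , cong apply e'
    ... | no si≮k = 0 , k≥1 , trans (cong apply e') (trans (cong (λ z → pow z 1) (≤-antisym i<k (≮⇒≥ si≮k))) e)

    pow∈orbit : ∀ k → 1 ≤ k → pow k 1 ≡ 1 → ∀ t → pow t 1 ∈ orbit k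
    pow∈orbit k k≥1 e t with periodic-pow k k≥1 e t
    ... | i , i<k , e' = subst (_∈ orbit k) (sym e') (∈-map⁺ (λ i → pow i 1) (∈-upTo⁺ i<k))

    noReturn⇒⊥ : (∀ d → 1 ≤ d → d ≤ m → pow d 1 ≢ 1) → ⊥
    noReturn⇒⊥ H = 1+n≰n (≤-trans (≤-reflexive (sym (length-orbit (suc m))))
      (≤-trans (unique-⊆⇒length≤ (orbit (suc m)) (range m) (Unique-orbit (suc m) (λ d a b → H d a (≤-pred b))) (orbit⊆range (suc m)))
        (≤-reflexive (length-range m))))

    orbit-covers : (∀ d → 1 ≤ d → d < m → pow d 1 ≢ 1) → ∀ {v} → v ∈ range m → v ∈ orbit m
    orbit-covers H {v} mv = 1≤countB⇒∈ (orbit m) (≤-trans 1≤countB-range (≤-reflexive (sym (countB-orbit≡range (λ x → x ≡ᵇ v)))))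
      where
      countB-orbit≡range : ∀ q → countB q (orbit m) ≡ countB q (range m)
      countB-orbit≡range = unique-⊆-length≥⇒countB≡ (orbit m) (range m) (Unique-orbit m H) (orbit⊆range m) (≤-reflexive (trans (length-range m) (sym (length-orbit m))))
      1≤countB-range : 1 ≤ countB (λ x → x ≡ᵇ v) (range m)
      1≤countB-range = ∈⇒1≤countB (λ x → x ≡ᵇ v) (range m) mv (≡⇒≡ᵇ≡true {v} refl)
      1≤countB⇒∈ : ∀ L → 1 ≤ countB (λ x → x ≡ᵇ v) L → v ∈ L
      1≤countB⇒∈ (x ∷ L) c with x ≡ᵇ v in e
      ... | true = here (sym (≡ᵇ≡true⇒≡ e))
      ... | false = there (1≤countB⇒∈ L c)

isCyclic-true⇒ : ∀ σ → isCyclic σ ≡ true → ∀ d → 1 ≤ d → d < length σ → iter σ d 1 ≢ 1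
isCyclic-true⇒ σ e (suc k) _ lt eq = ≡ᵇ≡false⇒≢ (not≡true⇒ (allB-∀ _ (upTo (length σ ∸ 1)) e (∈-upTo⁺ (suc<⇒<∸1 lt)))) eq

isCyclic-true⇐ : ∀ σ → (∀ d → 1 ≤ d → d < length σ → iter σ d 1 ≢ 1) → isCyclic σ ≡ true
isCyclic-true⇐ σ h = allB-∀⁻ _ (upTo (length σ ∸ 1)) (λ {k} m → cong not (≢⇒≡ᵇ≡false (h (suc k) (s≤s z≤n) (<∸1⇒suc< (∈-upTo⁻ m)))))

isCyclic-false⇒ : ∀ σ → isCyclic σ ≡ false → ∃ λ d → 1 ≤ d × d < length σ × iter σ d 1 ≡ 1
isCyclic-false⇒ σ e with allB-∃ _ (upTo (length σ ∸ 1)) e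
... | k , m , pk = suc k , s≤s z≤n , <∸1⇒suc< (∈-upTo⁻ m) , ≡ᵇ≡true⇒≡ (not≡false⇒ pk)

isCyclic-false⇐ : ∀ σ d → 1 ≤ d → d < length σ → iter σ d 1 ≡ 1 → isCyclic σ ≡ false
isCyclic-false⇐ σ (suc k) _ lt e = allB-∃⁻ _ (upTo (length σ ∸ 1)) (∈-upTo⁺ (suc<⇒<∸1 lt)) (cong not (≡⇒≡ᵇ≡true e))

cycleInserts-shape : ∀ A y c → c ∈ cycleInserts A y → ∃ λ p → ∃ λ z → ∃ λ q → y ≡ p ++ z ∷ q × c ≡ p ++ A ∷ (q ∷ʳ z)
cycleInserts-shape A (z ∷ q) .(A ∷ q ∷ʳ z) (here refl) = [] , z , q , refl , refl
cycleInserts-shape A (z ∷ q) c (there m) with ∈-map⁻ (z ∷_) m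
... | c' , m' , refl with cycleInserts-shape A q c' m'
... | p , z' , q' , refl , refl = z ∷ p , z' , q' , refl , refl

-- The orbit of 1 under c is that of y with the detour j ↦ Aₘ ↦ y j, so c is cyclic iff y is.
module CycleInsertOrbit (m : ℕ) (m≥1 : 1 ≤ m) (y : List ℕ) (ipy : IsPerm m y) (p : List ℕ) (z : ℕ) (q : List ℕ)
  (ey : y ≡ p ++ z ∷ q) (ipc : IsPerm (suc m) (p ++ suc m ∷ (q ∷ʳ z))) where

  Aₘ : ℕ
  Aₘ = suc m
  c : List ℕ
  c = p ++ Aₘ ∷ (q ∷ʳ z)
  j : ℕ
  j = suc (length p)

  module Y = Orbit m y ipy
  module C = Orbit (suc m) c ipc

  m≡length : m ≡ length p + suc (length q)
  m≡length = trans (sym (IsPerm-length ipy)) (trans (cong length ey) (length-++ p))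

  j≤m : j ≤ m
  j≤m = ≤-trans (≤-reflexive (+-comm 1 (length p))) (≤-trans (+-monoʳ-≤ (length p) (s≤s z≤n)) (≤-reflexive (sym m≡length)))

  c-at-j : at c j ≡ Aₘ
  c-at-j = trans (cong (at c) (+-comm 1 (length p))) (at-++ʳ p (Aₘ ∷ (q ∷ʳ z)) 0)

  c-at-new : at c Aₘ ≡ z
  c-at-new = trans (cong (λ t → at t Aₘ) (sym (++-assoc p (Aₘ ∷ q) [ z ])))
        (trans (cong (λ t → at ((p ++ Aₘ ∷ q) ++ [ z ]) (suc t)) (trans m≡length (sym (length-++ p))))
          (at-++-suc-length (p ++ Aₘ ∷ q) z []))

  y-at-j : at y j ≡ z
  y-at-j = trans (cong (λ t → at t j) ey) (at-++-suc-length p z q)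

  c-at-other : ∀ x → InRange m x → x ≢ j → at c x ≡ at y x
  c-at-other x (x≥1 , x≤m) ne with x ≤? length p
  ... | yes le = trans (at-++ˡ p _ x x≥1 le) (sym (trans (cong (λ t → at t x) ey) (at-++ˡ p _ x x≥1 le)))
  ... | no nle with x ∸ length p in ex
  ... | zero with () ← nle (m∸n≡0⇒m≤n ex)
  ... | suc zero with () ← ne (trans (sym (m+[n∸m]≡n (<⇒≤ (≰⇒> nle)))) (trans (cong (length p +_) ex) (+-comm (length p) 1)))
  ... | suc (suc i) = trans (cong (at c) xe) (trans (at-++ʳ p (Aₘ ∷ (q ∷ʳ z)) (suc i))
      (trans (at-++ˡ q [ z ] (suc i) (s≤s z≤n) i<q) (sym (trans (cong (λ t → at t x) ey) (trans (cong (at (p ++ z ∷ q)) xe) (at-++ʳ p (z ∷ q) (suc i)))))))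
    where
    xe : x ≡ length p + suc (suc i)
    xe = trans (sym (m+[n∸m]≡n (<⇒≤ (≰⇒> nle)))) (cong (length p +_) ex)
    i<q : suc i ≤ length q
    i<q = ≤-pred (+-cancelˡ-≤ (length p) (suc (suc i)) (suc (length q)) (≤-trans (≤-reflexive (sym xe)) (≤-trans x≤m (≤-reflexive m≡length))))

  visits-j : ℕ → ℕ
  visits-j s = countB (λ i → Y.pow i 1 ≡ᵇ j) (upTo s)

  pow-c≡pow-y : ∀ s → C.pow (s + visits-j s) 1 ≡ Y.pow s 1
  pow-c≡pow-y zero = refl
  pow-c≡pow-y (suc s) with Y.pow s 1 ≡ᵇ j in e
  ... | true = trans (cong (λ t → C.pow t 1) ar) (trans (cong (λ t → at c (at c t)) (pow-c≡pow-y s))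
               (trans (cong (λ t → at c (at c t)) (≡ᵇ≡true⇒≡ {Y.pow s 1} {j} e)) (trans (cong (at c) c-at-j) (trans c-at-new (trans (sym y-at-j) (cong (at y) (sym (≡ᵇ≡true⇒≡ {Y.pow s 1} {j} e))))))))
    where
    ar : suc s + countB (λ i → Y.pow i 1 ≡ᵇ j) (upTo (suc s)) ≡ suc (suc (s + visits-j s))
    ar rewrite countB-upTo-sucʳ (λ i → Y.pow i 1 ≡ᵇ j) s | e = cong suc (trans (cong (s +_) (+-comm (visits-j s) 1)) (+-suc s (visits-j s)))
  ... | false = trans (cong (λ t → C.pow t 1) ar) (trans (cong (at c) (pow-c≡pow-y s)) (c-at-other (Y.pow s 1) (Y.pow-InRange s (Y.1-InRange m≥1)) (≡ᵇ≡false⇒≢ e)))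
    where
    ar : suc s + countB (λ i → Y.pow i 1 ≡ᵇ j) (upTo (suc s)) ≡ suc (s + visits-j s)
    ar rewrite countB-upTo-sucʳ (λ i → Y.pow i 1 ≡ᵇ j) s | e = cong suc (cong (s +_) (+-identityʳ _))

  pow-c-reaches-new : ∀ s → Y.pow s 1 ≡ j → C.pow (suc (s + visits-j s)) 1 ≡ Aₘ
  pow-c-reaches-new s e = trans (cong (at c) (trans (pow-c≡pow-y s) e)) c-at-j

  length-c : length c ≡ suc m
  length-c = IsPerm-length ipc

  cyclic⇒cyclic : isCyclic y ≡ true → isCyclic c ≡ true
  cyclic⇒cyclic cy = isCyclic-true⇐ c (λ k k≥1 k< e → c-noReturn k k≥1 (≤-pred (≤-trans k< (≤-reflexive length-c))) e)
    where
    y-noReturn : ∀ d → 1 ≤ d → d < m → Y.pow d 1 ≢ 1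
    y-noReturn d a b = isCyclic-true⇒ y cy d a (≤-trans b (≤-reflexive (sym (IsPerm-length ipy))))
    L : List ℕ
    L = Y.orbit m ∷ʳ Aₘ
    Unique-L : Unique L
    Unique-L = UP.++⁺ (Y.Unique-orbit m≥1 m y-noReturn) ([] ∷ []) disj
      where
      disj : ∀ {v} → v ∈ Y.orbit m × v ∈ [ Aₘ ] → ⊥
      disj (mv , here refl) = 1+n≰n (proj₂ (∈-range⁻ (Y.orbit⊆range m≥1 m mv)))
    c-noReturn : ∀ k → 1 ≤ k → k ≤ m → C.pow k 1 ≡ 1 → ⊥
    c-noReturn k k≥1 k≤m e = 1+n≰n (≤-trans (≤-reflexive (sym length-L)) (≤-trans (unique-⊆⇒length≤ L (C.orbit k) Unique-L sub) (≤-trans (≤-reflexive (C.length-orbit k)) k≤m)))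
      where
      length-L : length L ≡ suc m
      length-L = trans (length-++ (Y.orbit m)) (trans (+-comm (length (Y.orbit m)) 1) (cong suc (Y.length-orbit m)))
      pow-c∈orbit : ∀ t → C.pow t 1 ∈ C.orbit k
      pow-c∈orbit = C.pow∈orbit (s≤s z≤n) k k≥1 e
      sub : ∀ {v} → v ∈ L → v ∈ C.orbit k
      sub mv with ∈-++⁻ (Y.orbit m) mv
      ... | inj₁ mo with ∈-map⁻ (λ i → Y.pow i 1) mo
      ... | s , _ , refl = subst (_∈ C.orbit k) (pow-c≡pow-y s) (pow-c∈orbit (s + visits-j s))
      sub mv | inj₂ (here refl) with ∈-map⁻ (λ i → Y.pow i 1) (Y.orbit-covers m≥1 y-noReturn (∈-range⁺ (s≤s z≤n) j≤m))
      ... | s , _ , es = subst (_∈ C.orbit k) (pow-c-reaches-new s (sym es)) (pow-c∈orbit (suc (s + visits-j s)))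

  acyclic⇒acyclic : isCyclic y ≡ false → isCyclic c ≡ false
  acyclic⇒acyclic ncy with isCyclic-false⇒ y ncy
  ... | d₀ , d₀≥1 , d₀< , e₀ = go (firstWitness (λ i → Y.pow (suc i) 1 ≡ᵇ 1) d₀ (d₀ ∸ 1 , lt₀ , ≡⇒≡ᵇ≡true (trans (cong (λ t → Y.pow t 1) (suc[d∸1]≡d d₀≥1)) e₀)))
    where
    suc[d∸1]≡d : ∀ {d} → 1 ≤ d → suc (d ∸ 1) ≡ d
    suc[d∸1]≡d {suc d} _ = refl
    lt₀ : d₀ ∸ 1 < d₀
    lt₀ = ≤-trans (≤-reflexive (suc[d∸1]≡d d₀≥1)) ≤-refl
    go : (∃ λ i → i < d₀ × (Y.pow (suc i) 1 ≡ᵇ 1) ≡ true × (∀ i' → i' < i → (Y.pow (suc i') 1 ≡ᵇ 1) ≡ false)) → isCyclic c ≡ false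
    go (i , i<d₀ , ei , earlier-false) = isCyclic-false⇐ c τ (s≤s z≤n) τ< (trans (pow-c≡pow-y d) (≡ᵇ≡true⇒≡ ei))
      where
      d : ℕ
      d = suc i
      y-noEarlyReturn : ∀ d' → 1 ≤ d' → d' < d → Y.pow d' 1 ≢ 1
      y-noEarlyReturn (suc d') _ (s≤s lt) e' = ≡ᵇ≡false⇒≢ (earlier-false d' lt) e'
      τ : ℕ
      τ = d + visits-j d
      c≤1 : visits-j d ≤ 1
      c≤1 = ≤-trans (≤-reflexive (sym (countB-map (λ x → x ≡ᵇ j) (λ i → Y.pow i 1) (upTo d)))) (Unique⇒countB-≡ᵇ≤1 j (Y.orbit d) (Y.Unique-orbit m≥1 d y-noEarlyReturn))
      d<m : d < m
      d<m = ≤-trans (s≤s i<d₀) (≤-trans d₀< (≤-reflexive (IsPerm-length ipy)))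
      τ< : τ < length c
      τ< = ≤-trans (s≤s (+-mono-≤ (≤-refl {d}) c≤1)) (≤-trans (≤-reflexive (cong suc (+-comm d 1))) (≤-trans (s≤s d<m) (≤-reflexive (sym length-c))))

∷ʳ-top-notCyclic : ∀ m → 1 ≤ m → ∀ y → IsPerm m y → isCyclic (y ∷ʳ suc m) ≡ false
∷ʳ-top-notCyclic m m≥1 y ipy = returns (allB (λ k → not (Y.pow (suc k) 1 ≡ᵇ 1)) (upTo m)) refl
  where
  module Y = Orbit m y ipy
  length-y∷ʳ : length (y ∷ʳ suc m) ≡ suc m
  length-y∷ʳ = trans (length-∷ʳ y (suc m)) (cong suc (IsPerm-length ipy))
  iter≡pow : ∀ t → iter (y ∷ʳ suc m) t 1 ≡ Y.pow t 1
  iter≡pow zero = refl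
  iter≡pow (suc t) = trans (cong (at (y ∷ʳ suc m)) (iter≡pow t))
    (at-++ˡ y [ suc m ] (Y.pow t 1) (proj₁ (Y.pow-InRange t (Y.1-InRange m≥1))) (≤-trans (proj₂ (Y.pow-InRange t (Y.1-InRange m≥1))) (≤-reflexive (sym (IsPerm-length ipy)))))
  returns : ∀ b → allB (λ k → not (Y.pow (suc k) 1 ≡ᵇ 1)) (upTo m) ≡ b → isCyclic (y ∷ʳ suc m) ≡ false
  returns true eB = ⊥-elim (Y.noReturn⇒⊥ m≥1 (λ { (suc k) _ d≤m e → ≡ᵇ≡false⇒≢ (not≡true⇒ (allB-∀ _ (upTo m) eB (∈-upTo⁺ d≤m))) e }))
  returns false eB with allB-∃ _ (upTo m) eB
  ... | k , mk , pk = isCyclic-false⇐ (y ∷ʳ suc m) (suc k) (s≤s z≤n) (≤-trans (s≤s (∈-upTo⁻ mk)) (≤-reflexive (sym length-y∷ʳ)))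
    (trans (iter≡pow (suc k)) (≡ᵇ≡true⇒≡ (not≡false⇒ pk)))

countB-cyclic-cycleInsertAll : ∀ m → 1 ≤ m → ∀ y → y ∈ PermsC m → ∀ (P : List ℕ → Bool) →
  countB (λ c → isCyclic c ∧ P c) (cycleInsertAll (suc m) y) ≡ (if isCyclic y then countB P (cycleInserts (suc m) y) else 0)
countB-cyclic-cycleInsertAll m m≥1 y my P =
  trans (countB-++ _ (cycleInserts (suc m) y) [ y ∷ʳ suc m ])
  (trans (cong₂ _+_ (countB-ext (cycleInserts (suc m) y) same) (cong (λ b → ι (b ∧ P (y ∷ʳ suc m)) + 0) (∷ʳ-top-notCyclic m m≥1 y ipy)))
  (trans (+-identityʳ _) (fin (isCyclic y))))
  where
  ipy : IsPerm m y
  ipy = PermsC-IsPerm m y my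
  same : ∀ c → c ∈ cycleInserts (suc m) y → (isCyclic c ∧ P c) ≡ (isCyclic y ∧ P c)
  same c mc with cycleInserts-shape (suc m) y c mc
  ... | p , z , q , ey , refl = cong (_∧ P _) (eqc (isCyclic y) refl)
    where
    ipc : IsPerm (suc m) (p ++ suc m ∷ (q ∷ʳ z))
    ipc = PermsC-IsPerm (suc m) _ (∈-concatMap⁺ (cycleInsertAll (suc m)) (PermsC m) my (∈-++⁺ˡ mc))
    module CO = CycleInsertOrbit m m≥1 y ipy p z q ey ipc
    eqc : ∀ b → isCyclic y ≡ b → isCyclic (p ++ suc m ∷ (q ∷ʳ z)) ≡ b
    eqc true e = CO.cyclic⇒cyclic e
    eqc false e = CO.acyclic⇒acyclic e
  fin : ∀ b → countB (λ c → b ∧ P c) (cycleInserts (suc m) y) ≡ (if b then countB P (cycleInserts (suc m) y) else 0)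
  fin true = refl
  fin false = countB-none _ (cycleInserts (suc m) y) (λ _ _ → refl)

module CyclicFamily (Γ : List Op) where
  Γ' : List Op
  Γ' = Γ ++ [ δ ]
  a' : ℕ
  a' = #Δ Γ'
  b' : ℕ
  b' = #Δ' Γ'
  r : ℕ
  r = length Γ
  h : ℕ → ℕ → Bool
  h = bigRise a' b'

  S : List ℕ → ℕ
  S ρ = ∣ applyΓ Γ (Δ (E ρ)) ∣⁺

  S-unfold : ∀ n ρ → IsPerm n ρ → S ρ ≡ indexCount h 0 ρ
  S-unfold n ρ ip = trans (cong ∣_∣⁺ (applyΓ-Δ Γ (E ρ)))
    (trans (cong (λ t → ∣ applyΓ Γ' (Data.List.map (λ i → at ρ (suc i) ∸ i) (upTo t)) ∣⁺) (IsPerm-length ip))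
    (trans (∣applyΓ-excess∣⁺ Γ' n (λ i → at ρ (suc i)) (λ i → at-bound ip (suc i)))
    (trans (cong (λ t → countB (λ i → (b' ≤ᵇ i) ∧ (suc i + a' ≤ᵇ at ρ (suc i))) (upTo t)) (sym (IsPerm-length ip)))
      (countB-upTo≡indexCount h 0 ρ))))

  X : ℕ → List (List ℕ)
  X n = filterB isCyclic (PermsC (suc n))

  S-[1] : S (1 ∷ []) ≡ 0
  S-[1] rewrite applyΓ-[] Γ = refl

  base : ∀ k → countB (λ z → S z ≡ᵇ k) (X 0) ≡ Arec r 0 k
  base zero rewrite S-[1] = refl
  base (suc k) rewrite S-[1] = refl

  module _ (n : ℕ) where
    mono : ∀ o z → z < suc (suc n) → h o z ≡ true → h o (suc (suc n)) ≡ true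
    mono o z z<A e with ∧≡true⇒ {b' ≤ᵇ o} e
    ... | e1 , e2 = ∧-intro e1 (≤⇒≤ᵇ≡true (≤-trans (≤ᵇ≡true⇒≤ {suc o + a'} e2) (<⇒≤ z<A)))
    h-last-false : ∀ z → z < suc (suc n) → h (suc n) z ≡ false
    h-last-false z z<A = ∧-falseʳ (b' ≤ᵇ suc n) (>⇒≤ᵇ≡false (≤-trans z<A (m≤m+n (suc (suc n)) a')))

  childStats : ∀ n y → y ∈ X n → ChildStats (suc n) (suc n ∸ r) (S y) (map S (cycleInserts (suc (suc n)) y))
  childStats n y my = record
    { δs = CL.cycleDeltas 0 y
    ; stats≡ = trans (map-cong-∈ (cycleInserts A' y) (λ z mz → S-unfold (suc (suc n)) z (PermsC-IsPerm (suc (suc n)) z (∈-concatMap⁺ (cycleInsertAll A') (PermsC (suc n)) my' (∈-++⁺ˡ mz)))))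
             (trans (CL.indexCount-cycleInserts 0 y (IsPerm-length ip) bnd) (cong (λ t → map (t +_) (CL.cycleDeltas 0 y)) (sym (S-unfold (suc n) y ip))))
    ; δs≤1 = CL.cycleDeltas-≤1 0 y
    ; length-δs = trans (CL.length-cycleDeltas 0 y) (IsPerm-length ip)
    ; s+sum-δs≡c = trans (cong (_+ sum (CL.cycleDeltas 0 y)) (S-unfold (suc n) y ip))
             (trans (CL.sum-cycleDeltas 0 y bnd)
             (trans (cong (λ t → countB (λ i → h i A') (upTo t)) (IsPerm-length ip))
             (trans (countB-ext (upTo (suc n)) (λ i _ → cong ((b' ≤ᵇ i) ∧_) (≤ᵇ-suc (i + a') (suc n))))
             (trans (countB-interval b' a' (suc n) (suc n) (∸-monoʳ-≤ (suc (suc n)) (1≤#Δ-∷ʳδ Γ)))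
             (trans (∸-+-assoc (suc (suc n)) a' b') (cong (suc (suc n) ∸_) (#Δ+#Δ'-∷ʳδ Γ)))))))
    }
    where
    A' : ℕ
    A' = suc (suc n)
    module CL = CycleInsertion h A' (suc n) (mono n) (h-last-false n)
    my' : y ∈ PermsC (suc n)
    my' = proj₁ (∈-filterB isCyclic (PermsC (suc n)) my)
    ip : IsPerm (suc n) y
    ip = PermsC-IsPerm (suc n) y my'
    bnd : All (_< A') y
    bnd = All.tabulate (λ m → s≤s (proj₂ (IsPerm-bound ip m)))

  step : ∀ n k → countB (λ z → S z ≡ᵇ k) (X (suc n)) ≡ sumL (λ y → childCount (suc n) (suc n ∸ r) (S y) k) (X n)
  step n k =
    trans (countB-filterB (λ z → S z ≡ᵇ k) isCyclic (PermsC (suc (suc n))))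
    (trans (countB-concatMap _ (cycleInsertAll (suc (suc n))) (PermsC (suc n)))
    (trans (sumL-ext (PermsC (suc n)) (λ y my → countB-cyclic-cycleInsertAll (suc n) (s≤s z≤n) y my (λ z → S z ≡ᵇ k)))
    (trans (sym (sumL-filterB (λ y → countB (λ z → S z ≡ᵇ k) (cycleInserts (suc (suc n)) y)) isCyclic (PermsC (suc n))))
    (sumL-ext (X n) (λ y my → trans (sym (countB-map (λ t → t ≡ᵇ k) S (cycleInserts (suc (suc n)) y))) (ChildStats⇒countB (childStats n y my) k))))))

  countB-cyclic≡Arec : ∀ n k → countB (λ z → S z ≡ᵇ k) (X n) ≡ Arec r n k
  countB-cyclic≡Arec = ArecFamily.countB≡Arec r X (λ _ → S) base step

  θ≡Arec : ∀ n k → θ (λ σ → applyΓ Γ (Δ (E σ))) (Cyc n) k ≡ Arec r n k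
  θ≡Arec n k = trans (countB-filterB (λ z → S z ≡ᵇ k) isCyclic (Perms (suc n)))
    (trans (sym (countB-PermsC≡Perms (suc n) (λ z → isCyclic z ∧ (S z ≡ᵇ k))))
    (trans (sym (countB-filterB (λ z → S z ≡ᵇ k) isCyclic (PermsC (suc n)))) (countB-cyclic≡Arec n k)))

θ-E≡Arec : ∀ Γ n k → θ (λ σ → applyΓ Γ (E σ)) (Perms n) k ≡ Arec (length Γ) n k
θ-E≡Arec Γ n k = trans (ExcedanceFamily.countB-Perms≡Arec (#Δ Γ) (#Δ' Γ) S S-unfold S-[] n k) (cong (λ t → Arec t n k) (#Δ+#Δ'≡length Γ))
  where
  S : List ℕ → ℕ
  S σ = ∣ applyΓ Γ (E σ) ∣⁺
  S-unfold : ∀ n σ → IsPerm n σ → S σ ≡ indexCount (bigRise (#Δ Γ) (#Δ' Γ)) 0 σ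
  S-unfold n σ ip = trans (cong (λ t → ∣ applyΓ Γ (map (λ i → at σ (suc i) ∸ i) (upTo t)) ∣⁺) (IsPerm-length ip))
    (trans (∣applyΓ-excess∣⁺ Γ n (λ i → at σ (suc i)) (λ i → at-bound ip (suc i)))
    (trans (cong (λ t → countB (λ i → (#Δ' Γ ≤ᵇ i) ∧ (suc i + #Δ Γ ≤ᵇ at σ (suc i))) (upTo t)) (sym (IsPerm-length ip)))
      (countB-upTo≡indexCount (bigRise (#Δ Γ) (#Δ' Γ)) 0 σ)))
  S-[] : S [] ≡ 0
  S-[] rewrite applyΓ-[] Γ = refl

A≡Arec : ∀ r n k → A r n k ≡ Arec r n k
A≡Arec r n k = trans (ExcedanceFamily.countB-Perms≡Arec r 0 (excR r) (λ n σ ip → countB-upTo≡indexCount (bigRise r 0) 0 σ) refl n k) (cong (λ t → Arec t n k) (+-identityʳ r))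

θ-D≡Arec : ∀ Γ → 1 ≤ #Δ Γ → ∀ n k → θ (λ σ → applyΓ Γ (D σ)) (Perms n) k ≡ Arec (length Γ) n k
θ-D≡Arec Γ a≥1 = DFamily.countB-Perms≡Arec Γ a≥1

θ-M≡Arec : ∀ Γ n k → θ (λ σ → applyΓ Γ (M σ)) (Perms n) k ≡ Arec (length Γ) n k
θ-M≡Arec Γ = MFamily.countB-Perms≡Arec Γ

θ-DD'≡Arec : ∀ Γ n k → θ (λ σ → applyΓ Γ (DD' σ)) (Perms n) k ≡ Arec (length Γ) n k
θ-DD'≡Arec Γ n k with #Δ Γ in e
... | zero = DD'Family.countB-Perms≡Arec Γ e n k
... | suc _ = trans (countB-ext (Perms n) (λ σ _ → cong (_≡ᵇ k) (∣applyΓ-DD'∣⁺≡∣applyΓ-D∣⁺ Γ 1≤#Δ σ))) (θ-D≡Arec Γ 1≤#Δ n k)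
  where
  1≤#Δ : 1 ≤ #Δ Γ
  1≤#Δ = subst (1 ≤_) (sym e) (s≤s z≤n)

θ-ΔE-Cyc≡Arec : ∀ Γ n k → θ (λ σ → applyΓ Γ (Δ (E σ))) (Cyc n) k ≡ Arec (length Γ) n k
θ-ΔE-Cyc≡Arec Γ = CyclicFamily.θ≡Arec Γ

countB-PermsTop : ∀ n (P : List ℕ → Bool) → countB P (PermsTop n) ≡ countB (λ y → P (suc n ∷ y)) (Perms n)
countB-PermsTop n P = trans (countB-filterB P _ (Perms (suc n)))
  (trans (countB-concatMap _ (insertAll (suc n)) (Perms n))
  (trans (sumL-ext (Perms n) kid) (sym (sumcount (Perms n)))))
  where
  q : List ℕ → Bool
  q σ = (at σ 1 ≡ᵇ suc n) ∧ P σ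
  kid : ∀ y → y ∈ Perms n → countB q (insertAll (suc n) y) ≡ ι (P (suc n ∷ y))
  kid [] _ rewrite ≡⇒≡ᵇ≡true {suc n} refl = +-identityʳ _
  kid (x ∷ xs) my rewrite ≡⇒≡ᵇ≡true {suc n} refl =
    trans (cong (ι (P (suc n ∷ x ∷ xs)) +_) (trans (countB-map q (x ∷_) (insertAll (suc n) xs))
      (countB-none _ (insertAll (suc n) xs) (λ z _ → cong (_∧ P (x ∷ z)) (≢⇒≡ᵇ≡false x≢)))))
      (+-identityʳ _)
    where
    x≢ : x ≢ suc n
    x≢ e' = 1+n≰n (≤-trans (≤-reflexive (sym e')) (proj₂ (IsPerm-bound (Perms-IsPerm n _ my) (here refl))))
  sumcount : ∀ L → countB (λ y → P (suc n ∷ y)) L ≡ sumL (λ y → ι (P (suc n ∷ y))) L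
  sumcount [] = refl
  sumcount (y ∷ L) = cong (ι (P (suc n ∷ y)) +_) (sumcount L)

θ-ΔD-PermsTop≡Arec : ∀ Γ n k → θ (λ σ → applyΓ Γ (Δ (D σ))) (PermsTop n) k ≡ Arec (length Γ) n k
θ-ΔD-PermsTop≡Arec Γ n k = trans (countB-PermsTop n (λ σ → ∣ applyΓ Γ (Δ (D σ)) ∣⁺ ≡ᵇ k))
  (trans (countB-ext (Perms n) (λ y my → cong (λ t → S' (t ∷ y) ≡ᵇ k) (cong suc (sym (IsPerm-length (Perms-IsPerm n y my))))))
    (BD.countB-Perms≡Arec n k))
  where
  Γ' : List Op
  Γ' = Γ ++ [ δ ]
  a' : ℕ
  a' = #Δ Γ'
  b' : ℕ
  b' = #Δ' Γ'
  S' : List ℕ → ℕ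
  S' σ = ∣ applyΓ Γ (Δ (D σ)) ∣⁺
  S : List ℕ → ℕ
  S w = S' (suc (length w) ∷ w)
  S-unfold : ∀ n w → IsPerm n w → S w ≡ pairCount (bigDrop a' b') (suc n) w
  S-unfold n w ip = trans (cong (λ t → S' (suc t ∷ w)) (IsPerm-length ip))
    (trans (cong ∣_∣⁺ (applyΓ-Δ Γ (D (suc n ∷ w))))
    (trans (DStatistic.S-unfold Γ' (suc n) (suc n ∷ w) ip')
      (cong (_+ pairCount (bigDrop a' b') (suc n) w) (cong ι (∧-falseʳ (suc b' ≤ᵇ suc n) (>⇒≤ᵇ≡false {suc n + a'} {0} (s≤s z≤n)))))))
    where
    ip' : IsPerm (suc n) (suc n ∷ w)
    ip' = subst (λ t → (suc n ∷ w) ↭ t) (sym (range-suc n)) (↭-trans (∷↭∷ʳ (suc n) w) (++⁺ʳ [ suc n ] ip))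
  S-[] : S [] ≡ 0
  S-[] rewrite applyΓ-[] Γ = refl
  module BD = BigDropFamily a' b' (length Γ) (1≤#Δ-∷ʳδ Γ) (#Δ+#Δ'-∷ʳδ Γ) S S-unfold S-[]

module DBound (Γ : List Op) (a0 : #Δ Γ ≡ 0) where
  open DStatistic Γ

  PSbound : ∀ N u xs → Unique (u ∷ xs) → All (_≤ N) (u ∷ xs) → pairCount g u xs ≤ countB (λ v → (suc b ≤ᵇ v) ∧ (v <ᵇ N)) xs
  PSbound N u [] _ _ = z≤n
  PSbound N u (x ∷ xs) ((u≢x ∷ _) ∷ ux) (u≤ ∷ x≤ ∷ al) = +-mono-≤ (ι-mono step) (PSbound N x xs ux (x≤ ∷ al))
    where
    step : g u x ≡ true → ((suc b ≤ᵇ x) ∧ (x <ᵇ N)) ≡ true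
    step e with ∧≡true⇒ {suc b ≤ᵇ x} e
    ... | e1 , e2 = ∧-intro e1 (<⇒<ᵇ≡true (<-≤-trans (≤∧≢⇒< (≤-trans (≤-reflexive (trans (sym (+-identityʳ x)) (cong (x +_) (sym a0)))) (≤ᵇ≡true⇒≤ {x + a} e2)) (λ e' → u≢x (sym e'))) u≤))

  statBound : ∀ n' σ → IsPerm (suc n') σ → S σ ≤ n' ∸ b
  statBound n' σ ip = ≤-trans (≤-reflexive (S-unfold (suc n') σ ip))
    (≤-trans (PSbound (suc n') 0 σ (All.tabulate (λ m e → 0∉IsPerm ip (subst (_∈ σ) (sym e) m)) ∷ IsPerm⇒Unique ip)
               (z≤n ∷ All.tabulate (λ m → proj₂ (IsPerm-bound ip m))))
    (≤-reflexive (trans (sym (countB-upTo-IsPerm ip _))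
      (trans (countB-ext (upTo (suc n')) (λ i _ → cong₂ _∧_ (≤ᵇ-suc b i) (cong (_≤ᵇ n') (sym (+-comm i 1)))))
        (countB-interval b 1 n' (suc n') (n≤1+n n'))))))

θ-D-top≡0 : ∀ Γ n' → #Δ Γ ≡ 0 → length Γ ≤ n' → θ (λ σ → applyΓ Γ (D σ)) (Perms (suc n')) (suc n' ∸ length Γ) ≡ 0
θ-D-top≡0 Γ n' a0 le = countB-none _ (Perms (suc n')) (λ σ mσ → ≢⇒≡ᵇ≡false (λ e → <-irrefl e (lt σ mσ)))
  where
  b : ℕ
  b = #Δ' Γ
  b≡ : b ≡ length Γ
  b≡ = trans (sym (cong (_+ b) a0)) (#Δ+#Δ'≡length Γ)
  lt : ∀ σ → σ ∈ Perms (suc n') → ∣ applyΓ Γ (D σ) ∣⁺ < suc n' ∸ length Γ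
  lt σ mσ = subst (λ t → ∣ applyΓ Γ (D σ) ∣⁺ < suc n' ∸ t) b≡
    (subst (∣ applyΓ Γ (D σ) ∣⁺ <_) (sym (+-∸-assoc 1 (subst (_≤ n') (sym b≡) le)))
      (s≤s (DBound.statBound Γ a0 n' σ (Perms-IsPerm (suc n') σ mσ))))

A≡-via-Arec : ∀ r n {f : ℕ → ℕ} → (∀ k → f k ≡ Arec r n k) → ∀ k → A r n k ≡ f k
A≡-via-Arec r n f≡ k = trans (A≡Arec r n k) (sym (f≡ k))

A≡θ-D⇒anyB-isΔ : ∀ Γ n → length Γ ≤ n →
  (∀ k → A (length Γ) (suc n) k ≡ θ (λ σ → applyΓ Γ (D σ)) (Perms (suc n)) k) → T (anyB isΔ Γ)
A≡θ-D⇒anyB-isΔ Γ n r≤n A≡θ with anyB isΔ Γ in e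
... | true = tt
... | false = ⊥-elim (1+n≰n (begin
  1                             ≤⟨ Arec-top-positive (length Γ) (suc n) ⟩
  Arec (length Γ) (suc n) top   ≡⟨ sym (A≡Arec (length Γ) (suc n) top) ⟩
  A (length Γ) (suc n) top      ≡⟨ A≡θ top ⟩
  θ (λ σ → applyΓ Γ (D σ)) (Perms (suc n)) top ≡⟨ θ-D-top≡0 Γ n (¬anyB-isΔ⇒#Δ≡0 Γ e) r≤n ⟩
  0                             ∎))
  where
  open ≤-Reasoning
  top : ℕ
  top = suc n ∸ length Γ

mainTheorem10 : (n r : ℕ) → 1 ≤ n → r ≤ n ∸ 1 → (Γ : List Op) → length Γ ≡ r →
    ((k : ℕ) → A r n k ≡ θ (λ σ → applyΓ Γ (E σ)) (Perms n) k)
    × ((k : ℕ) → A r n k ≡ θ (λ σ → applyΓ Γ (DD' σ)) (Perms n) k)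
    × ((k : ℕ) → A r n k ≡ θ (λ σ → applyΓ Γ (M σ)) (Perms n) k)
    × ((k : ℕ) → A r n k ≡ θ (λ σ → applyΓ Γ (Δ (E σ))) (Cyc n) k)
    × ((k : ℕ) → A r n k ≡ θ (λ σ → applyΓ Γ (Δ (D σ))) (PermsTop n) k)
    × (((k : ℕ) → A r n k ≡ θ (λ σ → applyΓ Γ (D σ)) (Perms n) k) ⇔ T (anyB isΔ Γ))
mainTheorem10 (suc n) r _ r≤n Γ refl =
  via (θ-E≡Arec Γ (suc n)) ,
  via (θ-DD'≡Arec Γ (suc n)) ,
  via (θ-M≡Arec Γ (suc n)) ,
  via (θ-ΔE-Cyc≡Arec Γ (suc n)) ,
  via (θ-ΔD-PermsTop≡Arec Γ (suc n)) ,
  mk⇔ (A≡θ-D⇒anyB-isΔ Γ n r≤n) (λ t → via (θ-D≡Arec Γ (anyB-isΔ⇒1≤#Δ Γ (T⇒≡true t)) (suc n)))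
  where
  via : ∀ {f : ℕ → ℕ} → (∀ k → f k ≡ Arec (length Γ) (suc n) k) → ∀ k → A (length Γ) (suc n) k ≡ f k
  via = A≡-via-Arec (length Γ) (suc n)
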